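{- Let $T$ be a triangulation of a convex polygon and $\gamma$ a diagonal not in $T$; let $p_0,\dots,p_{d+1}$ be the points of intersection of $\gamma$ with $T'$ in order ($p_0,p_{d+1}$ the endpoints of $\gamma$) and $\tau_{i_1},\dots,\tau_{i_d}$ the diagonals of $T'$ crossed by $\gamma$, in order. In the construction of the snake graph $G_{T,\gamma}$ from $T'$: (1) each balanced diagonal $e\in\{\tau_{i_2},\dots,\tau_{i_{d-1}}\}$ becomes two identically labeled exterior edges of $G_{T,\gamma}$ that are parallel and a northwest–southeast knight's move apart, and the tile between the two tiles containing these edges is not a corner; (2) each imbalanced diagonal $e\in\{\tau_{i_2},\dots,\tau_{i_{d-1}}\}$ becomes two identically labeled exterior edges of $G_{T,\gamma}$ that are perpendicular and share a vertex, and the tile between the two tiles containing these edges is a corner; (3) each boundary segment of $T'$ not incident to $\gamma$ becomes an interior edge of $G_{T,\gamma}$ whose label appears on no other edge; (4) the two boundary segments of $T'$ incident to $p_0$ become the bottom and left edges of the first tile, each uniquely labeled in $G_{T,\gamma}$; the two boundary segments incident to $p_{d+1}$ become the top and right edges of the last tile, each uniquely labeled; (5) if $T'$ is not a triangulated quadrilateral, $\tau_{i_1}$ becomes the uniquely labeled edge $x_{i_1}$ on the left or bottom exterior edge (whichever exists) of the second tile, and $\tau_{i_d}$ becomes the uniquely labeled edge $x_{i_d}$ on the right or top exterior edge (whichever exists) of the penultimate tile; if $T'$ is a quadrilateral, its lone diagonal is not a label in $G_{T,\gamma}$; (6) $G_{T,\gamma}$ has exactly $d=|D(\gamma)|$ tiles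 (boxes).
   Context: $T$ is a triangulation of a convex polygon with edges $\tau_1,\tau_2,\dots$ (diagonals and boundary segments). For a diagonal $\tau_k\in T$, $Q_{\tau_k}$ is the quadrilateral formed by the two triangles of $T$ containing $\tau_k$. $D(\gamma)=\{\tau_{i_1},\dots,\tau_{i_d}\}$ is the set of diagonals of $T$ crossed by $\gamma$. $T'$ consists of all polygon vertices incident to $\gamma$ or to a diagonal in $D(\gamma)$ together with all edges of $T$ joining two such vertices (a triangulated subpolygon; its boundary segments are the edges of its boundary). A diagonal $a\in D(\gamma)$ is balanced if some pair of opposite sides of $Q_{\tau_a}$ consists of boundary segments of $T'$, imbalanced otherwise. Snake graph: for $1\le k\le d-1$ the piece of $\gamma$ from $p_k$ to $p_{k+1}$ lies in a triangle with sides $\tau_{i_k},\tau_{i_{k+1}},\tau_{[\gamma_k]}$. The tile $\overline S_k$ is a square with one diagonal whose edges are weighted $x_i$ via a homeomorphism $Q_{\tau_k}\to\overline S_k$ sending $\tau_i$ to the edge of weight $x_i$. Embed $\overline S_{i_1}$ orientation-preservingly with the vertex corresponding to $p_0$ in the southwest corner; for $k\ge2$ embed $\overline S_{i_k}$ with the orientation opposite to $\overline S_{i_{k-1}}$ and with diagonal running northwest to southeast; glue $\overline S_{i_{k+1}}$ to $\overline S_{i_k}$ along the edge weighted $x_{[\gamma_k]}$ (north or east edge of $\overline S_{i_k}$). Deleting all tile diagonals gives $G_{T,\gamma}$; each edge is labeled by the index of its weight, and vertices of $G_{T,\gamma}$ correspond to polygon vertices via these homeomorphisms. An edge is interior if it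 belongs to two tiles, exterior otherwise. A tile is a corner if it is adjacent to two other tiles, one to its left or right and one above or below it. Two parallel edges are a northwest–southeast knight's move apart if one is obtained from the other by a translation by $(-1,2),(-2,1),(1,-2)$ or $(2,-1)$ (tile side = 1). -}

module Defs where

open import Data.Nat using (ℕ; zero; suc; _+_; _<_; _≤_; _≡ᵇ_; _<ᵇ_; _⊔_; _⊓_)
open import Data.Bool using (Bool; true; false; _∧_; _∨_; not; if_then_else_)
open import Data.Product using (Σ; _×_; _,_; ∃)
open import Data.Sum using (_⊎_)
open import Data.List using (List)
open import Data.List.Membership.Propositional using (_∈_; _∉_)
open import Relation.Binary.PropositionalEquality using (_≡_; _≢_)
open import Relation.Nullary using (¬_)

-- Convex polygon with n vertices 0,1,…,n-1 listed COUNTERCLOCKWISE.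
-- A segment (edge or diagonal) joining vertices a and b is stored as the
-- normalised pair (min a b , max a b).

Seg : Set
Seg = ℕ × ℕ

seg : ℕ → ℕ → Seg
seg a b = (a ⊓ b , a ⊔ b)

ValidSeg : ℕ → Seg → Set
ValidSeg n (a , b) = a < b × b < n

PolyBd : ℕ → Seg → Set
PolyBd n (a , b) = ValidSeg n (a , b) × (b ≡ suc a ⊎ (a ≡ 0 × suc b ≡ n))

Diagonal : ℕ → Seg → Set
Diagonal n s = ValidSeg n s × ¬ PolyBd n s

Cross : Seg → Seg → Set
Cross (a , b) (c , e) = (a < c × c < b × b < e) ⊎ (c < a × a < e × e < b)

isEnd : Seg → ℕ → Bool
isEnd (a , b) v = (a ≡ᵇ v) ∨ (b ≡ᵇ v)

inside : Seg → ℕ → Bool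
inside (a , b) v = (a <ᵇ v) ∧ (v <ᵇ b)

-- u and v are vertices strictly on the same side of the diagonal τ
SameSide : Seg → ℕ → ℕ → Set
SameSide τ u v = isEnd τ u ≡ false × isEnd τ v ≡ false × inside τ u ≡ inside τ v

record Triangulation (n : ℕ) (T : List Seg) : Set where
  field
    diagonals   : ∀ {s} → s ∈ T → Diagonal n s
    noncrossing : ∀ {s t} → s ∈ T → t ∈ T → ¬ Cross s t
    maximal     : ∀ s → Diagonal n s → s ∉ T → Σ Seg λ t → t ∈ T × Cross s t

InT : ℕ → List Seg → Seg → Set
InT n T s = s ∈ T ⊎ PolyBd n s

Apex : ℕ → List Seg → Seg → ℕ → Set
Apex n T (a , b) c = c < n × isEnd (a , b) c ≡ false
                     × InT n T (seg a c) × InT n T (seg b c)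

-- σ comes after τ along γ = (p → q) (both crossed by γ, non-crossing):
-- every endpoint of σ is an endpoint of τ or lies strictly on the far side
-- of τ from p.
Before : ℕ → Seg → Seg → Set
Before p τ σ = τ ≢ σ × (∀ v → isEnd σ v ≡ true →
                 isEnd τ v ≡ true ⊎ (isEnd τ v ≡ false × inside τ v ≡ not (inside τ p)))

anyBelow : ℕ → (ℕ → Bool) → Bool
anyBelow zero    f = false
anyBelow (suc k) f = f k ∨ anyBelow k f

countBelow : ℕ → (ℕ → Bool) → ℕ
countBelow zero    f = 0
countBelow (suc k) f = (if f k then 1 else 0) + countBelow k f

isEven : ℕ → Bool
isEven zero    = true
isEven (suc k) = not (isEven k)

segEqᵇ : Seg → Seg → Bool
segEqᵇ (a , b) (c , e) = (a ≡ᵇ c) ∧ (b ≡ᵇ e)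

data Dir : Set where
  H V : Dir

-- (H , x , y) is the segment (x,y)–(x+1,y);  (V , x , y) is (x,y)–(x,y+1)
USeg : Set
USeg = Dir × ℕ × ℕ

Pt : Set
Pt = ℕ × ℕ

startPt : USeg → Pt
startPt (_ , x , y) = (x , y)

endPt : USeg → Pt
endPt (H , x , y) = (suc x , y)
endPt (V , x , y) = (x , suc y)

Parallel : USeg → USeg → Set
Parallel (d₁ , _) (d₂ , _) = d₁ ≡ d₂

Perpendicular : USeg → USeg → Set
Perpendicular (d₁ , _) (d₂ , _) = d₁ ≢ d₂

ShareVertex : USeg → USeg → Set
ShareVertex e f = Σ Pt λ z → (z ≡ startPt e ⊎ z ≡ endPt e) × (z ≡ startPt f ⊎ z ≡ endPt f)

KnightNWSE : USeg → USeg → Set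
KnightNWSE (d₁ , x₁ , y₁) (d₂ , x₂ , y₂) =
  d₁ ≡ d₂ ×
  ( (x₂ + 1 ≡ x₁ × y₂ ≡ y₁ + 2)
  ⊎ (x₂ + 2 ≡ x₁ × y₂ ≡ y₁ + 1)
  ⊎ (x₂ ≡ x₁ + 1 × y₂ + 2 ≡ y₁)
  ⊎ (x₂ ≡ x₁ + 2 × y₂ + 1 ≡ y₁))

data Side : Set where
  South East North West : Side

-- Data: the polygon size n, the triangulation T, the
-- arc γ from p = p₀ to q = p_{d+1}, the crossed diagonals τ 0,…,τ (d-1)
-- in order along γ (paper: τ_{i_1},…,τ_{i_d}; tile k here = paper's tile k+1),
-- and for each k < d the apex w k of the triangle of T on p's side of τ k
-- and the apex w' k of the triangle on q's side (so Q_{τ k} = {τ k, w k, w' k}).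

module Snake (n : ℕ) (T : List Seg) (p q d : ℕ)
             (τ : ℕ → Seg) (w w' : ℕ → ℕ) where

  inV' : ℕ → Bool
  inV' v = (v ≡ᵇ p) ∨ (v ≡ᵇ q) ∨ anyBelow d (λ k → isEnd (τ k) v)

  sizeT' : ℕ
  sizeT' = countBelow n inV'

  BdT' : Seg → Set
  BdT' (u , v) = u < v × inV' u ≡ true × inV' v ≡ true ×
                 ( (∀ x → inV' x ≡ true → ¬ (u < x × x < v))
                 ⊎ (∀ x → inV' x ≡ true → ¬ (x < u ⊎ v < x)))

  Incident : Seg → ℕ → Set
  Incident s v = isEnd s v ≡ true

  Balanced : ℕ → Set
  Balanced k with τ k
  ... | (a , b) = (BdT' (seg a (w k)) × BdT' (seg b (w' k)))
                ⊎ (BdT' (seg (w k) b) × BdT' (seg (w' k) a))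

  -- successor / predecessor of w k in the counterclockwise order of Q_{τ k}
  succW predW : ℕ → ℕ
  succW k with τ k
  ... | (a , b) = if inside (a , b) (w k) then b else a
  predW k with τ k
  ... | (a , b) = if inside (a , b) (w k) then a else b

  -- corners of tile k: SW = w k, NE = w' k, diagonal τ k from NW to SE;
  -- tile 0 orientation preserving, orientations alternate.
  SEv NWv : ℕ → ℕ
  SEv k = if isEven k then succW k else predW k
  NWv k = if isEven k then predW k else succW k

  label : ℕ → Side → Seg
  label k South = seg (w k) (SEv k)
  label k East  = seg (SEv k) (w' k)
  label k North = seg (NWv k) (w' k)
  label k West  = seg (w k) (NWv k)

  -- [γ_k]: third side of the triangle with sides τ k, τ (k+1)
  gam : ℕ → Seg
  gam k with τ k
  ... | (a , b) = seg (if isEnd (τ (suc k)) a then b else a) (w' k)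

  glueNorth : ℕ → Bool
  glueNorth k = segEqᵇ (label k North) (gam k)

  pos : ℕ → Pt
  pos zero = (0 , 0)
  pos (suc k) with pos k
  ... | (x , y) = if glueNorth k then (x , suc y) else (suc x , y)

  tileSide : ℕ → Side → USeg
  tileSide k s with pos k
  tileSide k South | (x , y) = (H , x , y)
  tileSide k North | (x , y) = (H , x , suc y)
  tileSide k West  | (x , y) = (V , x , y)
  tileSide k East  | (x , y) = (V , suc x , y)

  SideOf : ℕ → USeg → Set
  SideOf k e = k < d × Σ Side λ s → tileSide k s ≡ e

  HasLabel : USeg → Seg → Set
  HasLabel e ℓ = Σ ℕ λ k → k < d × Σ Side λ s → tileSide k s ≡ e × label k s ≡ ℓ

  Interior : USeg → Set
  Interior e = Σ ℕ λ k → Σ ℕ λ l → k ≢ l × SideOf k e × SideOf l e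

  Exterior : USeg → Set
  Exterior e = (Σ ℕ λ k → SideOf k e) × ¬ Interior e

  LabelOnlyOn : Seg → USeg → Set
  LabelOnlyOn ℓ e = ∀ f → (HasLabel f ℓ → f ≡ e) × (f ≡ e → HasLabel f ℓ)

  LabelOnlyOn₂ : Seg → USeg → USeg → Set
  LabelOnlyOn₂ ℓ e f = e ≢ f × (∀ g → (HasLabel g ℓ → g ≡ e ⊎ g ≡ f)
                                     × (g ≡ e ⊎ g ≡ f → HasLabel g ℓ))

  UniquelyLabeled : Seg → Set
  UniquelyLabeled ℓ = Σ USeg λ e → LabelOnlyOn ℓ e

  HorizAdj VertAdj : Pt → Pt → Set
  HorizAdj (x , y) (x' , y') = y ≡ y' × (suc x ≡ x' ⊎ suc x' ≡ x)
  VertAdj  (x , y) (x' , y') = x ≡ x' × (suc y ≡ y' ⊎ suc y' ≡ y)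

  Corner : ℕ → Set
  Corner k = (Σ ℕ λ l → l < d × HorizAdj (pos k) (pos l))
           × (Σ ℕ λ m → m < d × VertAdj (pos k) (pos m))

-- Relabel the vertices so that they are read counterclockwise starting at p (the map ρ); then
-- each crossed diagonal τ k has endpoints α k, β k with ρ (α k) < ρ q < ρ (β k), and the τ k
-- are nested: α increases and β decreases along γ.  Consecutive crossed diagonals share an
-- endpoint: the far apex w' k replaces α k or β k according to the side of γ it lies on, and
-- the endpoint it replaces is the near apex w (k+1).  This identifies every side of every
-- quadrilateral Q_{τ k} with one of: the two sides of T' at p, the two at q, a crossed diagonal,
-- or a segment [γ_k]; these edges of T' are pairwise distinct, the non-diagonal ones are
-- exactly the boundary segments of T', and one reads off on which tile sides each label occurs.
-- Tile k has its south-west corner on the antidiagonal x + y = k, which makes the tiles distinct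
-- and the sides carrying diagonal labels exterior; τ (k+1) is balanced exactly when w' k and
-- w' (k+1) lie on opposite sides of γ, i.e. when the snake runs straight through tile k+1.

module Submission where

open import Defs
open import Data.Nat using (ℕ; zero; suc; _+_; _∸_; _<_; _≤_; _≡ᵇ_; _<ᵇ_; _⊔_; _⊓_; z≤n; s≤s; _≟_; _<?_)
open import Data.Nat.Properties
open import Data.Bool using (Bool; true; false; _∧_; _∨_; not; if_then_else_; T)
open import Data.Bool.Properties using (T-≡; not-¬)
open import Data.Unit using (⊤; tt)
open import Data.Product using (Σ; _×_; _,_; proj₁; proj₂)
open import Data.Sum using (_⊎_; inj₁; inj₂)
open import Data.Empty using (⊥; ⊥-elim)
open import Data.List using (List; []; _∷_; length)
open import Data.List.Membership.Propositional using (_∈_; _∉_)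
open import Relation.Binary.PropositionalEquality using (_≡_; _≢_; refl; sym; trans; cong; cong₂; subst; subst₂; ≢-sym)
open import Relation.Nullary using (¬_; yes; no; Dec)
open import Relation.Nullary.Decidable using (_×-dec_)
open import Relation.Binary.Definitions using (tri<; tri≈; tri>)
open import Function.Bundles using (Equivalence)

<ᵇ-t : ∀ {a b} → a < b → (a <ᵇ b) ≡ true
<ᵇ-t h = Equivalence.to T-≡ (<⇒<ᵇ h)

<ᵇ-f : ∀ {a b} → ¬ a < b → (a <ᵇ b) ≡ false
<ᵇ-f {a} {b} h with a <ᵇ b in eq
... | false = refl
... | true = ⊥-elim (h (<ᵇ⇒< a b (Equivalence.from T-≡ eq)))

<ᵇ-t⇒ : ∀ {a b} → (a <ᵇ b) ≡ true → a < b
<ᵇ-t⇒ {a} {b} e = <ᵇ⇒< a b (Equivalence.from T-≡ e)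

≡ᵇ-t : ∀ {a b} → a ≡ b → (a ≡ᵇ b) ≡ true
≡ᵇ-t {a} {b} h = Equivalence.to T-≡ (≡⇒≡ᵇ a b h)

≡ᵇ-f : ∀ {a b} → a ≢ b → (a ≡ᵇ b) ≡ false
≡ᵇ-f {a} {b} h with a ≡ᵇ b in eq
... | false = refl
... | true = ⊥-elim (h (≡ᵇ⇒≡ a b (Equivalence.from T-≡ eq)))

≡ᵇ-t⇒ : ∀ {a b} → (a ≡ᵇ b) ≡ true → a ≡ b
≡ᵇ-t⇒ {a} {b} e = ≡ᵇ⇒≡ a b (Equivalence.from T-≡ e)

∧-t⇒ : ∀ {x y} → (x ∧ y) ≡ true → x ≡ true × y ≡ true
∧-t⇒ {true} {true} _ = refl , refl

∨-t⇒ : ∀ {x y} → (x ∨ y) ≡ true → x ≡ true ⊎ y ≡ true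
∨-t⇒ {true} _ = inj₁ refl
∨-t⇒ {false} {true} _ = inj₂ refl

∨-f⇒ : ∀ {x y} → (x ∨ y) ≡ false → x ≡ false × y ≡ false
∨-f⇒ {false} {false} _ = refl , refl

t≢f : true ≢ false
t≢f ()

inside-t : ∀ {a b u} → a < u → u < b → inside (a , b) u ≡ true
inside-t h1 h2 rewrite <ᵇ-t h1 | <ᵇ-t h2 = refl

inside-fL : ∀ {a b u} → ¬ a < u → inside (a , b) u ≡ false
inside-fL h rewrite <ᵇ-f h = refl

inside-fR : ∀ {a b u} → ¬ u < b → inside (a , b) u ≡ false
inside-fR {a} {b} {u} h rewrite <ᵇ-f h with a <ᵇ u
... | true = refl
... | false = refl

inside-t⇒ : ∀ {a b u} → inside (a , b) u ≡ true → a < u × u < b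
inside-t⇒ {a} {b} {u} e with ∧-t⇒ {a <ᵇ u} e
... | e1 , e2 = <ᵇ-t⇒ e1 , <ᵇ-t⇒ e2

isEnd-f : ∀ {a b v} → a ≢ v → b ≢ v → isEnd (a , b) v ≡ false
isEnd-f h1 h2 rewrite ≡ᵇ-f h1 | ≡ᵇ-f h2 = refl

isEnd-f⇒ : ∀ {a b v} → isEnd (a , b) v ≡ false → a ≢ v × b ≢ v
isEnd-f⇒ {a} {b} {v} e with ∨-f⇒ {a ≡ᵇ v} e
... | e1 , e2 = (λ h → t≢f (trans (sym (≡ᵇ-t h)) e1)) , (λ h → t≢f (trans (sym (≡ᵇ-t h)) e2))

isEnd-t⇒ : ∀ {a b v} → isEnd (a , b) v ≡ true → a ≡ v ⊎ b ≡ v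
isEnd-t⇒ {a} {b} {v} e with ∨-t⇒ {a ≡ᵇ v} e
... | inj₁ x = inj₁ (≡ᵇ-t⇒ x)
... | inj₂ y = inj₂ (≡ᵇ-t⇒ y)

isEnd-tL : ∀ {a b} → isEnd (a , b) a ≡ true
isEnd-tL {a} rewrite ≡ᵇ-t {a} {a} refl = refl

isEnd-tR : ∀ {a b} → isEnd (a , b) b ≡ true
isEnd-tR {a} {b} rewrite ≡ᵇ-t {b} {b} refl with a ≡ᵇ b
... | true = refl
... | false = refl

seg-lt : ∀ {a b} → a < b → seg a b ≡ (a , b)
seg-lt {a} {b} h rewrite m≤n⇒m⊓n≡m (<⇒≤ h) | m≤n⇒m⊔n≡n (<⇒≤ h) = refl

seg-gt : ∀ {a b} → b < a → seg a b ≡ (b , a)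
seg-gt {a} {b} h rewrite m≥n⇒m⊓n≡n (<⇒≤ h) | m≥n⇒m⊔n≡m (<⇒≤ h) = refl

seg-sym : ∀ a b → seg a b ≡ seg b a
seg-sym a b = cong₂ _,_ (⊓-comm a b) (⊔-comm a b)

seg-inj : ∀ {a b c e} → seg a b ≡ seg c e → (a ≡ c × b ≡ e) ⊎ (a ≡ e × b ≡ c)
seg-inj {a} {b} {c} {e} h with <-cmp a b | <-cmp c e
... | tri< x _ _ | tri< y _ _ rewrite seg-lt x | seg-lt y with h
... | refl = inj₁ (refl , refl)
seg-inj {a} {b} {c} {e} h | tri< x _ _ | tri≈ _ refl _ rewrite seg-lt x | ⊓-idem c | ⊔-idem c with h
... | refl = ⊥-elim (n≮n _ x)
seg-inj {a} {b} {c} {e} h | tri< x _ _ | tri> _ _ y rewrite seg-lt x | seg-gt y with h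
... | refl = inj₂ (refl , refl)
seg-inj {a} {b} {c} {e} h | tri≈ _ refl _ | tri< y _ _ rewrite seg-lt y | ⊓-idem a | ⊔-idem a with h
... | refl = ⊥-elim (n≮n _ y)
seg-inj {a} {b} {c} {e} h | tri≈ _ refl _ | tri≈ _ refl _ rewrite ⊓-idem a | ⊔-idem a | ⊓-idem c | ⊔-idem c with h
... | refl = inj₁ (refl , refl)
seg-inj {a} {b} {c} {e} h | tri≈ _ refl _ | tri> _ _ y rewrite seg-gt y | ⊓-idem a | ⊔-idem a with h
... | refl = ⊥-elim (n≮n _ y)
seg-inj {a} {b} {c} {e} h | tri> _ _ x | tri< y _ _ rewrite seg-gt x | seg-lt y with h
... | refl = inj₂ (refl , refl)
seg-inj {a} {b} {c} {e} h | tri> _ _ x | tri≈ _ refl _ rewrite seg-gt x | ⊓-idem c | ⊔-idem c with h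
... | refl = ⊥-elim (n≮n _ x)
seg-inj {a} {b} {c} {e} h | tri> _ _ x | tri> _ _ y rewrite seg-gt x | seg-gt y with h
... | refl = inj₁ (refl , refl)

seg-injR : ∀ {a b c} → seg a c ≡ seg b c → a ≡ b
seg-injR h with seg-inj h
... | inj₁ (e , _) = e
... | inj₂ (e1 , e2) = trans e1 e2

segEqᵇ-t : ∀ {s t} → s ≡ t → segEqᵇ s t ≡ true
segEqᵇ-t {a , b} refl rewrite ≡ᵇ-t {a} refl | ≡ᵇ-t {b} refl = refl

segEqᵇ-f : ∀ {s t} → s ≢ t → segEqᵇ s t ≡ false
segEqᵇ-f {a , b} {c , e} h with a ≡ᵇ c in e1 | b ≡ᵇ e in e2
... | false | _ = refl
... | true | false = refl
... | true | true = ⊥-elim (h (cong₂ _,_ (≡ᵇ-t⇒ e1) (≡ᵇ-t⇒ e2)))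

module Rotation (n p : ℕ) (p<n : p < n) where

  -- Vertices v < p are moved past n - 1, so that cyclic betweenness starting from p becomes <.
  ρ : ℕ → ℕ
  ρ v = if v <ᵇ p then v + n else v

  ρ-lo : ∀ {v} → v < p → ρ v ≡ v + n
  ρ-lo h rewrite <ᵇ-t h = refl

  ρ-hi : ∀ {v} → ¬ v < p → ρ v ≡ v
  ρ-hi h rewrite <ᵇ-f h = refl

  ρp : ρ p ≡ p
  ρp = ρ-hi (n≮n _)

  n≤v+n : ∀ v → n ≤ v + n
  n≤v+n v = m≤n+m n v

  ρ-inj : ∀ {u v} → u < n → v < n → ρ u ≡ ρ v → u ≡ v
  ρ-inj {u} {v} un vn e with u <? p | v <? p
  ... | yes a | yes b rewrite ρ-lo a | ρ-lo b = +-cancelʳ-≡ n u v e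
  ... | yes a | no b rewrite ρ-lo a | ρ-hi b = ⊥-elim (<⇒≱ vn (subst (n ≤_) e (n≤v+n u)))
  ... | no a | yes b rewrite ρ-hi a | ρ-lo b = ⊥-elim (<⇒≱ un (subst (n ≤_) (sym e) (n≤v+n v)))
  ... | no a | no b rewrite ρ-hi a | ρ-hi b = e

  ρ-≥p : ∀ {v} → p ≤ ρ v
  ρ-≥p {v} with v <? p
  ... | yes a rewrite ρ-lo a = ≤-trans (<⇒≤ p<n) (n≤v+n v)
  ... | no a rewrite ρ-hi a = ≮⇒≥ a

  ρ-≢p : ∀ {v} → v < n → v ≢ p → p < ρ v
  ρ-≢p {v} vn h = ≤∧≢⇒< ρ-≥p (λ e → h (ρ-inj vn p<n (trans (sym e) (sym ρp))))

  Between : ℕ → ℕ → ℕ → Set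
  Between x y u = ρ x < ρ u × ρ u < ρ y

  record ChordF (a b : ℕ) : Set where
    field
      lt  : ρ a < ρ b
      bin : ∀ u → u < n → u ≢ a → u ≢ b → Between a b u → inside (a , b) u ≡ true
      bout : ∀ u → u < n → u ≢ a → u ≢ b → ¬ Between a b u → inside (a , b) u ≡ false

  record ChordT (a b : ℕ) : Set where
    field
      lt  : ρ b < ρ a
      bin : ∀ u → u < n → u ≢ a → u ≢ b → Between b a u → inside (a , b) u ≡ false
      bout : ∀ u → u < n → u ≢ a → u ≢ b → ¬ Between b a u → inside (a , b) u ≡ true

  flipped : ℕ → ℕ → Bool
  flipped a b = inside (a , b) p ∨ (b ≡ᵇ p)

  chord-p<a : ∀ a b → a < b → b < n → p < a → flipped a b ≡ false × ChordF a b
  chord-p<a a b ab bn pa = f , record { lt = lt ; bin = bi ; bout = bo }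
    where
      pb : p < b
      pb = <-trans pa ab
      ra : ρ a ≡ a
      ra = ρ-hi (λ h → <-asym h pa)
      rb : ρ b ≡ b
      rb = ρ-hi (λ h → <-asym h pb)
      f : flipped a b ≡ false
      f rewrite inside-fL {a} {b} {p} (λ h → <-asym h pa) | ≡ᵇ-f {b} {p} (λ e → n≮n _ (subst (p <_) e pb)) = refl
      lt : ρ a < ρ b
      lt rewrite ra | rb = ab
      bi : ∀ u → u < n → u ≢ a → u ≢ b → Between a b u → inside (a , b) u ≡ true
      bi u un _ _ (h1 , h2) with u <? p
      ... | yes up rewrite ρ-lo up | rb = ⊥-elim (<⇒≱ (<-trans h2 bn) (n≤v+n u))
      ... | no up rewrite ρ-hi up | ra | rb = inside-t h1 h2
      bo : ∀ u → u < n → u ≢ a → u ≢ b → ¬ Between a b u → inside (a , b) u ≡ false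
      bo u un _ _ h with u <? p
      ... | yes up = inside-fL {a = a} {b = b} (λ h' → <-asym (<-trans h' up) pa)
      ... | no up with a <? u | u <? b
      ... | yes x | yes y = ⊥-elim (h (subst₂' x y))
        where subst₂' : a < u → u < b → Between a b u
              subst₂' x y rewrite ρ-hi up | ra | rb = x , y
      ... | no x | _ = inside-fL {a = a} {b = b} x
      ... | yes _ | no y = inside-fR {a = a} {b = b} y

  chord-p≡a : ∀ a b → a < b → b < n → p ≡ a → flipped a b ≡ false × ChordF a b
  chord-p≡a a b ab bn refl = f , record { lt = lt ; bin = bi ; bout = bo }
    where
      ra : ρ a ≡ a
      ra = ρp
      rb : ρ b ≡ b
      rb = ρ-hi (λ h → <-asym h ab)
      f : flipped a b ≡ false
      f rewrite inside-fL {a} {b} {a} (n≮n _) | ≡ᵇ-f {b} {a} (λ e → n≮n _ (subst (a <_) e ab)) = refl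
      lt : ρ a < ρ b
      lt rewrite ra | rb = ab
      bi : ∀ u → u < n → u ≢ a → u ≢ b → Between a b u → inside (a , b) u ≡ true
      bi u un _ _ (h1 , h2) with u <? a
      ... | yes up rewrite ρ-lo up | rb = ⊥-elim (<⇒≱ (<-trans h2 bn) (n≤v+n u))
      ... | no up rewrite ρ-hi up | ra | rb = inside-t h1 h2
      bo : ∀ u → u < n → u ≢ a → u ≢ b → ¬ Between a b u → inside (a , b) u ≡ false
      bo u un _ _ h with u <? a
      ... | yes up = inside-fL {a = a} {b = b} (λ h' → <-asym h' up)
      ... | no up with a <? u | u <? b
      ... | yes x | yes y = ⊥-elim (h (s2 x y))
        where s2 : a < u → u < b → Between a b u
              s2 x y rewrite ρ-hi up | ra | rb = x , y
      ... | no x | _ = inside-fL {a = a} {b = b} x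
      ... | yes _ | no y = inside-fR {a = a} {b = b} y

  chord-a<p<b : ∀ a b → a < b → b < n → a < p → p < b → flipped a b ≡ true × ChordT a b
  chord-a<p<b a b ab bn ap pb = f , record { lt = lt ; bin = bi ; bout = bo }
    where
      ra : ρ a ≡ a + n
      ra = ρ-lo ap
      rb : ρ b ≡ b
      rb = ρ-hi (λ h → <-asym h pb)
      f : flipped a b ≡ true
      f rewrite inside-t {a} {b} {p} ap pb = refl
      lt : ρ b < ρ a
      lt rewrite ra | rb = <-≤-trans bn (n≤v+n a)
      bi : ∀ u → u < n → u ≢ a → u ≢ b → Between b a u → inside (a , b) u ≡ false
      bi u un _ _ (h1 , h2) with u <? p
      ... | yes up rewrite ρ-lo up | ra = inside-fL {a = a} {b = b} (λ h → <-asym h (+-cancelʳ-< n u a h2))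
      ... | no up rewrite ρ-hi up | rb = inside-fR {a = a} {b = b} (λ h → <-asym h h1)
      bo : ∀ u → u < n → u ≢ a → u ≢ b → ¬ Between b a u → inside (a , b) u ≡ true
      bo u un ua ub h with u <? p
      ... | yes up = inside-t (≤∧≢⇒< (≮⇒≥ λ ua' → h (s1 ua')) (≢-sym ua)) (<-trans up pb)
        where s1 : u < a → Between b a u
              s1 x rewrite ρ-lo up | ra | rb = <-≤-trans bn (n≤v+n u) , +-monoˡ-< n x
      ... | no up = inside-t (<-≤-trans ap (≮⇒≥ up)) (≤∧≢⇒< (≮⇒≥ λ bu → h (s1 bu)) ub)
        where s1 : b < u → Between b a u
              s1 x rewrite ρ-hi up | ra | rb = x , <-≤-trans un (n≤v+n a)

  chord-p≡b : ∀ a b → a < b → b < n → p ≡ b → flipped a b ≡ true × ChordT a b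
  chord-p≡b a b ab bn refl = f , record { lt = lt ; bin = bi ; bout = bo }
    where
      ra : ρ a ≡ a + n
      ra = ρ-lo ab
      rb : ρ b ≡ b
      rb = ρp
      f : flipped a b ≡ true
      f rewrite ≡ᵇ-t {b} {b} refl with inside (a , b) b
      ... | true = refl
      ... | false = refl
      lt : ρ b < ρ a
      lt rewrite ra | rb = <-≤-trans bn (n≤v+n a)
      bi : ∀ u → u < n → u ≢ a → u ≢ b → Between b a u → inside (a , b) u ≡ false
      bi u un _ _ (h1 , h2) with u <? b
      ... | yes up rewrite ρ-lo up | ra = inside-fL {a = a} {b = b} (λ h → <-asym h (+-cancelʳ-< n u a h2))
      ... | no up = inside-fR {a = a} {b = b} up
      bo : ∀ u → u < n → u ≢ a → u ≢ b → ¬ Between b a u → inside (a , b) u ≡ true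
      bo u un ua ub h with u <? b
      ... | yes up = inside-t (≤∧≢⇒< (≮⇒≥ λ ua' → h (s1 ua')) (≢-sym ua)) up
        where s1 : u < a → Between b a u
              s1 x rewrite ρ-lo up | ra | rb = <-≤-trans bn (n≤v+n u) , +-monoˡ-< n x
      ... | no up = ⊥-elim (h (s1 (≤∧≢⇒< (≮⇒≥ up) (≢-sym ub))))
        where s1 : b < u → Between b a u
              s1 x rewrite ρ-hi up | ra | rb = x , <-≤-trans un (n≤v+n a)

  chord-b<p : ∀ a b → a < b → b < n → a < p → b < p → flipped a b ≡ false × ChordF a b
  chord-b<p a b ab bn ap bp = f , record { lt = lt ; bin = bi ; bout = bo }
    where
      ra : ρ a ≡ a + n
      ra = ρ-lo ap
      rb : ρ b ≡ b + n
      rb = ρ-lo bp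
      f : flipped a b ≡ false
      f rewrite inside-fR {a} {b} {p} (λ h → <-asym h bp) | ≡ᵇ-f {b} {p} (λ e → n≮n _ (subst (_< p) e bp)) = refl
      lt : ρ a < ρ b
      lt rewrite ra | rb = +-monoˡ-< n ab
      bi : ∀ u → u < n → u ≢ a → u ≢ b → Between a b u → inside (a , b) u ≡ true
      bi u un _ _ (h1 , h2) with u <? p
      ... | yes up rewrite ρ-lo up | ra | rb = inside-t (+-cancelʳ-< n a u h1) (+-cancelʳ-< n u b h2)
      ... | no up rewrite ρ-hi up | ra = ⊥-elim (<⇒≱ h1 (≤-trans (<⇒≤ un) (n≤v+n a)))
      bo : ∀ u → u < n → u ≢ a → u ≢ b → ¬ Between a b u → inside (a , b) u ≡ false
      bo u un _ _ h with u <? p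
      ... | no up = inside-fR {a = a} {b = b} (λ h' → up (<-trans h' bp))
      ... | yes up with a <? u | u <? b
      ... | yes x | yes y = ⊥-elim (h (s2 x y))
        where s2 : a < u → u < b → Between a b u
              s2 x y rewrite ρ-lo up | ra | rb = +-monoˡ-< n x , +-monoˡ-< n y
      ... | no x | _ = inside-fL {a = a} {b = b} x
      ... | yes _ | no y = inside-fR {a = a} {b = b} y

  chord-cases : ∀ a b → a < b → b < n → (flipped a b ≡ false × ChordF a b) ⊎ (flipped a b ≡ true × ChordT a b)
  chord-cases a b ab bn with <-cmp p a
  ... | tri< pa _ _ = inj₁ (chord-p<a a b ab bn pa)
  ... | tri≈ _ pa _ = inj₁ (chord-p≡a a b ab bn pa)
  ... | tri> _ _ ap with <-cmp p b
  ...   | tri< pb _ _ = inj₂ (chord-a<p<b a b ab bn ap pb)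
  ...   | tri≈ _ pb _ = inj₂ (chord-p≡b a b ab bn pb)
  ...   | tri> _ _ bp = inj₁ (chord-b<p a b ab bn ap bp)

  lo hi : Seg → ℕ
  lo (a , b) = if flipped a b then b else a
  hi (a , b) = if flipped a b then a else b

  record ChordInfo (a b : ℕ) : Set where
    field
      lh  : ρ (lo (a , b)) < ρ (hi (a , b))
      ends : (lo (a , b) ≡ a × hi (a , b) ≡ b) ⊎ (lo (a , b) ≡ b × hi (a , b) ≡ a)
      bin : ∀ u → u < n → u ≢ a → u ≢ b → Between (lo (a , b)) (hi (a , b)) u → inside (a , b) u ≡ not (flipped a b)
      bout : ∀ u → u < n → u ≢ a → u ≢ b → ¬ Between (lo (a , b)) (hi (a , b)) u → inside (a , b) u ≡ flipped a b

  chordInfo : ∀ a b → a < b → b < n → ChordInfo a b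
  chordInfo a b ab bn with chord-cases a b ab bn
  ... | inj₁ (f , C) = record
      { lh = subst₂' (ChordF.lt C) ; ends = inj₁ (loE , hiE)
      ; bin = λ u un ua ub bt → trans (ChordF.bin C u un ua ub (subB bt)) (cong not (sym f))
      ; bout = λ u un ua ub bt → trans (ChordF.bout C u un ua ub (λ z → bt (subB' z))) (sym f) }
    where
      loE : lo (a , b) ≡ a
      loE = cong (λ z → if z then b else a) f
      hiE : hi (a , b) ≡ b
      hiE = cong (λ z → if z then a else b) f
      subst₂' : ρ a < ρ b → ρ (lo (a , b)) < ρ (hi (a , b))
      subst₂' h rewrite loE | hiE = h
      subB : ∀ {u} → Between (lo (a , b)) (hi (a , b)) u → Between a b u
      subB h rewrite loE | hiE = h
      subB' : ∀ {u} → Between a b u → Between (lo (a , b)) (hi (a , b)) u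
      subB' h rewrite loE | hiE = h
  ... | inj₂ (f , C) = record
      { lh = subst₂' (ChordT.lt C) ; ends = inj₂ (loE , hiE)
      ; bin = λ u un ua ub bt → trans (ChordT.bin C u un ua ub (subB bt)) (cong not (sym f))
      ; bout = λ u un ua ub bt → trans (ChordT.bout C u un ua ub (λ z → bt (subB' z))) (sym f) }
    where
      loE : lo (a , b) ≡ b
      loE = cong (λ z → if z then b else a) f
      hiE : hi (a , b) ≡ a
      hiE = cong (λ z → if z then a else b) f
      subst₂' : ρ b < ρ a → ρ (lo (a , b)) < ρ (hi (a , b))
      subst₂' h rewrite loE | hiE = h
      subB : ∀ {u} → Between (lo (a , b)) (hi (a , b)) u → Between b a u
      subB h rewrite loE | hiE = h
      subB' : ∀ {u} → Between b a u → Between (lo (a , b)) (hi (a , b)) u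
      subB' h rewrite loE | hiE = h

  between-sides-differ : ∀ a b → a < b → b < n → ∀ u v → u < n → v < n → u ≢ a → u ≢ b → v ≢ a → v ≢ b →
          Between (lo (a , b)) (hi (a , b)) u → ¬ Between (lo (a , b)) (hi (a , b)) v →
          inside (a , b) u ≢ inside (a , b) v
  between-sides-differ a b ab bn u v un vn ua ub va vb x y e with chordInfo a b ab bn
  ... | C = not-¬ refl (trans (sym (ChordInfo.bout C v vn va vb y)) (trans (sym e) (ChordInfo.bin C u un ua ub x)))

  same-side-not-between : ∀ a b → a < b → b < n → ∀ u v → u < n → v < n → u ≢ a → u ≢ b → v ≢ a → v ≢ b →
          inside (a , b) u ≡ inside (a , b) v → ¬ Between (lo (a , b)) (hi (a , b)) v → ¬ Between (lo (a , b)) (hi (a , b)) u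
  same-side-not-between a b ab bn u v un vn ua ub va vb e nv bu = between-sides-differ a b ab bn u v un vn ua ub va vb bu nv e

  other-side-between : ∀ a b → a < b → b < n → ∀ u v → u < n → v < n → u ≢ a → u ≢ b → v ≢ a → v ≢ b →
          inside (a , b) u ≢ inside (a , b) v → ¬ Between (lo (a , b)) (hi (a , b)) v → Between (lo (a , b)) (hi (a , b)) u
  other-side-between a b ab bn u v un vn ua ub va vb e nv with chordInfo a b ab bn
  ... | C with <-cmp (ρ (lo (a , b))) (ρ u) | <-cmp (ρ u) (ρ (hi (a , b)))
  ... | tri< x _ _ | tri< y _ _ = x , y
  ... | tri< x _ _ | tri≈ _ y _ = ⊥-elim (e (trans (ChordInfo.bout C u un ua ub λ { (_ , z) → <-irrefl y z }) (sym (ChordInfo.bout C v vn va vb nv))))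
  ... | tri< x _ _ | tri> _ _ y = ⊥-elim (e (trans (ChordInfo.bout C u un ua ub λ { (_ , z) → <-asym y z }) (sym (ChordInfo.bout C v vn va vb nv))))
  ... | tri≈ _ x _ | _ = ⊥-elim (e (trans (ChordInfo.bout C u un ua ub λ { (z , _) → <-irrefl x z }) (sym (ChordInfo.bout C v vn va vb nv))))
  ... | tri> _ _ x | _ = ⊥-elim (e (trans (ChordInfo.bout C u un ua ub λ { (z , _) → <-asym x z }) (sym (ChordInfo.bout C v vn va vb nv))))

cross-sym : ∀ {s t} → Cross s t → Cross t s
cross-sym {a , b} {c , e} (inj₁ (x , y , z)) = inj₂ (x , y , z)
cross-sym {a , b} {c , e} (inj₂ (x , y , z)) = inj₁ (x , y , z)

record CrossInfo (a b c e : ℕ) : Set where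
  field
    ca : c ≢ a
    cb : c ≢ b
    ea : e ≢ a
    eb : e ≢ b
    diff : inside (a , b) c ≢ inside (a , b) e

crossInfo : ∀ {a b c e} → Cross (a , b) (c , e) → CrossInfo a b c e
crossInfo {a} {b} {c} {e} (inj₁ (x , y , z)) = record
  { ca = λ h → n≮n _ (subst (a <_) h x) ; cb = λ h → n≮n _ (subst (_< b) h y)
  ; ea = λ h → <-asym (subst (b <_) h z) (<-trans x y) ; eb = λ h → n≮n _ (subst (b <_) h z)
  ; diff = λ h → t≢f (trans (sym (inside-t x y)) (trans h (inside-fR {a = a} {b = b} (<-asym z)))) }
crossInfo {a} {b} {c} {e} (inj₂ (x , y , z)) = record
  { ca = λ h → n≮n _ (subst (_< a) h x) ; cb = λ h → <-asym (subst (_< a) h x) (<-trans y z)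
  ; ea = λ h → n≮n _ (subst (a <_) h y) ; eb = λ h → n≮n _ (subst (_< b) h z)
  ; diff = λ h → t≢f (trans (sym (inside-t y z)) (trans (sym h) (inside-fL {a = a} {b = b} (<-asym x)))) }

crossInfo-seg : ∀ {a b c e} → Cross (a , b) (seg c e) → CrossInfo a b c e
crossInfo-seg {a} {b} {c} {e} h with <-cmp c e
... | tri< x _ _ = crossInfo (subst (Cross (a , b)) (seg-lt x) h)
... | tri> _ _ x = let C = crossInfo (subst (Cross (a , b)) (seg-gt x) h) in record
  { ca = CrossInfo.ea C ; cb = CrossInfo.eb C ; ea = CrossInfo.ca C ; eb = CrossInfo.cb C
  ; diff = λ z → CrossInfo.diff C (sym z) }
... | tri≈ _ refl _ = ⊥-elim (CrossInfo.diff (crossInfo (subst (Cross (a , b)) (cong₂ _,_ (⊓-idem c) (⊔-idem c)) h)) refl)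

mkCross : ∀ {a b c e} → a < b → c < e → c ≢ a → c ≢ b → e ≢ a → e ≢ b →
          inside (a , b) c ≢ inside (a , b) e → Cross (a , b) (c , e)
mkCross {a} {b} {c} {e} ab ce ca cb ea eb d with inside (a , b) c in ic
... | true with inside-t⇒ {a} {b} {c} ic
...   | ac , cb' = inj₁ (ac , cb' , be)
  where
    be : b < e
    be with <-cmp b e
    ... | tri< x _ _ = x
    ... | tri≈ _ x _ = ⊥-elim (eb (sym x))
    ... | tri> _ _ x = ⊥-elim (d (sym (inside-t (<-trans ac ce) x)))
mkCross {a} {b} {c} {e} ab ce ca cb ea eb d | false with inside (a , b) e in ie
... | false = ⊥-elim (d refl)
... | true with inside-t⇒ {a} {b} {e} ie
...   | ae , eb' = inj₂ (ca' , ae , eb')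
  where
    ca' : c < a
    ca' with <-cmp c a
    ... | tri< x _ _ = x
    ... | tri≈ _ x _ = ⊥-elim (ca x)
    ... | tri> _ _ x = ⊥-elim (t≢f (trans (sym (inside-t x (<-trans ce eb'))) ic))

mkCross-seg : ∀ {a b c e} → a < b → c ≢ a → c ≢ b → e ≢ a → e ≢ b →
          inside (a , b) c ≢ inside (a , b) e → Cross (a , b) (seg c e)
mkCross-seg {a} {b} {c} {e} ab ca cb ea eb d with <-cmp c e
... | tri< x _ _ = subst (Cross (a , b)) (sym (seg-lt x)) (mkCross ab x ca cb ea eb d)
... | tri> _ _ x = subst (Cross (a , b)) (sym (seg-gt x)) (mkCross ab x ea eb ca cb (λ z → d (sym z)))
... | tri≈ _ refl _ = ⊥-elim (d refl)

polyBd-nocross : ∀ {n a b c e} → PolyBd n (a , b) → ValidSeg n (c , e) → ¬ Cross (a , b) (c , e)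
polyBd-nocross ((ab , bn) , inj₁ refl) _ (inj₁ (x , y , z)) = ⊥-elim (<⇒≱ y x)
polyBd-nocross ((ab , bn) , inj₁ refl) _ (inj₂ (x , y , z)) = ⊥-elim (<⇒≱ z y)
polyBd-nocross ((ab , bn) , inj₂ (refl , refl)) (_ , en) (inj₁ (x , y , z)) = ⊥-elim (<⇒≱ z (≤-pred en))
polyBd-nocross ((ab , bn) , inj₂ (refl , refl)) _ (inj₂ (() , y , z))

OrderedSeg : ℕ → Seg → Set
OrderedSeg n s = proj₁ s < proj₂ s × proj₂ s < n

module ChordSides (n p : ℕ) (p<n : p < n) where
  open Rotation n p p<n public

  pNotBtw : ∀ x y → ¬ Between x y p
  pNotBtw x y (h , _) = <⇒≱ h (subst (_≤ ρ x) (sym ρp) ρ-≥p)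

  AvoidsP : Seg → Set
  AvoidsP s = p ≢ proj₁ s × p ≢ proj₂ s

  Lo : Seg → ℕ
  Lo s = lo s
  Hi : Seg → ℕ
  Hi s = hi s

  chordOf : ∀ s → OrderedSeg n s → ChordInfo (proj₁ s) (proj₂ s)
  chordOf (a , b) (ab , bn) = chordInfo a b ab bn

  lh : ∀ s → OrderedSeg n s → ρ (Lo s) < ρ (Hi s)
  lh s v = ChordInfo.lh (chordOf s v)

  ends : ∀ s → OrderedSeg n s → (Lo s ≡ proj₁ s × Hi s ≡ proj₂ s) ⊎ (Lo s ≡ proj₂ s × Hi s ≡ proj₁ s)
  ends s v = ChordInfo.ends (chordOf s v)

  near-not-between : ∀ s → OrderedSeg n s → AvoidsP s → ∀ u → u < n → isEnd s u ≡ false → inside s u ≡ inside s p → ¬ Between (Lo s) (Hi s) u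
  near-not-between (a , b) (ab , bn) (pa , pb) u un ie e with isEnd-f⇒ {a} {b} ie
  ... | ua , ub = same-side-not-between a b ab bn u p un p<n (≢-sym ua) (≢-sym ub) pa pb e (pNotBtw _ _)

  far-between : ∀ s → OrderedSeg n s → AvoidsP s → ∀ u → u < n → isEnd s u ≡ false → inside s u ≢ inside s p → Between (Lo s) (Hi s) u
  far-between (a , b) (ab , bn) (pa , pb) u un ie e with isEnd-f⇒ {a} {b} ie
  ... | ua , ub = other-side-between a b ab bn u p un p<n (≢-sym ua) (≢-sym ub) pa pb e (pNotBtw _ _)

  between-cross : ∀ s → OrderedSeg n s → ∀ u v → u < n → v < n → u ≢ proj₁ s → u ≢ proj₂ s → v ≢ proj₁ s → v ≢ proj₂ s →
           Between (Lo s) (Hi s) u → ¬ Between (Lo s) (Hi s) v → Cross s (seg u v)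
  between-cross (a , b) (ab , bn) u v un vn ua ub va vb bu nbv =
    mkCross-seg ab ua ub va vb (between-sides-differ a b ab bn u v un vn ua ub va vb bu nbv)

  ρ<⇒≢ : ∀ {u v} → ρ u < ρ v → u ≢ v
  ρ<⇒≢ h refl = n≮n _ h

isEnd-seg : ∀ {a b x} → isEnd (seg a b) x ≡ true → x ≡ a ⊎ x ≡ b
isEnd-seg {a} {b} {x} h with <-cmp a b
... | tri< y _ _ with isEnd-t⇒ {a ⊓ b} {a ⊔ b} h
... | inj₁ e = inj₁ (sym (trans (sym (m≤n⇒m⊓n≡m (<⇒≤ y))) e))
... | inj₂ e = inj₂ (sym (trans (sym (m≤n⇒m⊔n≡n (<⇒≤ y))) e))
isEnd-seg {a} {b} {x} h | tri≈ _ refl _ with isEnd-t⇒ {a ⊓ a} {a ⊔ a} h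
... | inj₁ e = inj₁ (sym (trans (sym (⊓-idem a)) e))
... | inj₂ e = inj₂ (sym (trans (sym (⊔-idem a)) e))
isEnd-seg {a} {b} {x} h | tri> _ _ y with isEnd-t⇒ {a ⊓ b} {a ⊔ b} h
... | inj₁ e = inj₂ (sym (trans (sym (m≥n⇒m⊓n≡n (<⇒≤ y))) e))
... | inj₂ e = inj₁ (sym (trans (sym (m≥n⇒m⊔n≡m (<⇒≤ y))) e))

isEnd-sf : ∀ {a b x} → x ≢ a → x ≢ b → isEnd (seg a b) x ≡ false
isEnd-sf {a} {b} {x} xa xb with isEnd (seg a b) x in e
... | false = refl
... | true with isEnd-seg {a} {b} e
... | inj₁ z = ⊥-elim (xa z)
... | inj₂ z = ⊥-elim (xb z)

isEnd-sL : ∀ {a b} → isEnd (seg a b) a ≡ true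
isEnd-sL {a} {b} with <-cmp a b
... | tri< y _ _ = subst (λ s → isEnd s a ≡ true) (sym (seg-lt y)) (isEnd-tL {a} {b})
... | tri≈ _ refl _ rewrite ⊓-idem a | ⊔-idem a = isEnd-tL {a} {a}
... | tri> _ _ y = subst (λ s → isEnd s a ≡ true) (sym (seg-gt y)) (isEnd-tR {b} {a})

isEnd-sR : ∀ {a b} → isEnd (seg a b) b ≡ true
isEnd-sR {a} {b} = subst (λ s → isEnd s b ≡ true) (seg-sym b a) (isEnd-sL {b} {a})

record CrossingSetup (n : ℕ) (T : List Seg) (p q d : ℕ) (τ : ℕ → Seg) (w w' : ℕ → ℕ) : Set where
  field
    triangulation    : Triangulation n T
    γ-diagonal       : Diagonal n (seg p q)
    γ∉T              : seg p q ∉ T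
    crossed-complete : ∀ σ → σ ∈ T → Cross σ (seg p q) → Σ ℕ λ k → k < d × τ k ≡ σ
    crossed-in-T     : ∀ k → k < d → τ k ∈ T × Cross (τ k) (seg p q)
    crossed-ordered  : ∀ k l → l < d → k < l → Before p (τ k) (τ l)
    p-apex           : ∀ k → k < d → Apex n T (τ k) (w k) × SameSide (τ k) (w k) p
    q-apex           : ∀ k → k < d → Apex n T (τ k) (w' k) × SameSide (τ k) (w' k) q

module CrossedDiagonals {n : ℕ} {T : List Seg} {p q d : ℕ} {τ : ℕ → Seg} {w w' : ℕ → ℕ}
  (S : CrossingSetup n T p q d τ w w') where

  open CrossingSetup S

  pqlt : p ⊓ q < p ⊔ q
  pqlt = proj₁ (proj₁ γ-diagonal)
  pqn : p ⊔ q < n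
  pqn = proj₂ (proj₁ γ-diagonal)
  p<n : p < n
  p<n = ≤-<-trans (m≤m⊔n p q) pqn
  q<n : q < n
  q<n = ≤-<-trans (m≤n⊔m p q) pqn
  p≢q : p ≢ q
  p≢q refl = n≮n _ (subst₂' pqlt)
    where subst₂' : p ⊓ p < p ⊔ p → p < p
          subst₂' h rewrite ⊓-idem p | ⊔-idem p = h

  open ChordSides n p p<n public

  m : ℕ
  m = ρ q
  p<m : p < m
  p<m = ρ-≢p q<n (≢-sym p≢q)

  inTvalid : ∀ {s} → InT n T s → OrderedSeg n s
  inTvalid (inj₁ x) = proj₁ (Triangulation.diagonals triangulation x)
  inTvalid (inj₂ y) = proj₁ y

  noX : ∀ {s t} → InT n T s → InT n T t → ¬ Cross s t
  noX (inj₂ ps) it c = polyBd-nocross ps (inTvalid it) c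
  noX (inj₁ s∈) (inj₂ pt) c = polyBd-nocross pt (inTvalid (inj₁ s∈)) (cross-sym c)
  noX (inj₁ s∈) (inj₁ t∈) c = Triangulation.noncrossing triangulation s∈ t∈ c

  γvs : OrderedSeg n (seg p q)
  γvs = proj₁ γ-diagonal

  γLo : Lo (seg p q) ≡ p
  γLo with <-cmp p q
  ... | tri< x _ _ rewrite m≤n⇒m⊓n≡m (<⇒≤ x) | m≤n⇒m⊔n≡n (<⇒≤ x) | inside-fL {a = p} {b = q} {u = p} (n≮n _) | ≡ᵇ-f {q} {p} (≢-sym p≢q) = refl
  ... | tri≈ _ x _ = ⊥-elim (p≢q x)
  ... | tri> _ _ x rewrite m≥n⇒m⊓n≡n (<⇒≤ x) | m≥n⇒m⊔n≡m (<⇒≤ x) | ≡ᵇ-t {p} {p} refl with inside (q , p) p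
  ... | true = refl
  ... | false = refl
  γHi : Hi (seg p q) ≡ q
  γHi with <-cmp p q
  ... | tri< x _ _ rewrite m≤n⇒m⊓n≡m (<⇒≤ x) | m≤n⇒m⊔n≡n (<⇒≤ x) | inside-fL {a = p} {b = q} {u = p} (n≮n _) | ≡ᵇ-f {q} {p} (≢-sym p≢q) = refl
  ... | tri≈ _ x _ = ⊥-elim (p≢q x)
  ... | tri> _ _ x rewrite m≥n⇒m⊓n≡n (<⇒≤ x) | m≥n⇒m⊔n≡m (<⇒≤ x) | ≡ᵇ-t {p} {p} refl with inside (q , p) p
  ... | true = refl
  ... | false = refl

  segEnds≢ : ∀ {a b u} → u ≢ a → u ≢ b → u ≢ proj₁ (seg a b) × u ≢ proj₂ (seg a b)
  segEnds≢ {a} {b} {u} ua ub with <-cmp a b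
  ... | tri< x _ _ rewrite m≤n⇒m⊓n≡m (<⇒≤ x) | m≤n⇒m⊔n≡n (<⇒≤ x) = ua , ub
  ... | tri≈ _ refl _ rewrite ⊓-idem a | ⊔-idem a = ua , ua
  ... | tri> _ _ x rewrite m≥n⇒m⊓n≡n (<⇒≤ x) | m≥n⇒m⊔n≡m (<⇒≤ x) = ub , ua

  crossγ : ∀ u v → u < n → v < n → p < ρ u → ρ u < m → m < ρ v → Cross (seg p q) (seg u v)
  crossγ u v un vn pu um mv = between-cross (seg p q) γvs u v un vn (proj₁ e1) (proj₂ e1) (proj₁ e2) (proj₂ e2) bu nbv
    where
      e1 = segEnds≢ {p} {q} {u} (λ { refl → n≮n _ (subst (p <_) ρp pu) }) (λ { refl → (n≮n _) um })
      e2 = segEnds≢ {p} {q} {v} (λ { refl → <-asym (subst (m <_) ρp mv) p<m }) (λ { refl → (n≮n _) mv })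
      bu : Between (Lo (seg p q)) (Hi (seg p q)) u
      bu rewrite γLo | γHi = subst (_< ρ u) (sym ρp) pu , um
      nbv : ¬ Between (Lo (seg p q)) (Hi (seg p q)) v
      nbv rewrite γLo | γHi = λ { (_ , z) → <-asym z mv }

  fromInT : ∀ {s} → InT n T s → Cross (seg p q) s → Σ ℕ λ j → j < d × τ j ≡ s
  fromInT (inj₁ x) c = crossed-complete _ x (cross-sym c)
  fromInT (inj₂ y) c = ⊥-elim (polyBd-nocross y γvs (cross-sym c))

  α β : ℕ → ℕ
  α k = Lo (τ k)
  β k = Hi (τ k)

  τT : ∀ k → k < d → τ k ∈ T
  τT k kd = proj₁ (crossed-in-T k kd)
  vs : ∀ k → k < d → OrderedSeg n (τ k)
  vs k kd = proj₁ (Triangulation.diagonals triangulation (τT k kd))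
  ciγ : ∀ k → k < d → CrossInfo (proj₁ (τ k)) (proj₂ (τ k)) p q
  ciγ k kd = crossInfo-seg (proj₂ (crossed-in-T k kd))
  np : ∀ k → k < d → AvoidsP (τ k)
  np k kd = CrossInfo.ca (ciγ k kd) , CrossInfo.cb (ciγ k kd)

  q-between : ∀ k → k < d → ρ (α k) < m × m < ρ (β k)
  q-between k kd = far-between (τ k) (vs k kd) (np k kd) q q<n (isEnd-f (≢-sym (CrossInfo.ea (ciγ k kd))) (≢-sym (CrossInfo.eb (ciγ k kd)))) (λ e → CrossInfo.diff (ciγ k kd) (sym e))

  αn : ∀ k → k < d → α k < n
  αn k kd with ends (τ k) (vs k kd)
  ... | inj₁ (e , _) rewrite e = <-trans (proj₁ (vs k kd)) (proj₂ (vs k kd))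
  ... | inj₂ (e , _) rewrite e = proj₂ (vs k kd)
  βn : ∀ k → k < d → β k < n
  βn k kd with ends (τ k) (vs k kd)
  ... | inj₁ (_ , e) rewrite e = proj₂ (vs k kd)
  ... | inj₂ (_ , e) rewrite e = <-trans (proj₁ (vs k kd)) (proj₂ (vs k kd))

  τseg : ∀ k → k < d → τ k ≡ seg (α k) (β k)
  τseg k kd with ends (τ k) (vs k kd)
  ... | inj₁ (e1 , e2) rewrite e1 | e2 = sym (seg-lt (proj₁ (vs k kd)))
  ... | inj₂ (e1 , e2) rewrite e1 | e2 = sym (seg-gt (proj₁ (vs k kd)))

  p<α : ∀ k → k < d → p < ρ (α k)
  p<α k kd with ends (τ k) (vs k kd)
  ... | inj₁ (e , _) rewrite e = ρ-≢p (<-trans (proj₁ (vs k kd)) (proj₂ (vs k kd))) (≢-sym (proj₁ (np k kd)))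
  ... | inj₂ (e , _) rewrite e = ρ-≢p (proj₂ (vs k kd)) (≢-sym (proj₂ (np k kd)))

  αβ< : ∀ k → k < d → ρ (α k) < ρ (β k)
  αβ< k kd = <-trans (proj₁ (q-between k kd)) (proj₂ (q-between k kd))

  endsτ : ∀ k → k < d → ∀ {v} → isEnd (τ k) v ≡ true → v ≡ α k ⊎ v ≡ β k
  endsτ k kd {v} h = isEnd-seg (subst (λ s → isEnd s v ≡ true) (τseg k kd) h)

  endτα : ∀ k → k < d → isEnd (τ k) (α k) ≡ true
  endτα k kd = subst (λ s → isEnd s (α k) ≡ true) (sym (τseg k kd)) (isEnd-sL {α k} {β k})
  endτβ : ∀ k → k < d → isEnd (τ k) (β k) ≡ true
  endτβ k kd = subst (λ s → isEnd s (β k) ≡ true) (sym (τseg k kd)) (isEnd-sR {α k} {β k})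

  notEnd : ∀ k → k < d → ∀ {v} → v ≢ α k → v ≢ β k → v ≢ proj₁ (τ k) × v ≢ proj₂ (τ k)
  notEnd k kd {v} va vb with ends (τ k) (vs k kd)
  ... | inj₁ (e1 , e2) = (λ z → va (trans z (sym e1))) , (λ z → vb (trans z (sym e2)))
  ... | inj₂ (e1 , e2) = (λ z → vb (trans z (sym e2))) , (λ z → va (trans z (sym e1)))

  notEndF : ∀ k → k < d → ∀ {v} → v ≢ α k → v ≢ β k → isEnd (τ k) v ≡ false
  notEndF k kd {v} va vb = subst (λ s → isEnd s v ≡ false) (sym (τseg k kd)) (isEnd-sf va vb)

  inTαβ : ∀ k → k < d → ∀ {c} → InT n T (seg (proj₁ (τ k)) c) → InT n T (seg (proj₂ (τ k)) c) →
          InT n T (seg (α k) c) × InT n T (seg (β k) c)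
  inTαβ k kd {c} x y with ends (τ k) (vs k kd)
  ... | inj₁ (e1 , e2) rewrite e1 | e2 = x , y
  ... | inj₂ (e1 , e2) rewrite e1 | e2 = y , x

  record ApexData (k c : ℕ) : Set where
    field
      cn : c < n
      cα : c ≢ α k
      cβ : c ≢ β k
      iα : InT n T (seg (α k) c)
      iβ : InT n T (seg (β k) c)

  apexData : ∀ k → k < d → ∀ {c} → Apex n T (τ k) c → ApexData k c
  apexData k kd {c} (cn , ie , x , y) with isEnd-f⇒ {proj₁ (τ k)} {proj₂ (τ k)} ie | inTαβ k kd x y
  ... | (a1 , a2) | (i1 , i2) = record { cn = cn ; cα = cα' ; cβ = cβ' ; iα = i1 ; iβ = i2 }
    where
      cα' : c ≢ α k
      cα' e with ends (τ k) (vs k kd)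
      ... | inj₁ (e1 , _) = a1 (sym (trans e e1))
      ... | inj₂ (e1 , _) = a2 (sym (trans e e1))
      cβ' : c ≢ β k
      cβ' e with ends (τ k) (vs k kd)
      ... | inj₁ (_ , e2) = a2 (sym (trans e e2))
      ... | inj₂ (_ , e2) = a1 (sym (trans e e2))

  nearApex : ∀ k → k < d → ApexData k (w k)
  nearApex k kd = apexData k kd (proj₁ (p-apex k kd))
  farApex : ∀ k → k < d → ApexData k (w' k)
  farApex k kd = apexData k kd (proj₁ (q-apex k kd))

  w-near : ∀ k → k < d → ¬ Between (α k) (β k) (w k)
  w-near k kd = near-not-between (τ k) (vs k kd) (np k kd) (w k) (ApexData.cn (nearApex k kd)) (proj₁ (proj₂ (p-apex k kd))) (proj₂ (proj₂ (proj₂ (p-apex k kd))))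

  w'-far : ∀ k → k < d → Between (α k) (β k) (w' k)
  w'-far k kd = far-between (τ k) (vs k kd) (np k kd) (w' k) (ApexData.cn (farApex k kd)) (proj₁ (proj₂ (q-apex k kd)))
    (λ e → CrossInfo.diff (ciγ k kd) (trans (sym (trans (sym (proj₂ (proj₂ (proj₂ (q-apex k kd))))) e)) refl))

  suc<⇒< : ∀ {k} → suc k < d → k < d
  suc<⇒< h = <-trans (n<1+n _) h

  endn : ∀ l → l < d → ∀ {v} → isEnd (τ l) v ≡ true → v < n
  endn l ld h with endsτ l ld h
  ... | inj₁ refl = αn l ld
  ... | inj₂ refl = βn l ld

  beforeEnd : ∀ k l → k < l → l < d → ∀ v → isEnd (τ l) v ≡ true → v ≡ α k ⊎ v ≡ β k ⊎ Between (α k) (β k) v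
  beforeEnd k l kl ld v h with proj₂ (crossed-ordered k l ld kl) v h
  ... | inj₁ e with endsτ k (<-trans kl ld) e
  ... | inj₁ x = inj₁ x
  ... | inj₂ x = inj₂ (inj₁ x)
  beforeEnd k l kl ld v h | inj₂ (ef , ins) = inj₂ (inj₂ (far-between (τ k) (vs k (<-trans kl ld)) (np k (<-trans kl ld)) v (endn l ld h) ef (λ e → not-¬ refl (trans (sym e) ins))))

  τ≢ : ∀ k l → k < l → l < d → τ k ≢ τ l
  τ≢ k l kl ld = proj₁ (crossed-ordered k l ld kl)

  nested : ∀ k l → k ≤ l → l < d → ρ (α k) ≤ ρ (α l) × ρ (β l) ≤ ρ (β k)
  nested k l kl ld with <-cmp k l
  ... | tri≈ _ refl _ = ≤-refl , ≤-refl
  ... | tri> _ _ x = ⊥-elim (<⇒≱ x kl)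
  ... | tri< x _ _ = m1 , m2
    where
      kd = <-trans x ld
      m1 : ρ (α k) ≤ ρ (α l)
      m1 with beforeEnd k l x ld (α l) (endτα l ld)
      ... | inj₁ e = ≤-reflexive (cong ρ (sym e))
      ... | inj₂ (inj₁ e) = ⊥-elim (<-asym (proj₁ (q-between l ld)) (subst (λ z → m < ρ z) (sym e) (proj₂ (q-between k kd))))
      ... | inj₂ (inj₂ b) = <⇒≤ (proj₁ b)
      m2 : ρ (β l) ≤ ρ (β k)
      m2 with beforeEnd k l x ld (β l) (endτβ l ld)
      ... | inj₁ e = ⊥-elim (<-asym (proj₂ (q-between l ld)) (subst (λ z → ρ z < m) (sym e) (proj₁ (q-between k kd))))
      ... | inj₂ (inj₁ e) = ≤-reflexive (cong ρ e)
      ... | inj₂ (inj₂ b) = <⇒≤ (proj₂ b)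

  αβOf : ∀ j → j < d → ∀ {u v} → τ j ≡ seg u v → ρ u < m → m < ρ v → α j ≡ u × β j ≡ v
  αβOf j jd {u} {v} e um mv = a1 , b1
    where
      a1 : α j ≡ u
      a1 with isEnd-seg {u} {v} (subst (λ s → isEnd s (α j) ≡ true) e (endτα j jd))
      ... | inj₁ x = x
      ... | inj₂ x = ⊥-elim (<-asym (proj₁ (q-between j jd)) (subst (λ z → m < ρ z) (sym x) mv))
      b1 : β j ≡ v
      b1 with isEnd-seg {u} {v} (subst (λ s → isEnd s (β j) ≡ true) e (endτβ j jd))
      ... | inj₁ x = ⊥-elim (<-asym (proj₂ (q-between j jd)) (subst (λ z → ρ z < m) (sym x) um))
      ... | inj₂ x = x

  αβ≡⇒τ≡ : ∀ k l → k < d → l < d → α k ≡ α l → β k ≡ β l → τ k ≡ τ l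
  αβ≡⇒τ≡ k l kd ld e1 e2 = trans (τseg k kd) (trans (cong₂ seg e1 e2) (sym (τseg l ld)))

  ≡-from-≤ : ∀ {u v} → u < n → v < n → ρ u ≤ ρ v → ρ v ≤ ρ u → u ≡ v
  ≡-from-≤ un vn a b = ρ-inj un vn (≤-antisym a b)

  no-cross-τ : ∀ k → k < d → ∀ u v → u < n → v < n → u ≢ α k → u ≢ β k → v ≢ α k → v ≢ β k →
           Between (α k) (β k) u → ¬ Between (α k) (β k) v → InT n T (seg u v) → ⊥
  no-cross-τ k kd u v un vn ua ub va vb bu nbv it =
    noX (inj₁ (τT k kd)) it (between-cross (τ k) (vs k kd) u v un vn (proj₁ (notEnd k kd ua ub)) (proj₂ (notEnd k kd ua ub)) (proj₁ (notEnd k kd va vb)) (proj₂ (notEnd k kd va vb)) bu nbv)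

  loHiOf : ∀ {s u v} → OrderedSeg n s → s ≡ seg u v → ρ u < ρ v → Lo s ≡ u × Hi s ≡ v
  loHiOf {s} {u} {v} Vs e uv with ends s Vs | lh s Vs
  ... | inj₁ (e1 , e2) | l = fin (subst (λ z → isEnd z (Lo s) ≡ true) e (subst (λ z → isEnd s z ≡ true) (sym e1) (isEnd-tL {proj₁ s} {proj₂ s})))
                                  (subst (λ z → isEnd z (Hi s) ≡ true) e (subst (λ z → isEnd s z ≡ true) (sym e2) (isEnd-tR {proj₁ s} {proj₂ s}))) l
    where
      fin : isEnd (seg u v) (Lo s) ≡ true → isEnd (seg u v) (Hi s) ≡ true → ρ (Lo s) < ρ (Hi s) → Lo s ≡ u × Hi s ≡ v
      fin a b l' with isEnd-seg {u} {v} a | isEnd-seg {u} {v} b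
      ... | inj₁ x | inj₁ y = ⊥-elim (n≮n _ (subst₂ (λ z z' → ρ z < ρ z') x y l'))
      ... | inj₁ x | inj₂ y = x , y
      ... | inj₂ x | inj₁ y = ⊥-elim (<-asym uv (subst₂ (λ z z' → ρ z < ρ z') x y l'))
      ... | inj₂ x | inj₂ y = ⊥-elim (n≮n _ (subst₂ (λ z z' → ρ z < ρ z') x y l'))
  ... | inj₂ (e1 , e2) | l = fin (subst (λ z → isEnd z (Lo s) ≡ true) e (subst (λ z → isEnd s z ≡ true) (sym e1) (isEnd-tR {proj₁ s} {proj₂ s})))
                                  (subst (λ z → isEnd z (Hi s) ≡ true) e (subst (λ z → isEnd s z ≡ true) (sym e2) (isEnd-tL {proj₁ s} {proj₂ s}))) l
    where
      fin : isEnd (seg u v) (Lo s) ≡ true → isEnd (seg u v) (Hi s) ≡ true → ρ (Lo s) < ρ (Hi s) → Lo s ≡ u × Hi s ≡ v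
      fin a b l' with isEnd-seg {u} {v} a | isEnd-seg {u} {v} b
      ... | inj₁ x | inj₁ y = ⊥-elim (n≮n _ (subst₂ (λ z z' → ρ z < ρ z') x y l'))
      ... | inj₁ x | inj₂ y = x , y
      ... | inj₂ x | inj₁ y = ⊥-elim (<-asym uv (subst₂ (λ z z' → ρ z < ρ z') x y l'))
      ... | inj₂ x | inj₂ y = ⊥-elim (n≮n _ (subst₂ (λ z z' → ρ z < ρ z') x y l'))

  no-cross-edge : ∀ a c → InT n T (seg a c) → ρ a < ρ c → ∀ u v → u < n → v < n → u ≢ a → u ≢ c → v ≢ a → v ≢ c →
           ρ a < ρ u → ρ u < ρ c → (ρ v < ρ a ⊎ ρ c < ρ v) → InT n T (seg u v) → ⊥
  no-cross-edge a c ia ac u v un vn ua uc va vc l1 l2 vo iu = noX ia iu (between-cross (seg a c) Vv u v un vn (proj₁ eu) (proj₂ eu) (proj₁ ev) (proj₂ ev) bu nbv)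
    where
      Vv = inTvalid ia
      LH = loHiOf Vv refl ac
      eu = segEnds≢ ua uc
      ev = segEnds≢ va vc
      bu : Between (Lo (seg a c)) (Hi (seg a c)) u
      bu rewrite proj₁ LH | proj₂ LH = l1 , l2
      nbv : ¬ Between (Lo (seg a c)) (Hi (seg a c)) v
      nbv rewrite proj₁ LH | proj₂ LH = nb vo
        where nb : (ρ v < ρ a ⊎ ρ c < ρ v) → ¬ Between a c v
              nb (inj₁ x) (y , _) = <-asym x y
              nb (inj₂ x) (_ , y) = <-asym x y

  d>0 : 0 < d
  d>0 with Triangulation.maximal triangulation (seg p q) γ-diagonal γ∉T
  ... | t , t∈ , c with crossed-complete t t∈ (cross-sym c)
  ... | k , kd , _ = ≤-<-trans z≤n kd

  w0≡p : w 0 ≡ p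
  w0≡p with w 0 ≟ p
  ... | yes e = e
  ... | no ne = ⊥-elim (go (<-cmp (ρ W) (ρ A)))
    where
      kd = d>0
      W = w 0
      A = α 0
      B = β 0
      Ap = nearApex 0 kd
      Wn = ApexData.cn Ap
      pW : p < ρ W
      pW = ρ-≢p Wn ne
      other : ∀ j → j < d → isEnd (τ j) W ≡ true → ⊥
      other zero jd h with endsτ 0 jd h
      ... | inj₁ x = ApexData.cα Ap x
      ... | inj₂ x = ApexData.cβ Ap x
      other (suc j) jd h with beforeEnd 0 (suc j) (s≤s z≤n) jd W h
      ... | inj₁ x = ApexData.cα Ap x
      ... | inj₂ (inj₁ x) = ApexData.cβ Ap x
      ... | inj₂ (inj₂ x) = w-near 0 kd x
      go : _ → ⊥
      go (tri< x _ _) with fromInT (subst (InT n T) (seg-sym B W) (ApexData.iβ Ap)) (crossγ W B Wn (βn 0 kd) pW (<-trans x (proj₁ (q-between 0 kd))) (proj₂ (q-between 0 kd)))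
      ... | j , jd , e = other j jd (subst (λ s → isEnd s W ≡ true) (sym e) (isEnd-sL {W} {B}))
      go (tri≈ _ x _) = ApexData.cα Ap (ρ-inj Wn (αn 0 kd) x)
      go (tri> _ _ x) with <-cmp (ρ W) (ρ B)
      ... | tri< y _ _ = w-near 0 kd (x , y)
      ... | tri≈ _ y _ = ApexData.cβ Ap (ρ-inj Wn (βn 0 kd) y)
      ... | tri> _ _ y with fromInT (ApexData.iα Ap) (crossγ A W (αn 0 kd) Wn (p<α 0 kd) (proj₁ (q-between 0 kd)) (<-trans (proj₂ (q-between 0 kd)) y))
      ... | j , jd , e = other j jd (subst (λ s → isEnd s W ≡ true) (sym e) (isEnd-sR {A} {W}))

  w'-last : ∀ l → suc l ≡ d → w' l ≡ q
  w'-last l e = go (<-cmp (ρ c) m)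
    where
      ld : l < d
      ld = subst (l <_) e (n<1+n l)
      c = w' l
      A = α l
      B = β l
      Ap = farApex l ld
      cn = ApexData.cn Ap
      bt = w'-far l ld
      jle : ∀ {j} → j < d → j < l ⊎ j ≡ l
      jle {j} jd with <-cmp j l
      ... | tri< x _ _ = inj₁ x
      ... | tri≈ _ x _ = inj₂ x
      ... | tri> _ _ x = ⊥-elim (<⇒≱ jd (subst (_≤ j) e x))
      go : _ → c ≡ q
      go (tri≈ _ x _) = ρ-inj cn q<n x
      go (tri< x _ _) with fromInT (subst (InT n T) (seg-sym B c) (ApexData.iβ Ap)) (crossγ c B cn (βn l ld) (<-trans (p<α l ld) (proj₁ bt)) x (proj₂ (q-between l ld)))
      ... | j , jd , ej with αβOf j jd ej x (proj₂ (q-between l ld))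
      ... | ea , eb with jle jd
      ... | inj₂ refl = ⊥-elim (ApexData.cα Ap (sym ea))
      ... | inj₁ jl with beforeEnd j l jl ld A (endτα l ld)
      ... | inj₁ y = ⊥-elim (ApexData.cα Ap (sym (trans y ea)))
      ... | inj₂ (inj₁ y) = ⊥-elim (ρ<⇒≢ (αβ< l ld) (trans y eb))
      ... | inj₂ (inj₂ (y , _)) = ⊥-elim (<-asym (proj₁ bt) (subst (λ z → ρ z < ρ A) ea y))
      go (tri> _ _ x) with fromInT (ApexData.iα Ap) (crossγ A c (αn l ld) cn (p<α l ld) (proj₁ (q-between l ld)) x)
      ... | j , jd , ej with αβOf j jd ej (proj₁ (q-between l ld)) x
      ... | ea , eb with jle jd
      ... | inj₂ refl = ⊥-elim (ApexData.cβ Ap (sym eb))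
      ... | inj₁ jl with beforeEnd j l jl ld B (endτβ l ld)
      ... | inj₁ y = ⊥-elim (ρ<⇒≢ (αβ< l ld) (sym (trans y ea)))
      ... | inj₂ (inj₁ y) = ⊥-elim (ApexData.cβ Ap (sym (trans y eb)))
      ... | inj₂ (inj₂ (_ , y)) = ⊥-elim (<-asym (proj₂ bt) (subst (λ z → ρ B < ρ z) eb y))

  module Step (k : ℕ) (skd : suc k < d) where
    kd : k < d
    kd = suc<⇒< skd
    c = w' k
    A = α k
    B = β k
    Ap = farApex k kd
    cn = ApexData.cn Ap
    bt : Between A B c
    bt = w'-far k kd
    A' = α (suc k)
    B' = β (suc k)
    mo = nested k (suc k) (n≤1+n k) skd
    An = αn k kd
    Bn = βn k kd
    A'n = αn (suc k) skd
    B'n = βn (suc k) skd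
    ne : ¬ (A ≡ A' × B ≡ B')
    ne (x , y) = τ≢ k (suc k) (n<1+n k) skd (αβ≡⇒τ≡ k (suc k) kd skd x y)
    A<B' : ρ A < ρ B'
    A<B' = <-trans (proj₁ (q-between k kd)) (proj₂ (q-between (suc k) skd))
    A'<B : ρ A' < ρ B
    A'<B = <-trans (proj₁ (q-between (suc k) skd)) (proj₂ (q-between k kd))

  w'≢q : ∀ k → suc k < d → w' k ≢ q
  w'≢q k skd refl = ne (a1 , b1)
    where
      open Step k skd
      qb : Between A' B' q
      qb = q-between (suc k) skd
      a1 : A ≡ A'
      a1 with <-cmp (ρ A) (ρ A')
      ... | tri≈ _ x _ = ρ-inj An A'n x
      ... | tri> _ _ x = ⊥-elim (<⇒≱ x (proj₁ mo))
      ... | tri< x _ _ = ⊥-elim (no-cross-τ (suc k) skd q A q<n An (λ z → ρ<⇒≢ (proj₁ qb) (sym z)) (ρ<⇒≢ (proj₂ qb)) (ρ<⇒≢ x) (ρ<⇒≢ A<B') qb (λ { (y , _) → <-asym x y }) (subst (InT n T) (seg-sym A q) (ApexData.iα Ap)))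
      b1 : B ≡ B'
      b1 with <-cmp (ρ B') (ρ B)
      ... | tri≈ _ x _ = ρ-inj Bn B'n (sym x)
      ... | tri> _ _ x = ⊥-elim (<⇒≱ x (proj₂ mo))
      ... | tri< x _ _ = ⊥-elim (no-cross-τ (suc k) skd q B q<n Bn (λ z → ρ<⇒≢ (proj₁ qb) (sym z)) (ρ<⇒≢ (proj₂ qb)) (λ z → ρ<⇒≢ A'<B (sym z)) (λ z → ρ<⇒≢ x (sym z)) qb (λ { (_ , y) → <-asym x y }) (subst (InT n T) (seg-sym B q) (ApexData.iβ Ap)))

  module StepαSide (k : ℕ) (skd : suc k < d) (cm : ρ (w' k) < m) (j : ℕ) (jd : j < d) (ea : α j ≡ w' k) (eb : β j ≡ β k) where
    open Step k skd
    kj : suc k ≤ j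
    kj with <-cmp k j
    ... | tri< x _ _ = x
    ... | tri≈ _ x _ = ⊥-elim (ApexData.cα Ap (sym (subst (λ z → α z ≡ c) (sym x) ea)))
    ... | tri> _ _ x with beforeEnd j k x kd A (endτα k kd)
    ... | inj₁ y = ⊥-elim (ApexData.cα Ap (sym (trans y ea)))
    ... | inj₂ (inj₁ y) = ⊥-elim (ρ<⇒≢ (αβ< k kd) (trans y eb))
    ... | inj₂ (inj₂ (y , _)) = ⊥-elim (<-asym (proj₁ bt) (subst (λ z → ρ z < ρ A) ea y))
    mj = nested (suc k) j kj jd
    b1 : B' ≡ B
    b1 = ≡-from-≤ B'n Bn (proj₂ mo) (subst (λ z → ρ z ≤ ρ B') eb (proj₂ mj))
    A'≤c : ρ A' ≤ ρ c
    A'≤c = subst (λ z → ρ A' ≤ ρ z) ea (proj₁ mj)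
    a1 : A' ≡ c
    a1 with <-cmp (ρ A) (ρ A')
    ... | tri≈ _ x _ = ⊥-elim (ne (ρ-inj An A'n x , sym b1))
    ... | tri> _ _ x = ⊥-elim (<⇒≱ x (proj₁ mo))
    ... | tri< x _ _ with <-cmp (ρ A') (ρ c)
    ... | tri≈ _ y _ = ρ-inj A'n cn y
    ... | tri> _ _ y = ⊥-elim (<⇒≱ y A'≤c)
    ... | tri< y _ _ = ⊥-elim (no-cross-τ (suc k) skd c A cn An (λ z → ρ<⇒≢ y (sym z)) (ρ<⇒≢ (<-trans cm (proj₂ (q-between (suc k) skd)))) (ρ<⇒≢ x) (ρ<⇒≢ A<B') (y , <-trans cm (proj₂ (q-between (suc k) skd))) (λ { (z , _) → <-asym x z }) (subst (InT n T) (seg-sym A c) (ApexData.iα Ap)))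
    u = w (suc k)
    Wp = nearApex (suc k) skd
    un = ApexData.cn Wp
    iuc : InT n T (seg u c)
    iuc = subst (InT n T) (trans (seg-sym A' u) (cong (seg u) a1)) (ApexData.iα Wp)
    iuB : InT n T (seg u B)
    iuB = subst (InT n T) (trans (seg-sym B' u) (cong (seg u) b1)) (ApexData.iβ Wp)
    unc : u ≢ c
    unc z = ApexData.cα Wp (trans z (sym a1))
    unB : u ≢ B
    unB z = ApexData.cβ Wp (trans z (sym b1))
    nb : ¬ Between c B u
    nb = subst₂ (λ x y → ¬ Between x y u) a1 b1 (w-near (suc k) skd)
    cA : c ≢ A
    cA = ApexData.cα Ap
    cB : c ≢ B
    cB = ApexData.cβ Ap
    w1 : u ≡ A
    w1 with <-cmp (ρ u) (ρ A)
    ... | tri≈ _ x _ = ρ-inj un An x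
    ... | tri< x _ _ = ⊥-elim (no-cross-τ k kd c u cn un cA cB (ρ<⇒≢ x) (ρ<⇒≢ (<-trans x (αβ< k kd))) bt (λ { (z , _) → <-asym x z }) (subst (InT n T) (seg-sym u c) iuc))
    ... | tri> _ _ x with <-cmp (ρ u) (ρ c)
    ... | tri≈ _ y _ = ⊥-elim (unc (ρ-inj un cn y))
    ... | tri< y _ _ = ⊥-elim (no-cross-edge A c (ApexData.iα Ap) (proj₁ bt) u B un Bn (λ z → ρ<⇒≢ x (sym z)) unc (λ z → ρ<⇒≢ (αβ< k kd) (sym z)) (λ z → cB (sym z)) x y (inj₂ (proj₂ bt)) iuB)
    ... | tri> _ _ y with <-cmp (ρ u) (ρ B)
    ... | tri< z _ _ = ⊥-elim (nb (y , z))
    ... | tri≈ _ z _ = ⊥-elim (unB (ρ-inj un Bn z))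
    ... | tri> _ _ z = ⊥-elim (no-cross-τ k kd c u cn un cA cB (λ e → ρ<⇒≢ x (sym e)) (λ e → ρ<⇒≢ z (sym e)) bt (λ { (_ , e) → <-asym z e }) (subst (InT n T) (seg-sym u c) iuc))

  step-α-side : ∀ k → (skd : suc k < d) → ρ (w' k) < m → α (suc k) ≡ w' k × β (suc k) ≡ β k × w (suc k) ≡ α k
  step-α-side k skd cm = go (fromInT (subst (InT n T) (seg-sym (β k) (w' k)) (ApexData.iβ (farApex k (suc<⇒< skd))))
                          (crossγ (w' k) (β k) (ApexData.cn (farApex k (suc<⇒< skd))) (βn k (suc<⇒< skd)) (<-trans (p<α k (suc<⇒< skd)) (proj₁ (w'-far k (suc<⇒< skd)))) cm (proj₂ (q-between k (suc<⇒< skd)))))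
    where
      go : (Σ ℕ λ j → j < d × τ j ≡ seg (w' k) (β k)) → α (suc k) ≡ w' k × β (suc k) ≡ β k × w (suc k) ≡ α k
      go (j , jd , ej) = let e = αβOf j jd ej cm (proj₂ (q-between k (suc<⇒< skd))) in
        StepαSide.a1 k skd cm j jd (proj₁ e) (proj₂ e) , StepαSide.b1 k skd cm j jd (proj₁ e) (proj₂ e) , StepαSide.w1 k skd cm j jd (proj₁ e) (proj₂ e)

  module StepβSide (k : ℕ) (skd : suc k < d) (mc : m < ρ (w' k)) (j : ℕ) (jd : j < d) (ea : α j ≡ α k) (eb : β j ≡ w' k) where
    open Step k skd
    kj : suc k ≤ j
    kj with <-cmp k j
    ... | tri< x _ _ = x
    ... | tri≈ _ x _ = ⊥-elim (ApexData.cβ Ap (sym (subst (λ z → β z ≡ c) (sym x) eb)))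
    ... | tri> _ _ x with beforeEnd j k x kd B (endτβ k kd)
    ... | inj₁ y = ⊥-elim (ρ<⇒≢ (αβ< k kd) (sym (trans y ea)))
    ... | inj₂ (inj₁ y) = ⊥-elim (ApexData.cβ Ap (sym (trans y eb)))
    ... | inj₂ (inj₂ (_ , y)) = ⊥-elim (<-asym (proj₂ bt) (subst (λ z → ρ B < ρ z) eb y))
    mj = nested (suc k) j kj jd
    a1 : A' ≡ A
    a1 = ≡-from-≤ A'n An (subst (λ z → ρ A' ≤ ρ z) ea (proj₁ mj)) (proj₁ mo)
    c≤B' : ρ c ≤ ρ B'
    c≤B' = subst (λ z → ρ z ≤ ρ B') eb (proj₂ mj)
    b1 : B' ≡ c
    b1 with <-cmp (ρ B') (ρ B)
    ... | tri≈ _ x _ = ⊥-elim (ne (sym a1 , sym (ρ-inj B'n Bn x)))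
    ... | tri> _ _ x = ⊥-elim (<⇒≱ x (proj₂ mo))
    ... | tri< x _ _ with <-cmp (ρ c) (ρ B')
    ... | tri≈ _ y _ = sym (ρ-inj cn B'n y)
    ... | tri> _ _ y = ⊥-elim (<⇒≱ y c≤B')
    ... | tri< y _ _ = ⊥-elim (no-cross-τ (suc k) skd c B cn Bn (λ z → ρ<⇒≢ (<-trans (proj₁ (q-between (suc k) skd)) mc) (sym z)) (ρ<⇒≢ y) (λ z → ρ<⇒≢ A'<B (sym z)) (λ z → ρ<⇒≢ x (sym z)) (<-trans (proj₁ (q-between (suc k) skd)) mc , y) (λ { (_ , z) → <-asym x z }) (subst (InT n T) (seg-sym B c) (ApexData.iβ Ap)))
    u = w (suc k)
    Wp = nearApex (suc k) skd
    un = ApexData.cn Wp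
    iuA : InT n T (seg u A)
    iuA = subst (InT n T) (trans (seg-sym A' u) (cong (seg u) a1)) (ApexData.iα Wp)
    iuc : InT n T (seg u c)
    iuc = subst (InT n T) (trans (seg-sym B' u) (cong (seg u) b1)) (ApexData.iβ Wp)
    unA : u ≢ A
    unA z = ApexData.cα Wp (trans z (sym a1))
    unc : u ≢ c
    unc z = ApexData.cβ Wp (trans z (sym b1))
    nb : ¬ Between A c u
    nb = subst₂ (λ x y → ¬ Between x y u) a1 b1 (w-near (suc k) skd)
    cA : c ≢ A
    cA = ApexData.cα Ap
    cB : c ≢ B
    cB = ApexData.cβ Ap
    w1 : u ≡ B
    w1 with <-cmp (ρ u) (ρ A)
    ... | tri≈ _ x _ = ⊥-elim (unA (ρ-inj un An x))
    ... | tri< x _ _ = ⊥-elim (no-cross-τ k kd c u cn un cA cB (ρ<⇒≢ x) (ρ<⇒≢ (<-trans x (αβ< k kd))) bt (λ { (z , _) → <-asym x z }) (subst (InT n T) (seg-sym u c) iuc))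
    ... | tri> _ _ x with <-cmp (ρ u) (ρ c)
    ... | tri≈ _ y _ = ⊥-elim (unc (ρ-inj un cn y))
    ... | tri< y _ _ = ⊥-elim (nb (x , y))
    ... | tri> _ _ y with <-cmp (ρ u) (ρ B)
    ... | tri≈ _ z _ = ρ-inj un Bn z
    ... | tri< z _ _ = ⊥-elim (no-cross-edge c B (subst (InT n T) (seg-sym B c) (ApexData.iβ Ap)) (proj₂ bt) u A un An unc (λ e → ρ<⇒≢ z e) (λ e → cA (sym e)) (λ e → ρ<⇒≢ (αβ< k kd) e) y z (inj₁ (proj₁ bt)) iuA)
    ... | tri> _ _ z = ⊥-elim (no-cross-τ k kd c u cn un cA cB (λ e → ρ<⇒≢ x (sym e)) (λ e → ρ<⇒≢ z (sym e)) bt (λ { (_ , e) → <-asym z e }) (subst (InT n T) (seg-sym u c) iuc))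

  step-β-side : ∀ k → (skd : suc k < d) → m < ρ (w' k) → α (suc k) ≡ α k × β (suc k) ≡ w' k × w (suc k) ≡ β k
  step-β-side k skd mc = go (fromInT (ApexData.iα (farApex k (suc<⇒< skd))) (crossγ (α k) (w' k) (αn k (suc<⇒< skd)) (ApexData.cn (farApex k (suc<⇒< skd))) (p<α k (suc<⇒< skd)) (proj₁ (q-between k (suc<⇒< skd))) mc))
    where
      go : (Σ ℕ λ j → j < d × τ j ≡ seg (α k) (w' k)) → α (suc k) ≡ α k × β (suc k) ≡ w' k × w (suc k) ≡ β k
      go (j , jd , ej) = let e = αβOf j jd ej (proj₁ (q-between k (suc<⇒< skd))) mc in
        StepβSide.a1 k skd mc j jd (proj₁ e) (proj₂ e) , StepβSide.b1 k skd mc j jd (proj₁ e) (proj₂ e) , StepβSide.w1 k skd mc j jd (proj₁ e) (proj₂ e)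

-- The edges of T': PA, PB join p to α 0, β 0; QA, QB join α (d-1), β (d-1) to q; Tau j is the
-- crossed diagonal τ j and G j is [γ_j].  A Role names a side of Q_{τ k}: w–α, w–β, α–w', β–w'.
data Desc : Set where
  PA PB QA QB : Desc
  Tau G : ℕ → Desc

data Role : Set where
  RWa RWb RAw RBw : Role

data Kind : Set where
  kPA kPB kQA kQB kT kGL kGR : Kind

module EdgeDescriptors {n : ℕ} {T : List Seg} {p q d : ℕ} {τ : ℕ → Seg} {w w' : ℕ → ℕ}
  (S : CrossingSetup n T p q d τ w w') where

  open CrossedDiagonals S public
  open CrossingSetup S
  open Snake n T p q d τ w w' public

  -- Whether w' k lies on the side of γ containing the α endpoints, i.e. whether τ (k+1) is
  -- (w' k , β k) rather than (α k , w' k).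
  onαSide : ℕ → Bool
  onαSide k = ρ (w' k) <ᵇ m

  gamEnd : ℕ → ℕ
  gamEnd k = if onαSide k then α k else β k

  Stepα : ℕ → Set
  Stepα k = α (suc k) ≡ w' k × β (suc k) ≡ β k × w (suc k) ≡ α k
  Stepβ : ℕ → Set
  Stepβ k = α (suc k) ≡ α k × β (suc k) ≡ w' k × w (suc k) ≡ β k

  consecutive-step : ∀ k → suc k < d → (onαSide k ≡ true × Stepα k) ⊎ (onαSide k ≡ false × Stepβ k)
  consecutive-step k skd with onαSide k in e
  ... | true = inj₁ (refl , step-α-side k skd (<ᵇ-t⇒ e))
  ... | false = inj₂ (refl , step-β-side k skd mc)
    where
      mc : m < ρ (w' k)
      mc with <-cmp m (ρ (w' k))
      ... | tri< x _ _ = x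
      ... | tri≈ _ x _ = ⊥-elim (w'≢q k skd (ρ-inj (ApexData.cn (farApex k (suc<⇒< skd))) q<n (sym x)))
      ... | tri> _ _ x = ⊥-elim (t≢f (trans (sym (<ᵇ-t x)) e))

  gamEnd-α : ∀ {k} → onαSide k ≡ true → gamEnd k ≡ α k
  gamEnd-α {k} e = cong (λ b → if b then α k else β k) e
  gamEnd-β : ∀ {k} → onαSide k ≡ false → gamEnd k ≡ β k
  gamEnd-β {k} e = cong (λ b → if b then α k else β k) e

  succW≡ : ∀ k → k < d → succW k ≡ α k
  succW≡ k kd with proj₂ (proj₂ (proj₂ (p-apex k kd))) | ≡ᵇ-f {proj₂ (τ k)} {p} (≢-sym (proj₂ (np k kd)))
  ... | e1 | e2 rewrite e1 | e2 with inside (τ k) p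
  ... | true = refl
  ... | false = refl

  predW≡ : ∀ k → k < d → predW k ≡ β k
  predW≡ k kd with proj₂ (proj₂ (proj₂ (p-apex k kd))) | ≡ᵇ-f {proj₂ (τ k)} {p} (≢-sym (proj₂ (np k kd)))
  ... | e1 | e2 rewrite e1 | e2 with inside (τ k) p
  ... | true = refl
  ... | false = refl

  descEnds : Desc → ℕ × ℕ
  descEnds PA = p , α 0
  descEnds PB = p , β 0
  descEnds QA = α (d ∸ 1) , q
  descEnds QB = β (d ∸ 1) , q
  descEnds (Tau j) = α j , β j
  descEnds (G j) = gamEnd j , w' j

  descSeg : Desc → Seg
  descSeg e = seg (proj₁ (descEnds e)) (proj₂ (descEnds e))

  ValidDesc : Desc → Set
  ValidDesc (Tau j) = j < d
  ValidDesc (G j) = suc j < d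
  ValidDesc _ = ⊤

  roleEnds : ℕ → Role → ℕ × ℕ
  roleEnds k RWa = w k , α k
  roleEnds k RWb = w k , β k
  roleEnds k RAw = α k , w' k
  roleEnds k RBw = β k , w' k

  roleSeg : ℕ → Role → Seg
  roleSeg k r = seg (proj₁ (roleEnds k r)) (proj₂ (roleEnds k r))

  sideRole : ℕ → Side → Role
  sideRole k South = if isEven k then RWa else RWb
  sideRole k West = if isEven k then RWb else RWa
  sideRole k East = if isEven k then RAw else RBw
  sideRole k North = if isEven k then RBw else RAw

  labelRole : ∀ k → k < d → ∀ s → label k s ≡ roleSeg k (sideRole k s)
  labelRole k kd South rewrite succW≡ k kd | predW≡ k kd with isEven k
  ... | true = refl
  ... | false = refl
  labelRole k kd West rewrite succW≡ k kd | predW≡ k kd with isEven k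
  ... | true = refl
  ... | false = refl
  labelRole k kd East rewrite succW≡ k kd | predW≡ k kd with isEven k
  ... | true = refl
  ... | false = refl
  labelRole k kd North rewrite succW≡ k kd | predW≡ k kd with isEven k
  ... | true = refl
  ... | false = refl

  drW : Bool → ℕ → Desc
  drW true i = G i
  drW false i = Tau i
  drW' : Bool → ℕ → Desc
  drW' true i = Tau i
  drW' false i = G i
  drA : Bool → Bool → ℕ → Desc
  drA true _ k = QA
  drA false true k = G k
  drA false false k = Tau (suc k)
  drB : Bool → Bool → ℕ → Desc
  drB true _ k = QB
  drB false true k = Tau (suc k)
  drB false false k = G k

  roleDesc : ℕ → Role → Desc
  roleDesc k RAw = drA (suc k ≡ᵇ d) (onαSide k) k
  roleDesc k RBw = drB (suc k ≡ᵇ d) (onαSide k) k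
  roleDesc zero RWa = PA
  roleDesc (suc i) RWa = drW (onαSide i) i
  roleDesc zero RWb = PB
  roleDesc (suc i) RWb = drW' (onαSide i) i

  lastPred : ∀ {k} → suc k ≡ d → d ∸ 1 ≡ k
  lastPred refl = refl

  notLast : ∀ {k} → k < d → (suc k ≡ᵇ d) ≡ false → suc k < d
  notLast {k} kd e with <-cmp (suc k) d
  ... | tri< x _ _ = x
  ... | tri≈ _ x _ = ⊥-elim (t≢f (trans (sym (≡ᵇ-t x)) e))
  ... | tri> _ _ x = ⊥-elim (<⇒≱ x kd)

  roleDesc-correct : ∀ k → k < d → ∀ r → roleSeg k r ≡ descSeg (roleDesc k r) × ValidDesc (roleDesc k r)
  roleDesc-correct zero kd RWa rewrite w0≡p = refl , tt
  roleDesc-correct zero kd RWb rewrite w0≡p = refl , tt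
  roleDesc-correct (suc i) kd RWa with consecutive-step i kd
  ... | inj₁ (e , a , b , c) rewrite e | a | c | gamEnd-α {i} e = refl , kd
  ... | inj₂ (e , a , b , c) rewrite e | a | c = seg-sym (β i) (α i) , suc<⇒< kd
  roleDesc-correct (suc i) kd RWb with consecutive-step i kd
  ... | inj₁ (e , a , b , c) rewrite e | b | c = refl , suc<⇒< kd
  ... | inj₂ (e , a , b , c) rewrite e | b | c | gamEnd-β {i} e = refl , kd
  roleDesc-correct k kd RAw with suc k ≡ᵇ d in el
  ... | true rewrite lastPred (≡ᵇ-t⇒ el) | w'-last k (≡ᵇ-t⇒ el) = refl , tt
  ... | false with consecutive-step k (notLast kd el)
  ... | inj₁ (e , a , b , c) rewrite e | gamEnd-α {k} e = refl , notLast kd el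
  ... | inj₂ (e , a , b , c) rewrite e | a | b = refl , notLast kd el
  roleDesc-correct k kd RBw with suc k ≡ᵇ d in el
  ... | true rewrite lastPred (≡ᵇ-t⇒ el) | w'-last k (≡ᵇ-t⇒ el) = refl , tt
  ... | false with consecutive-step k (notLast kd el)
  ... | inj₁ (e , a , b , c) rewrite e | a | b = seg-sym (β k) (w' k) , notLast kd el
  ... | inj₂ (e , a , b , c) rewrite e | gamEnd-β {k} e = refl , notLast kd el

  ind : Bool → ℕ
  ind true = 1
  ind false = 0

  F3 : Set
  F3 = ℕ × ℕ × ℕ

  -- Summed over both endpoints, (is p, is q, lies on the α side of γ) takes a different value on
  -- each class of edges of T' (kindF), so edges of different classes are different segments.
  vertexFeatures : ℕ → F3
  vertexFeatures v = ind (v ≡ᵇ p) , ind (v ≡ᵇ q) , ind (ρ v <ᵇ m)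

  _⊕_ : F3 → F3 → F3
  (a , b , c) ⊕ (a' , b' , c') = (a + a' , b + b' , c + c')

  ⊕-comm : ∀ x y → x ⊕ y ≡ y ⊕ x
  ⊕-comm (a , b , c) (a' , b' , c') rewrite +-comm a a' | +-comm b b' | +-comm c c' = refl

  segFeatures : ℕ × ℕ → F3
  segFeatures (x , y) = vertexFeatures x ⊕ vertexFeatures y

  conA : ∀ {v} → v ≢ p → v ≢ q → ρ v < m → vertexFeatures v ≡ (0 , 0 , 1)
  conA vp vq vm rewrite ≡ᵇ-f vp | ≡ᵇ-f vq | <ᵇ-t vm = refl
  conB : ∀ {v} → v ≢ p → v ≢ q → ¬ ρ v < m → vertexFeatures v ≡ (0 , 0 , 0)
  conB vp vq vm rewrite ≡ᵇ-f vp | ≡ᵇ-f vq | <ᵇ-f vm = refl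
  conP : vertexFeatures p ≡ (1 , 0 , 1)
  conP rewrite ≡ᵇ-t {p} refl | ≡ᵇ-f p≢q | <ᵇ-t (subst (_< m) (sym ρp) p<m) = refl
  conQ : vertexFeatures q ≡ (0 , 1 , 0)
  conQ rewrite ≡ᵇ-f (≢-sym p≢q) | ≡ᵇ-t {q} refl | <ᵇ-f (n≮n m) = refl

  αp : ∀ k → k < d → α k ≢ p
  αp k kd e = n≮n _ (subst (p <_) (trans (cong ρ e) ρp) (p<α k kd))
  αq : ∀ k → k < d → α k ≢ q
  αq k kd = ρ<⇒≢ (proj₁ (q-between k kd))
  βp : ∀ k → k < d → β k ≢ p
  βp k kd e = <-asym p<m (subst (m <_) (trans (cong ρ e) ρp) (proj₂ (q-between k kd)))
  βq : ∀ k → k < d → β k ≢ q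
  βq k kd e = ρ<⇒≢ (proj₂ (q-between k kd)) (sym e)
  w'p : ∀ k → k < d → w' k ≢ p
  w'p k kd e = n≮n _ (subst (p <_) (trans (cong ρ e) ρp) (<-trans (p<α k kd) (proj₁ (w'-far k kd))))

  conα : ∀ k → k < d → vertexFeatures (α k) ≡ (0 , 0 , 1)
  conα k kd = conA (αp k kd) (αq k kd) (proj₁ (q-between k kd))
  conβ : ∀ k → k < d → vertexFeatures (β k) ≡ (0 , 0 , 0)
  conβ k kd = conB (βp k kd) (βq k kd) (λ z → <-asym z (proj₂ (q-between k kd)))

  kind : Desc → Kind
  kind PA = kPA
  kind PB = kPB
  kind QA = kQA
  kind QB = kQB
  kind (Tau _) = kT
  kind (G j) = if onαSide j then kGL else kGR

  kindF : F3 → Kind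
  kindF (1 , 0 , 2) = kPA
  kindF (1 , 0 , 1) = kPB
  kindF (0 , 1 , 1) = kQA
  kindF (0 , 1 , 0) = kQB
  kindF (0 , 0 , 2) = kGL
  kindF (0 , 0 , 0) = kGR
  kindF _ = kT

  d-1<d : d ∸ 1 < d
  d-1<d = pr d>0
    where pr : ∀ {x} → 0 < x → x ∸ 1 < x
          pr {suc x} _ = n<1+n x

  kind-from-features : ∀ e → ValidDesc e → kindF (segFeatures (descEnds e)) ≡ kind e
  kind-from-features PA _ = cong kindF (cong₂ _⊕_ conP (conα 0 d>0))
  kind-from-features PB _ = cong kindF (cong₂ _⊕_ conP (conβ 0 d>0))
  kind-from-features QA _ = cong kindF (cong₂ _⊕_ (conα (d ∸ 1) d-1<d) conQ)
  kind-from-features QB _ = cong kindF (cong₂ _⊕_ (conβ (d ∸ 1) d-1<d) conQ)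
  kind-from-features (Tau j) jd = cong kindF (cong₂ _⊕_ (conα j jd) (conβ j jd))
  kind-from-features (G j) sjd with onαSide j in e
  ... | true = cong kindF (cong₂ _⊕_ (conα j (suc<⇒< sjd)) (cong₂ _,_ (cong ind (≡ᵇ-f (w'p j (suc<⇒< sjd)))) (cong₂ _,_ (cong ind (≡ᵇ-f (w'≢q j sjd))) refl)))
  ... | false = cong kindF (cong₂ _⊕_ (conβ j (suc<⇒< sjd)) (cong₂ _,_ (cong ind (≡ᵇ-f (w'p j (suc<⇒< sjd)))) (cong₂ _,_ (cong ind (≡ᵇ-f (w'≢q j sjd))) refl)))

  segFeatures-seg : ∀ {x y x' y'} → seg x y ≡ seg x' y' → segFeatures (x , y) ≡ segFeatures (x' , y')
  segFeatures-seg {x} {y} h with seg-inj h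
  ... | inj₁ (refl , refl) = refl
  ... | inj₂ (refl , refl) = ⊕-comm (vertexFeatures x) (vertexFeatures y)

  kindG : ∀ j → (kind (G j) ≡ kGL × onαSide j ≡ true) ⊎ (kind (G j) ≡ kGR × onαSide j ≡ false)
  kindG j with onαSide j
  ... | true = inj₁ (refl , refl)
  ... | false = inj₂ (refl , refl)

  kPA-inv : ∀ e → kind e ≡ kPA → e ≡ PA
  kPA-inv PA _ = refl
  kPA-inv PB ()
  kPA-inv QA ()
  kPA-inv QB ()
  kPA-inv (Tau j) ()
  kPA-inv (G j) h with kindG j
  ... | inj₁ (x , _) with trans (sym x) h
  ... | ()
  kPA-inv (G j) h | inj₂ (x , _) with trans (sym x) h
  ... | ()

  kPB-inv : ∀ e → kind e ≡ kPB → e ≡ PB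
  kPB-inv PA ()
  kPB-inv PB _ = refl
  kPB-inv QA ()
  kPB-inv QB ()
  kPB-inv (Tau j) ()
  kPB-inv (G j) h with kindG j
  ... | inj₁ (x , _) with trans (sym x) h
  ... | ()
  kPB-inv (G j) h | inj₂ (x , _) with trans (sym x) h
  ... | ()

  kQA-inv : ∀ e → kind e ≡ kQA → e ≡ QA
  kQA-inv PA ()
  kQA-inv PB ()
  kQA-inv QA _ = refl
  kQA-inv QB ()
  kQA-inv (Tau j) ()
  kQA-inv (G j) h with kindG j
  ... | inj₁ (x , _) with trans (sym x) h
  ... | ()
  kQA-inv (G j) h | inj₂ (x , _) with trans (sym x) h
  ... | ()

  kQB-inv : ∀ e → kind e ≡ kQB → e ≡ QB
  kQB-inv PA ()
  kQB-inv PB ()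
  kQB-inv QA ()
  kQB-inv QB _ = refl
  kQB-inv (Tau j) ()
  kQB-inv (G j) h with kindG j
  ... | inj₁ (x , _) with trans (sym x) h
  ... | ()
  kQB-inv (G j) h | inj₂ (x , _) with trans (sym x) h
  ... | ()

  kT-inv : ∀ e → kind e ≡ kT → Σ ℕ λ j → e ≡ Tau j
  kT-inv PA ()
  kT-inv PB ()
  kT-inv QA ()
  kT-inv QB ()
  kT-inv (Tau j) _ = j , refl
  kT-inv (G j) h with kindG j
  ... | inj₁ (x , _) with trans (sym x) h
  ... | ()
  kT-inv (G j) h | inj₂ (x , _) with trans (sym x) h
  ... | ()

  kG-inv : ∀ e K → K ≡ kGL ⊎ K ≡ kGR → kind e ≡ K → Σ ℕ λ j → e ≡ G j
  kG-inv PA K (inj₁ refl) ()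
  kG-inv PA K (inj₂ refl) ()
  kG-inv PB K (inj₁ refl) ()
  kG-inv PB K (inj₂ refl) ()
  kG-inv QA K (inj₁ refl) ()
  kG-inv QA K (inj₂ refl) ()
  kG-inv QB K (inj₁ refl) ()
  kG-inv QB K (inj₂ refl) ()
  kG-inv (Tau j) K (inj₁ refl) ()
  kG-inv (Tau j) K (inj₂ refl) ()
  kG-inv (G j) _ _ _ = j , refl

  tauInj : ∀ i j → i < d → j < d → descSeg (Tau i) ≡ descSeg (Tau j) → i ≡ j
  tauInj i j id jd h with <-cmp i j
  ... | tri< x _ _ = ⊥-elim (τ≢ i j x jd (trans (τseg i id) (trans h (sym (τseg j jd)))))
  ... | tri≈ _ x _ = x
  ... | tri> _ _ x = ⊥-elim (τ≢ j i x id (sym (trans (τseg i id) (trans h (sym (τseg j jd))))))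

  gL-lt : ∀ i j → i < j → j < d → onαSide i ≡ true → α i ≡ α j → ⊥
  gL-lt i j ij jd e a with consecutive-step i (≤-<-trans ij jd)
  ... | inj₂ (e' , _) = t≢f (trans (sym e) e')
  ... | inj₁ (_ , a1 , _ , _) = n≮n _ (<-≤-trans (proj₁ (w'-far i (<-trans ij jd)))
          (subst (λ z → ρ z ≤ ρ (α i)) a1 (subst (λ z → ρ (α (suc i)) ≤ ρ z) (sym a) (proj₁ (nested (suc i) j ij jd)))))

  gR-lt : ∀ i j → i < j → j < d → onαSide i ≡ false → β i ≡ β j → ⊥
  gR-lt i j ij jd e b with consecutive-step i (≤-<-trans ij jd)
  ... | inj₁ (e' , _) = t≢f (trans (sym e') e)
  ... | inj₂ (_ , _ , b1 , _) = n≮n _ (<-≤-trans (proj₂ (w'-far i (<-trans ij jd)))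
          (subst (λ z → ρ (β i) ≤ ρ z) b1 (subst (λ z → ρ z ≤ ρ (β (suc i))) (sym b) (proj₂ (nested (suc i) j ij jd)))))

  gInj : ∀ i j → suc i < d → suc j < d → onαSide i ≡ onαSide j → descSeg (G i) ≡ descSeg (G j) → i ≡ j
  gInj i j id jd ee h with onαSide i in ei | onαSide j in ej
  gInj i j id jd refl h | true | true with seg-inj h
  ... | inj₂ (a , b) = ⊥-elim (<-asym (proj₁ (w'-far i (suc<⇒< id))) (subst₂ (λ x y → ρ x < ρ y) (sym b) (sym a) (proj₁ (w'-far j (suc<⇒< jd)))))
  ... | inj₁ (a , _) with <-cmp i j
  ... | tri< x _ _ = ⊥-elim (gL-lt i j x (suc<⇒< jd) ei a)
  ... | tri≈ _ x _ = x
  ... | tri> _ _ x = ⊥-elim (gL-lt j i x (suc<⇒< id) ej (sym a))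
  gInj i j id jd refl h | false | false with seg-inj h
  ... | inj₂ (a , b) = ⊥-elim (<-asym (proj₂ (w'-far i (suc<⇒< id))) (subst₂ (λ x y → ρ x < ρ y) (sym a) (sym b) (proj₂ (w'-far j (suc<⇒< jd)))))
  ... | inj₁ (a , _) with <-cmp i j
  ... | tri< x _ _ = ⊥-elim (gR-lt i j x (suc<⇒< jd) ei a)
  ... | tri≈ _ x _ = x
  ... | tri> _ _ x = ⊥-elim (gR-lt j i x (suc<⇒< id) ej (sym a))

  LbG : ∀ i j → kind (G i) ≡ kind (G j) → onαSide i ≡ onαSide j
  LbG i j h with kindG i | kindG j
  ... | inj₁ (_ , a) | inj₁ (_ , b) = trans a (sym b)
  ... | inj₂ (_ , a) | inj₂ (_ , b) = trans a (sym b)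
  ... | inj₁ (x , _) | inj₂ (y , _) with trans (sym x) (trans h y)
  ... | ()
  LbG i j h | inj₂ (x , _) | inj₁ (y , _) with trans (sym x) (trans h y)
  ... | ()

  kind-of-seg : ∀ e e' → ValidDesc e → ValidDesc e' → descSeg e ≡ descSeg e' → kind e ≡ kind e'
  kind-of-seg e e' ve ve' h = trans (sym (kind-from-features e ve)) (trans (cong kindF (segFeatures-seg h)) (kind-from-features e' ve'))

  descSeg-injective : ∀ e e' → ValidDesc e → ValidDesc e' → descSeg e ≡ descSeg e' → e ≡ e'
  descSeg-injective PA e' ve ve' h = sym (kPA-inv e' (sym (kind-of-seg PA e' ve ve' h)))
  descSeg-injective PB e' ve ve' h = sym (kPB-inv e' (sym (kind-of-seg PB e' ve ve' h)))
  descSeg-injective QA e' ve ve' h = sym (kQA-inv e' (sym (kind-of-seg QA e' ve ve' h)))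
  descSeg-injective QB e' ve ve' h = sym (kQB-inv e' (sym (kind-of-seg QB e' ve ve' h)))
  descSeg-injective (Tau i) e' ve ve' h with kT-inv e' (sym (kind-of-seg (Tau i) e' ve ve' h))
  ... | j , refl = cong Tau (tauInj i j ve ve' h)
  descSeg-injective (G i) e' ve ve' h with kindG i
  ... | inj₁ (x , _) with kG-inv e' kGL (inj₁ refl) (trans (sym (kind-of-seg (G i) e' ve ve' h)) x)
  ... | j , refl = cong G (gInj i j ve ve' (LbG i j (kind-of-seg (G i) (G j) ve ve' h)) h)
  descSeg-injective (G i) e' ve ve' h | inj₂ (x , _) with kG-inv e' kGR (inj₂ refl) (trans (sym (kind-of-seg (G i) e' ve ve' h)) x)
  ... | j , refl = cong G (gInj i j ve ve' (LbG i j (kind-of-seg (G i) (G j) ve ve' h)) h)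

anyBelow-t : ∀ N f → anyBelow N f ≡ true → Σ ℕ λ k → k < N × f k ≡ true
anyBelow-t zero f ()
anyBelow-t (suc N) f h with f N in e
... | true = N , n<1+n N , e
... | false with anyBelow-t N f h
... | k , kN , fk = k , <-trans kN (n<1+n N) , fk

anyBelow-i : ∀ N f k → k < N → f k ≡ true → anyBelow N f ≡ true
anyBelow-i (suc N) f k kN fk with f N in e
... | true = refl
... | false with <-cmp k N
... | tri< x _ _ = anyBelow-i N f k x fk
... | tri≈ _ refl _ = ⊥-elim (t≢f (trans (sym fk) e))
... | tri> _ _ x = ⊥-elim (<⇒≱ x (≤-pred kN))

cb-mono : ∀ N f g → (∀ x → x < N → f x ≡ true → g x ≡ true) → countBelow N f ≤ countBelow N g
cb-mono zero f g h = z≤n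
cb-mono (suc N) f g h with f N in ef | g N in eg
... | true | true = s≤s (cb-mono N f g λ x xN → h x (<-trans xN (n<1+n N)))
... | true | false = ⊥-elim (t≢f (trans (sym (h N (n<1+n N) ef)) eg))
... | false | true = ≤-trans (cb-mono N f g λ x xN → h x (<-trans xN (n<1+n N))) (n≤1+n _)
... | false | false = cb-mono N f g λ x xN → h x (<-trans xN (n<1+n N))

cb-ext : ∀ N f g → (∀ x → x < N → f x ≡ g x) → countBelow N f ≡ countBelow N g
cb-ext zero f g h = refl
cb-ext (suc N) f g h rewrite h N (n<1+n N) = cong (_ +_) (cb-ext N f g λ x xN → h x (<-trans xN (n<1+n N)))

cb-or : ∀ N f g → (∀ x → x < N → f x ≡ true → g x ≡ false) →
        countBelow N (λ x → f x ∨ g x) ≡ countBelow N f + countBelow N g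
cb-or zero f g h = refl
cb-or (suc N) f g h with f N in ef | g N in eg
... | true | true = ⊥-elim (t≢f (trans (sym eg) (h N (n<1+n N) ef)))
... | true | false = cong suc (cb-or N f g λ x xN → h x (<-trans xN (n<1+n N)))
... | false | true = trans (cong suc (cb-or N f g λ x xN → h x (<-trans xN (n<1+n N)))) (sym (+-suc (countBelow N f) (countBelow N g)))
... | false | false = cb-or N f g λ x xN → h x (<-trans xN (n<1+n N))

cb-single : ∀ N a → a < N → countBelow N (λ x → x ≡ᵇ a) ≡ 1
cb-single zero a ()
cb-single (suc N) a aN with N ≡ᵇ a in e
... | true = cong suc (cb-zero N (≤-reflexive (≡ᵇ-t⇒ {N} {a} e)))
  where
    cb-zero : ∀ M → M ≤ a → countBelow M (λ x → x ≡ᵇ a) ≡ 0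
    cb-zero zero _ = refl
    cb-zero (suc M) Ma rewrite ≡ᵇ-f {M} {a} (λ z → n≮n _ (subst (_< a) z Ma)) = cb-zero M (<⇒≤ Ma)
... | false = cb-single N a (≤∧≢⇒< (≤-pred aN) (λ z → t≢f (trans (sym (≡ᵇ-t (sym z))) e)))

bool-ext : ∀ {b c : Bool} → (b ≡ true → c ≡ true) → (c ≡ true → b ≡ true) → b ≡ c
bool-ext {true} {true} _ _ = refl
bool-ext {true} {false} f _ = sym (f refl)
bool-ext {false} {true} _ g = g refl
bool-ext {false} {false} _ _ = refl

memb : ℕ → List ℕ → Bool
memb x [] = false
memb x (a ∷ L) = (x ≡ᵇ a) ∨ memb x L

Distinct : List ℕ → Set
Distinct [] = ⊤
Distinct (a ∷ L) = (memb a L ≡ false) × Distinct L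

AllLt : ℕ → List ℕ → Set
AllLt N [] = ⊤
AllLt N (a ∷ L) = a < N × AllLt N L

cb-list : ∀ N L → AllLt N L → Distinct L → countBelow N (λ x → memb x L) ≡ length L
cb-list N [] _ _ = cb-zero N
  where cb-zero : ∀ M → countBelow M (λ x → false) ≡ 0
        cb-zero zero = refl
        cb-zero (suc M) = cb-zero M
cb-list N (a ∷ L) (aN , al) (ma , dl) =
  trans (cb-or N (λ x → x ≡ᵇ a) (λ x → memb x L) (λ x _ e → subst (λ z → memb z L ≡ false) (sym (≡ᵇ-t⇒ e)) ma))
        (cong₂ _+_ (cb-single N a aN) (cb-list N L al dl))

∨-iL : ∀ {a b} → a ≡ true → (a ∨ b) ≡ true
∨-iL refl = refl
∨-iR : ∀ {a b} → b ≡ true → (a ∨ b) ≡ true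
∨-iR {true} _ = refl
∨-iR {false} h = h

boolCase : ∀ b → b ≡ false ⊎ b ≡ true
boolCase false = inj₁ refl
boolCase true = inj₂ refl

NotTau : Desc → Set
NotTau (Tau _) = ⊥
NotTau _ = ⊤

module SubpolygonBoundary {n : ℕ} {T : List Seg} {p q d : ℕ} {τ : ℕ → Seg} {w w' : ℕ → ℕ}
  (S : CrossingSetup n T p q d τ w w') where

  open EdgeDescriptors S public
  open CrossingSetup S

  VertexT' : ℕ → Set
  VertexT' x = x ≡ p ⊎ x ≡ q ⊎ Σ ℕ (λ k → k < d × (x ≡ α k ⊎ x ≡ β k))

  inV'⇒ : ∀ {x} → inV' x ≡ true → VertexT' x
  inV'⇒ {x} h with ∨-t⇒ {x ≡ᵇ p} h
  ... | inj₁ e = inj₁ (≡ᵇ-t⇒ e)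
  ... | inj₂ h2 with ∨-t⇒ {x ≡ᵇ q} h2
  ... | inj₁ e = inj₂ (inj₁ (≡ᵇ-t⇒ e))
  ... | inj₂ h3 with anyBelow-t d (λ k → isEnd (τ k) x) h3
  ... | k , kd , e = inj₂ (inj₂ (k , kd , endsτ k kd e))

  ⇒inV' : ∀ {x} → VertexT' x → inV' x ≡ true
  ⇒inV' (inj₁ refl) = ∨-iL (≡ᵇ-t {p} refl)
  ⇒inV' {x} (inj₂ (inj₁ refl)) = ∨-iR {x ≡ᵇ p} (∨-iL (≡ᵇ-t {q} refl))
  ⇒inV' {x} (inj₂ (inj₂ (k , kd , inj₁ refl))) = ∨-iR {x ≡ᵇ p} (∨-iR {x ≡ᵇ q} (anyBelow-i d _ k kd (endτα k kd)))
  ⇒inV' {x} (inj₂ (inj₂ (k , kd , inj₂ refl))) = ∨-iR {x ≡ᵇ p} (∨-iR {x ≡ᵇ q} (anyBelow-i d _ k kd (endτβ k kd)))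

  InV-n : ∀ {x} → VertexT' x → x < n
  InV-n (inj₁ refl) = p<n
  InV-n (inj₂ (inj₁ refl)) = q<n
  InV-n (inj₂ (inj₂ (k , kd , inj₁ refl))) = αn k kd
  InV-n (inj₂ (inj₂ (k , kd , inj₂ refl))) = βn k kd

  Consecutive : ℕ → ℕ → Set
  Consecutive x y = (∀ z → VertexT' z → z ≢ x → z ≢ y → ¬ Between x y z) ⊎ (∀ z → VertexT' z → z ≢ x → z ≢ y → Between x y z)

  btw? : ∀ x y z → Dec (Between x y z)
  btw? x y z = (ρ x <? ρ z) ×-dec (ρ z <? ρ y)

  module BD (s : Seg) (Vs : OrderedSeg n s) where
    u = proj₁ s
    v = proj₂ s
    C = chordOf s Vs
    cv1 : ∀ {z} → z ≢ Lo s → z ≢ Hi s → z ≢ u × z ≢ v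
    cv1 {z} a b with ends s Vs
    ... | inj₁ (e1 , e2) = (λ x → a (trans x (sym e1))) , (λ x → b (trans x (sym e2)))
    ... | inj₂ (e1 , e2) = (λ x → b (trans x (sym e2))) , (λ x → a (trans x (sym e1)))
    cv2 : ∀ {z} → z ≢ u → z ≢ v → z ≢ Lo s × z ≢ Hi s
    cv2 {z} a b with ends s Vs
    ... | inj₁ (e1 , e2) = (λ x → a (trans x e1)) , (λ x → b (trans x e2))
    ... | inj₂ (e1 , e2) = (λ x → b (trans x e1)) , (λ x → a (trans x e2))

    toCons : BdT' s → Consecutive (Lo s) (Hi s)
    toCons (uv , iu , iv , inj₁ A) with boolCase (flipped u v)
    ... | inj₁ ef = inj₁ λ z iz zL zH bt → A z (⇒inV' iz) (inside-t⇒ (trans (ChordInfo.bin C z (InV-n iz) (proj₁ (cv1 zL zH)) (proj₂ (cv1 zL zH)) bt) (cong not ef)))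
    ... | inj₂ ef = inj₂ λ z iz zL zH → dec z iz zL zH (btw? (Lo s) (Hi s) z)
      where
        dec : ∀ z → VertexT' z → z ≢ Lo s → z ≢ Hi s → Dec (Between (Lo s) (Hi s) z) → Between (Lo s) (Hi s) z
        dec z iz zL zH (yes b) = b
        dec z iz zL zH (no nb) = ⊥-elim (A z (⇒inV' iz) (inside-t⇒ (trans (ChordInfo.bout C z (InV-n iz) (proj₁ (cv1 zL zH)) (proj₂ (cv1 zL zH)) nb) ef)))
    toCons (uv , iu , iv , inj₂ B) with boolCase (flipped u v)
    ... | inj₂ ef = inj₁ λ z iz zL zH bt → outside z iz zL zH (trans (ChordInfo.bin C z (InV-n iz) (proj₁ (cv1 zL zH)) (proj₂ (cv1 zL zH)) bt) (cong not ef))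
      where
        outside : ∀ z → VertexT' z → z ≢ Lo s → z ≢ Hi s → inside (u , v) z ≡ false → ⊥
        outside z iz zL zH e with <-cmp u z | <-cmp z v
        ... | tri< a _ _ | tri< b _ _ = t≢f (trans (sym (inside-t a b)) e)
        ... | tri< a _ _ | tri≈ _ b _ = proj₂ (cv1 zL zH) b
        ... | tri< a _ _ | tri> _ _ b = B z (⇒inV' iz) (inj₂ b)
        ... | tri≈ _ a _ | _ = proj₁ (cv1 zL zH) (sym a)
        ... | tri> _ _ a | _ = B z (⇒inV' iz) (inj₁ a)
    ... | inj₁ ef = inj₂ λ z iz zL zH → dec z iz zL zH (btw? (Lo s) (Hi s) z)
      where
        outside : ∀ z → VertexT' z → z ≢ Lo s → z ≢ Hi s → inside (u , v) z ≡ false → ⊥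
        outside z iz zL zH e with <-cmp u z | <-cmp z v
        ... | tri< a _ _ | tri< b _ _ = t≢f (trans (sym (inside-t a b)) e)
        ... | tri< a _ _ | tri≈ _ b _ = proj₂ (cv1 zL zH) b
        ... | tri< a _ _ | tri> _ _ b = B z (⇒inV' iz) (inj₂ b)
        ... | tri≈ _ a _ | _ = proj₁ (cv1 zL zH) (sym a)
        ... | tri> _ _ a | _ = B z (⇒inV' iz) (inj₁ a)
        dec : ∀ z → VertexT' z → z ≢ Lo s → z ≢ Hi s → Dec (Between (Lo s) (Hi s) z) → Between (Lo s) (Hi s) z
        dec z iz zL zH (yes b) = b
        dec z iz zL zH (no nb) = ⊥-elim (outside z iz zL zH (trans (ChordInfo.bout C z (InV-n iz) (proj₁ (cv1 zL zH)) (proj₂ (cv1 zL zH)) nb) ef))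

    ins-false→A : (∀ z → VertexT' z → z ≢ u → z ≢ v → inside (u , v) z ≡ false) → ∀ z → inV' z ≡ true → ¬ (u < z × z < v)
    ins-false→A h z iz (a , b) = t≢f (trans (sym (inside-t a b)) (h z (inV'⇒ iz) (λ e → n≮n _ (subst (u <_) e a)) (λ e → n≮n _ (subst (_< v) e b))))

    ins-true→B : (∀ z → VertexT' z → z ≢ u → z ≢ v → inside (u , v) z ≡ true) → ∀ z → inV' z ≡ true → ¬ (z < u ⊎ v < z)
    ins-true→B h z iz (inj₁ a) = t≢f (trans (sym (h z (inV'⇒ iz) (λ e → n≮n _ (subst (_< u) e a)) (λ e → <-asym (subst (_< u) e a) (proj₁ Vs)))) (inside-fL {a = u} {b = v} (<-asym a)))
    ins-true→B h z iz (inj₂ a) = t≢f (trans (sym (h z (inV'⇒ iz) (λ e → <-asym (subst (v <_) e a) (proj₁ Vs)) (λ e → n≮n _ (subst (v <_) e a)))) (inside-fR {a = u} {b = v} (<-asym a)))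

    fromCons : inV' u ≡ true → inV' v ≡ true → Consecutive (Lo s) (Hi s) → BdT' s
    fromCons iu iv (inj₁ N) with boolCase (flipped u v)
    ... | inj₁ ef = proj₁ Vs , iu , iv , inj₁ (ins-false→A λ z iz zu zv → trans (ChordInfo.bout C z (InV-n iz) zu zv (N z iz (proj₁ (cv2 zu zv)) (proj₂ (cv2 zu zv)))) ef)
    ... | inj₂ ef = proj₁ Vs , iu , iv , inj₂ (ins-true→B λ z iz zu zv → trans (ChordInfo.bout C z (InV-n iz) zu zv (N z iz (proj₁ (cv2 zu zv)) (proj₂ (cv2 zu zv)))) ef)
    fromCons iu iv (inj₂ Y) with boolCase (flipped u v)
    ... | inj₂ ef = proj₁ Vs , iu , iv , inj₁ (ins-false→A λ z iz zu zv → trans (ChordInfo.bin C z (InV-n iz) zu zv (Y z iz (proj₁ (cv2 zu zv)) (proj₂ (cv2 zu zv)))) (cong not ef))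
    ... | inj₁ ef = proj₁ Vs , iu , iv , inj₂ (ins-true→B λ z iz zu zv → trans (ChordInfo.bin C z (InV-n iz) zu zv (Y z iz (proj₁ (cv2 zu zv)) (proj₂ (cv2 zu zv)))) (cong not ef))

  InVα : ∀ k → k < d → VertexT' (α k)
  InVα k kd = inj₂ (inj₂ (k , kd , inj₁ refl))
  InVβ : ∀ k → k < d → VertexT' (β k)
  InVβ k kd = inj₂ (inj₂ (k , kd , inj₂ refl))
  InVp : VertexT' p
  InVp = inj₁ refl
  InVq : VertexT' q
  InVq = inj₂ (inj₁ refl)

  ρp< : ∀ {z} → p < ρ z → ρ p < ρ z
  ρp< {z} h = subst (_< ρ z) (sym ρp) h
  <ρp : ∀ {z} → ρ z < ρ p → ρ z < p
  <ρp {z} h = subst (ρ z <_) ρp h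
  notBelowP : ∀ {z} → ¬ ρ z < ρ p
  notBelowP h = <⇒≱ (<ρp h) ρ-≥p

  segP : ∀ (P : ℕ → Set) {x y} → P x → P y → P (proj₁ (seg x y)) × P (proj₂ (seg x y))
  segP P {x} {y} px py with <-cmp x y
  ... | tri< a _ _ = subst P (sym (m≤n⇒m⊓n≡m (<⇒≤ a))) px , subst P (sym (m≤n⇒m⊔n≡n (<⇒≤ a))) py
  ... | tri≈ _ refl _ = subst P (sym (⊓-idem x)) px , subst P (sym (⊔-idem x)) px
  ... | tri> _ _ a = subst P (sym (m≥n⇒m⊓n≡n (<⇒≤ a))) py , subst P (sym (m≥n⇒m⊔n≡m (<⇒≤ a))) px

  segVS : ∀ {x y} → x < n → y < n → x ≢ y → OrderedSeg n (seg x y)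
  segVS {x} {y} xn yn xy with <-cmp x y
  ... | tri< a _ _ = subst (OrderedSeg n) (sym (seg-lt a)) (a , yn)
  ... | tri≈ _ a _ = ⊥-elim (xy a)
  ... | tri> _ _ a = subst (OrderedSeg n) (sym (seg-gt a)) (a , xn)

  bdFromCons : ∀ {x y} → VertexT' x → VertexT' y → ρ x < ρ y → Consecutive x y → BdT' (seg x y)
  bdFromCons {x} {y} ix iy xy c = BD.fromCons (seg x y) Vs (proj₁ ii) (proj₂ ii) (subst₂ Consecutive (sym (proj₁ LH)) (sym (proj₂ LH)) c)
    where
      Vs = segVS (InV-n ix) (InV-n iy) (ρ<⇒≢ xy)
      LH = loHiOf Vs refl xy
      ii = segP (λ z → inV' z ≡ true) {x} {y} (⇒inV' ix) (⇒inV' iy)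

  consFromBd : ∀ {x y} → x < n → y < n → ρ x < ρ y → BdT' (seg x y) → Consecutive x y
  consFromBd {x} {y} xn yn xy b = subst₂ Consecutive (proj₁ LH) (proj₂ LH) (BD.toCons (seg x y) Vs b)
    where
      Vs = segVS xn yn (ρ<⇒≢ xy)
      LH = loHiOf Vs refl xy

  consPA : Consecutive p (α 0)
  consPA = inj₁ f
    where
      f : ∀ z → VertexT' z → z ≢ p → z ≢ α 0 → ¬ Between p (α 0) z
      f z (inj₁ refl) zp _ _ = zp refl
      f z (inj₂ (inj₁ refl)) _ _ (_ , b) = <-asym b (proj₁ (q-between 0 d>0))
      f z (inj₂ (inj₂ (k , kd , inj₁ refl))) _ _ (_ , b) = <⇒≱ b (proj₁ (nested 0 k z≤n kd))
      f z (inj₂ (inj₂ (k , kd , inj₂ refl))) _ _ (_ , b) = <-asym b (<-trans (proj₁ (q-between 0 d>0)) (proj₂ (q-between k kd)))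

  consPB : Consecutive p (β 0)
  consPB = inj₂ f
    where
      f : ∀ z → VertexT' z → z ≢ p → z ≢ β 0 → Between p (β 0) z
      f z (inj₁ refl) zp _ = ⊥-elim (zp refl)
      f z (inj₂ (inj₁ refl)) _ _ = ρp< p<m , proj₂ (q-between 0 d>0)
      f z (inj₂ (inj₂ (k , kd , inj₁ refl))) _ _ = ρp< (p<α k kd) , <-trans (proj₁ (q-between k kd)) (proj₂ (q-between 0 d>0))
      f z (inj₂ (inj₂ (k , kd , inj₂ refl))) _ zb = ρp< (<-trans p<m (proj₂ (q-between k kd))) , ≤∧≢⇒< (proj₂ (nested 0 k z≤n kd)) (λ e → zb (ρ-inj (βn k kd) (βn 0 d>0) e))

  l1 = d ∸ 1
  l1d = d-1<d
  k≤l1 : ∀ {k} → k < d → k ≤ l1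
  k≤l1 {k} kd = ≤-pred (subst (suc k ≤_) (sym (pr d>0)) kd)
    where pr : ∀ {x} → 0 < x → suc (x ∸ 1) ≡ x
          pr {suc x} _ = refl

  consQA : Consecutive (α l1) q
  consQA = inj₁ f
    where
      f : ∀ z → VertexT' z → z ≢ α l1 → z ≢ q → ¬ Between (α l1) q z
      f z (inj₁ refl) _ _ (b , _) = notBelowP b
      f z (inj₂ (inj₁ refl)) _ zq _ = zq refl
      f z (inj₂ (inj₂ (k , kd , inj₁ refl))) _ _ (b , _) = <⇒≱ b (proj₁ (nested k l1 (k≤l1 kd) l1d))
      f z (inj₂ (inj₂ (k , kd , inj₂ refl))) _ _ (_ , b) = <-asym b (proj₂ (q-between k kd))

  consQB : Consecutive q (β l1)
  consQB = inj₁ f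
    where
      f : ∀ z → VertexT' z → z ≢ q → z ≢ β l1 → ¬ Between q (β l1) z
      f z (inj₁ refl) _ _ (b , _) = <-asym b (subst (_< m) (sym ρp) p<m)
      f z (inj₂ (inj₁ refl)) zq _ _ = zq refl
      f z (inj₂ (inj₂ (k , kd , inj₁ refl))) _ _ (b , _) = <-asym b (proj₁ (q-between k kd))
      f z (inj₂ (inj₂ (k , kd , inj₂ refl))) _ _ (_ , b) = <⇒≱ b (proj₂ (nested k l1 (k≤l1 kd) l1d))

  k≤∨ : ∀ k j → k ≤ j ⊎ suc j ≤ k
  k≤∨ k j with <-cmp k j
  ... | tri< a _ _ = inj₁ (<⇒≤ a)
  ... | tri≈ _ refl _ = inj₁ ≤-refl
  ... | tri> _ _ a = inj₂ a

  consGL : ∀ j → suc j < d → Consecutive (α j) (α (suc j))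
  consGL j sjd = inj₁ f
    where
      jd = suc<⇒< sjd
      f : ∀ z → VertexT' z → z ≢ α j → z ≢ α (suc j) → ¬ Between (α j) (α (suc j)) z
      f z (inj₁ refl) _ _ (b , _) = notBelowP b
      f z (inj₂ (inj₁ refl)) _ _ (_ , b) = <-asym b (proj₁ (q-between (suc j) sjd))
      f z (inj₂ (inj₂ (k , kd , inj₁ refl))) _ _ (b1 , b2) with k≤∨ k j
      ... | inj₁ x = <⇒≱ b1 (proj₁ (nested k j x jd))
      ... | inj₂ x = <⇒≱ b2 (proj₁ (nested (suc j) k x kd))
      f z (inj₂ (inj₂ (k , kd , inj₂ refl))) _ _ (_ , b) = <-asym b (<-trans (proj₁ (q-between (suc j) sjd)) (proj₂ (q-between k kd)))

  consGR : ∀ j → suc j < d → Consecutive (β (suc j)) (β j)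
  consGR j sjd = inj₁ f
    where
      jd = suc<⇒< sjd
      f : ∀ z → VertexT' z → z ≢ β (suc j) → z ≢ β j → ¬ Between (β (suc j)) (β j) z
      f z (inj₁ e) _ _ (b , _) = <-asym b (subst (λ t → ρ t < ρ (β (suc j))) (sym e) (ρp< (<-trans p<m (proj₂ (q-between (suc j) sjd)))))
      f z (inj₂ (inj₁ refl)) _ _ (b , _) = <-asym b (proj₂ (q-between (suc j) sjd))
      f z (inj₂ (inj₂ (k , kd , inj₁ refl))) _ _ (b , _) = <-asym b (<-trans (proj₁ (q-between k kd)) (proj₂ (q-between (suc j) sjd)))
      f z (inj₂ (inj₂ (k , kd , inj₂ refl))) _ _ (b1 , b2) with k≤∨ k j
      ... | inj₁ x = <⇒≱ b2 (proj₂ (nested k j x jd))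
      ... | inj₂ x = <⇒≱ b1 (proj₂ (nested (suc j) k x kd))

  consTau : ∀ j → j < d → ¬ Consecutive (α j) (β j)
  consTau j jd (inj₁ f) = f q InVq (λ e → αq j jd (sym e)) (λ e → βq j jd (sym e)) (q-between j jd)
  consTau j jd (inj₂ f) = pNotBtw (α j) (β j) (f p InVp (λ e → αp j jd (sym e)) (λ e → βp j jd (sym e)))

  descriptor-boundary : ∀ e → ValidDesc e → NotTau e → BdT' (descSeg e)
  descriptor-boundary PA _ _ = bdFromCons InVp (InVα 0 d>0) (ρp< (p<α 0 d>0)) consPA
  descriptor-boundary PB _ _ = bdFromCons InVp (InVβ 0 d>0) (ρp< (<-trans p<m (proj₂ (q-between 0 d>0)))) consPB
  descriptor-boundary QA _ _ = bdFromCons (InVα l1 l1d) InVq (proj₁ (q-between l1 l1d)) consQA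
  descriptor-boundary QB _ _ = subst BdT' (seg-sym q (β l1)) (bdFromCons InVq (InVβ l1 l1d) (proj₂ (q-between l1 l1d)) consQB)
  descriptor-boundary (G j) sjd _ with consecutive-step j sjd
  ... | inj₁ (e , a , _ , _) = subst BdT' (trans (cong (seg (α j)) a) (cong (λ z → seg z (w' j)) (sym (gamEnd-α {j} e))))
          (bdFromCons (InVα j (suc<⇒< sjd)) (InVα (suc j) sjd) (subst (λ z → ρ (α j) < ρ z) (sym a) (proj₁ (w'-far j (suc<⇒< sjd)))) (consGL j sjd))
  ... | inj₂ (e , _ , b , _) = subst BdT' (trans (seg-sym (β (suc j)) (β j)) (trans (cong (seg (β j)) b) (cong (λ z → seg z (w' j)) (sym (gamEnd-β {j} e)))))
          (bdFromCons (InVβ (suc j) sjd) (InVβ j (suc<⇒< sjd)) (subst (λ z → ρ z < ρ (β j)) (sym b) (proj₂ (w'-far j (suc<⇒< sjd)))) (consGR j sjd))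

  crossed-not-boundary : ∀ j → j < d → ¬ BdT' (descSeg (Tau j))
  crossed-not-boundary j jd b = consTau j jd (consFromBd (αn j jd) (βn j jd) (αβ< j jd) b)

  Res : ℕ → ℕ → Set
  Res x y = Σ Desc λ e → ValidDesc e × NotTau e × seg x y ≡ descSeg e

  nP : ∀ {x y} → ρ x < ρ y → y ≢ p
  nP {x} lt e = notBelowP (subst (λ t → ρ x < ρ t) e lt)

  secondP : ∀ {x y} → x ≢ p → ρ x < ρ y → (∀ z → VertexT' z → z ≢ x → z ≢ y → Between x y z) → ⊥
  secondP {x} {y} xp lt f = pNotBtw x y (f p InVp (λ e → xp (sym e)) (λ e → nP lt (sym e)))

  cP : ∀ y → VertexT' y → ρ p < ρ y → Consecutive p y → Res p y
  cP y (inj₁ refl) lt c = ⊥-elim (n≮n _ lt)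
  cP y (inj₂ (inj₁ refl)) lt (inj₁ f) = ⊥-elim (f (α 0) (InVα 0 d>0) (αp 0 d>0) (αq 0 d>0) (ρp< (p<α 0 d>0) , proj₁ (q-between 0 d>0)))
  cP y (inj₂ (inj₁ refl)) lt (inj₂ f) = ⊥-elim (<-asym (proj₂ (f (β 0) (InVβ 0 d>0) (βp 0 d>0) (βq 0 d>0))) (proj₂ (q-between 0 d>0)))
  cP y (inj₂ (inj₂ (k , kd , inj₁ refl))) lt (inj₁ f) with <-cmp (ρ (α 0)) (ρ (α k))
  ... | tri< a _ _ = ⊥-elim (f (α 0) (InVα 0 d>0) (αp 0 d>0) (ρ<⇒≢ a) (ρp< (p<α 0 d>0) , a))
  ... | tri≈ _ a _ = PA , tt , tt , cong (seg p) (ρ-inj (αn k kd) (αn 0 d>0) (sym a))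
  ... | tri> _ _ a = ⊥-elim (<⇒≱ a (proj₁ (nested 0 k z≤n kd)))
  cP y (inj₂ (inj₂ (k , kd , inj₁ refl))) lt (inj₂ f) =
    ⊥-elim (<-asym (proj₂ (f (β 0) (InVβ 0 d>0) (βp 0 d>0) (λ e → ρ<⇒≢ (<-trans (proj₁ (q-between k kd)) (proj₂ (q-between 0 d>0))) (sym e))))
                   (<-trans (proj₁ (q-between k kd)) (proj₂ (q-between 0 d>0))))
  cP y (inj₂ (inj₂ (k , kd , inj₂ refl))) lt (inj₁ f) =
    ⊥-elim (f (α 0) (InVα 0 d>0) (αp 0 d>0) (ρ<⇒≢ (<-trans (proj₁ (q-between 0 d>0)) (proj₂ (q-between k kd)))) (ρp< (p<α 0 d>0) , <-trans (proj₁ (q-between 0 d>0)) (proj₂ (q-between k kd))))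
  cP y (inj₂ (inj₂ (k , kd , inj₂ refl))) lt (inj₂ f) with <-cmp (ρ (β k)) (ρ (β 0))
  ... | tri< a _ _ = ⊥-elim (<-asym a (proj₂ (f (β 0) (InVβ 0 d>0) (βp 0 d>0) (λ e → ρ<⇒≢ a (sym e)))))
  ... | tri≈ _ a _ = PB , tt , tt , cong (seg p) (ρ-inj (βn k kd) (βn 0 d>0) a)
  ... | tri> _ _ a = ⊥-elim (<⇒≱ a (proj₂ (nested 0 k z≤n kd)))

  cQ : ∀ y → VertexT' y → ρ q < ρ y → Consecutive q y → Res q y
  cQ y (inj₁ refl) lt c = ⊥-elim (notBelowP lt)
  cQ y (inj₂ (inj₁ refl)) lt c = ⊥-elim (n≮n _ lt)
  cQ y (inj₂ (inj₂ (k , kd , inj₁ refl))) lt c = ⊥-elim (<-asym lt (proj₁ (q-between k kd)))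
  cQ y (inj₂ (inj₂ (k , kd , inj₂ refl))) lt (inj₂ f) = ⊥-elim (secondP (≢-sym p≢q) lt f)
  cQ y (inj₂ (inj₂ (k , kd , inj₂ refl))) lt (inj₁ f) with <-cmp (ρ (β l1)) (ρ (β k))
  ... | tri< a _ _ = ⊥-elim (f (β l1) (InVβ l1 l1d) (βq l1 l1d) (ρ<⇒≢ a) (proj₂ (q-between l1 l1d) , a))
  ... | tri≈ _ a _ = QB , tt , tt , trans (seg-sym q (β k)) (cong (λ z → seg z q) (ρ-inj (βn k kd) (βn l1 l1d) (sym a)))
  ... | tri> _ _ a = ⊥-elim (<⇒≱ a (proj₂ (nested k l1 (k≤l1 kd) l1d)))

  auxA : ∀ k l → k < d → l < d → ρ (α k) < ρ (α l) → Σ ℕ λ j → suc j ≤ l × ρ (α j) ≤ ρ (α k) × ρ (α k) < ρ (α (suc j))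
  auxA k zero kd ld h = ⊥-elim (<⇒≱ h (proj₁ (nested 0 k z≤n kd)))
  auxA k (suc l) kd ld h with <-cmp (ρ (α k)) (ρ (α l))
  ... | tri< x _ _ = let (j , a , b , c) = auxA k l kd (suc<⇒< ld) x in j , ≤-trans a (n≤1+n l) , b , c
  ... | tri≈ _ x _ = l , ≤-refl , ≤-reflexive (sym x) , h
  ... | tri> _ _ x = l , ≤-refl , <⇒≤ x , h

  searchA : ∀ k l → k < d → l < d → ρ (α k) < ρ (α l) →
            (∀ i → i < d → α i ≢ α k → α i ≢ α l → ¬ Between (α k) (α l) (α i)) →
            Σ ℕ λ j → suc j < d × α j ≡ α k × w' j ≡ α l × onαSide j ≡ true
  searchA k l kd ld h nb with auxA k l kd ld h
  ... | j , sjl , ajk , kaj = j , sjd , ejk , ew , eL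
    where
      sjd = ≤-<-trans sjl ld
      jd = suc<⇒< sjd
      kj : k ≤ j
      kj with k≤∨ k j
      ... | inj₁ x = x
      ... | inj₂ x = ⊥-elim (<⇒≱ kaj (proj₁ (nested (suc j) k x kd)))
      ejk : α j ≡ α k
      ejk = ρ-inj (αn j jd) (αn k kd) (≤-antisym ajk (proj₁ (nested k j kj jd)))
      esl : α (suc j) ≡ α l
      esl with <-cmp (ρ (α (suc j))) (ρ (α l))
      ... | tri< x _ _ = ⊥-elim (nb (suc j) sjd (λ e → ρ<⇒≢ kaj (sym e)) (ρ<⇒≢ x) (kaj , x))
      ... | tri≈ _ x _ = ρ-inj (αn (suc j) sjd) (αn l ld) x
      ... | tri> _ _ x = ⊥-elim (<⇒≱ x (proj₁ (nested (suc j) l sjl ld)))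
      st = consecutive-step j sjd
      eL : onαSide j ≡ true
      eL with st
      ... | inj₁ (e , _) = e
      ... | inj₂ (_ , a , _) = ⊥-elim (n≮n _ (subst (λ z → ρ (α k) < ρ z) (trans a ejk) kaj))
      ew : w' j ≡ α l
      ew with st
      ... | inj₁ (_ , a , _) = trans (sym a) esl
      ... | inj₂ (e , _) = ⊥-elim (t≢f (trans (sym eL) e))

  auxB : ∀ k l → k < d → l < d → ρ (β k) < ρ (β l) → Σ ℕ λ j → suc j ≤ k × ρ (β l) ≤ ρ (β j) × ρ (β (suc j)) < ρ (β l)
  auxB zero l kd ld h = ⊥-elim (<⇒≱ h (proj₂ (nested 0 l z≤n ld)))
  auxB (suc k) l kd ld h with <-cmp (ρ (β k)) (ρ (β l))
  ... | tri< x _ _ = let (j , a , b , c) = auxB k l (suc<⇒< kd) ld x in j , ≤-trans a (n≤1+n k) , b , c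
  ... | tri≈ _ x _ = k , ≤-refl , ≤-reflexive (sym x) , h
  ... | tri> _ _ x = k , ≤-refl , <⇒≤ x , h

  searchB : ∀ k l → k < d → l < d → ρ (β k) < ρ (β l) →
            (∀ i → i < d → β i ≢ β k → β i ≢ β l → ¬ Between (β k) (β l) (β i)) →
            Σ ℕ λ j → suc j < d × β j ≡ β l × w' j ≡ β k × onαSide j ≡ false
  searchB k l kd ld h nb with auxB k l kd ld h
  ... | j , sjk , blj , bsl = j , sjd , ejl , ew , eR
    where
      sjd = ≤-<-trans sjk kd
      jd = suc<⇒< sjd
      lj : l ≤ j
      lj with k≤∨ l j
      ... | inj₁ x = x
      ... | inj₂ x = ⊥-elim (<⇒≱ bsl (proj₂ (nested (suc j) l x ld)))
      ejl : β j ≡ β l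
      ejl = ρ-inj (βn j jd) (βn l ld) (≤-antisym (proj₂ (nested l j lj jd)) blj)
      esk : β (suc j) ≡ β k
      esk with <-cmp (ρ (β k)) (ρ (β (suc j)))
      ... | tri< x _ _ = ⊥-elim (nb (suc j) sjd (λ e → ρ<⇒≢ x (sym e)) (ρ<⇒≢ bsl) (x , bsl))
      ... | tri≈ _ x _ = ρ-inj (βn (suc j) sjd) (βn k kd) (sym x)
      ... | tri> _ _ x = ⊥-elim (<⇒≱ x (proj₂ (nested (suc j) k sjk kd)))
      st = consecutive-step j sjd
      eR : onαSide j ≡ false
      eR with st
      ... | inj₂ (e , _) = e
      ... | inj₁ (_ , _ , b , _) = ⊥-elim (n≮n _ (subst (λ z → ρ z < ρ (β l)) (trans b ejl) bsl))
      ew : w' j ≡ β k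
      ew with st
      ... | inj₂ (_ , _ , b , _) = trans (sym b) esk
      ... | inj₁ (e , _) = ⊥-elim (t≢f (trans (sym e) eR))

  cA : ∀ k → k < d → ∀ y → VertexT' y → ρ (α k) < ρ y → Consecutive (α k) y → Res (α k) y
  cA k kd y iy lt (inj₂ f) = ⊥-elim (secondP (αp k kd) lt f)
  cA k kd y (inj₁ refl) lt c = ⊥-elim (notBelowP lt)
  cA k kd y (inj₂ (inj₁ refl)) lt (inj₁ f) with <-cmp (ρ (α k)) (ρ (α l1))
  ... | tri< a _ _ = ⊥-elim (f (α l1) (InVα l1 l1d) (λ e → ρ<⇒≢ a (sym e)) (αq l1 l1d) (a , proj₁ (q-between l1 l1d)))
  ... | tri≈ _ a _ = QA , tt , tt , cong (λ z → seg z q) (ρ-inj (αn k kd) (αn l1 l1d) a)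
  ... | tri> _ _ a = ⊥-elim (<⇒≱ a (proj₁ (nested k l1 (k≤l1 kd) l1d)))
  cA k kd y (inj₂ (inj₂ (l , ld , inj₁ refl))) lt (inj₁ f) with searchA k l kd ld lt (λ i id a b → f (α i) (InVα i id) a b)
  ... | j , sjd , ea , ew , eL = G j , sjd , tt , sym (trans (cong (λ z → seg z (w' j)) (gamEnd-α {j} eL)) (cong₂ seg ea ew))
  cA k kd y (inj₂ (inj₂ (l , ld , inj₂ refl))) lt (inj₁ f) =
    ⊥-elim (f q InVq (λ e → αq k kd (sym e)) (λ e → βq l ld (sym e)) (proj₁ (q-between k kd) , proj₂ (q-between l ld)))

  cB : ∀ k → k < d → ∀ y → VertexT' y → ρ (β k) < ρ y → Consecutive (β k) y → Res (β k) y
  cB k kd y iy lt (inj₂ f) = ⊥-elim (secondP (βp k kd) lt f)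
  cB k kd y (inj₁ refl) lt c = ⊥-elim (notBelowP lt)
  cB k kd y (inj₂ (inj₁ refl)) lt c = ⊥-elim (<-asym lt (proj₂ (q-between k kd)))
  cB k kd y (inj₂ (inj₂ (l , ld , inj₁ refl))) lt c = ⊥-elim (<-asym lt (<-trans (proj₁ (q-between l ld)) (proj₂ (q-between k kd))))
  cB k kd y (inj₂ (inj₂ (l , ld , inj₂ refl))) lt (inj₁ f) with searchB k l kd ld lt (λ i id a b → f (β i) (InVβ i id) a b)
  ... | j , sjd , el , ew , eR = G j , sjd , tt , trans (seg-sym (β k) (β l)) (sym (trans (cong (λ z → seg z (w' j)) (gamEnd-β {j} eR)) (cong₂ seg el ew)))

  consecutive-descriptor : ∀ x y → VertexT' x → VertexT' y → ρ x < ρ y → Consecutive x y → Res x y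
  consecutive-descriptor x y (inj₁ refl) iy lt c = cP y iy lt c
  consecutive-descriptor x y (inj₂ (inj₁ refl)) iy lt c = cQ y iy lt c
  consecutive-descriptor x y (inj₂ (inj₂ (k , kd , inj₁ refl))) iy lt c = cA k kd y iy lt c
  consecutive-descriptor x y (inj₂ (inj₂ (k , kd , inj₂ refl))) iy lt c = cB k kd y iy lt c

  boundary-descriptor : ∀ s → BdT' s → Σ Desc λ e → ValidDesc e × NotTau e × s ≡ descSeg e
  boundary-descriptor s b@(uv , iu , iv , _) with consecutive-descriptor (Lo s) (Hi s) ix iy (lh s Vs) (BD.toCons s Vs b)
    where
      Vs : OrderedSeg n s
      Vs = uv , InV-n (inV'⇒ iv)
      ix : VertexT' (Lo s)
      ix with ends s Vs
      ... | inj₁ (e , _) = subst VertexT' (sym e) (inV'⇒ iu)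
      ... | inj₂ (e , _) = subst VertexT' (sym e) (inV'⇒ iv)
      iy : VertexT' (Hi s)
      iy with ends s Vs
      ... | inj₁ (_ , e) = subst VertexT' (sym e) (inV'⇒ iv)
      ... | inj₂ (_ , e) = subst VertexT' (sym e) (inV'⇒ iu)
  ... | e , ve , nt , eq = e , ve , nt , trans sLH eq
    where
      sLH : s ≡ seg (Lo s) (Hi s)
      sLH with ends s (uv , InV-n (inV'⇒ iv))
      ... | inj₁ (e1 , e2) rewrite e1 | e2 = sym (seg-lt uv)
      ... | inj₂ (e1 , e2) rewrite e1 | e2 = sym (seg-gt uv)

  memb-here : ∀ {x a} L → x ≡ a → memb x (a ∷ L) ≡ true
  memb-here {x} {a} L e rewrite ≡ᵇ-t e = refl
  memb-there : ∀ x a L → memb x L ≡ true → memb x (a ∷ L) ≡ true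
  memb-there x a L h = ∨-iR {x ≡ᵇ a} h
  memb-inv : ∀ x a L → memb x (a ∷ L) ≡ true → x ≡ a ⊎ memb x L ≡ true
  memb-inv x a L h with ∨-t⇒ {x ≡ᵇ a} h
  ... | inj₁ e = inj₁ (≡ᵇ-t⇒ e)
  ... | inj₂ e = inj₂ e
  memb-f : ∀ x a L → x ≢ a → memb x L ≡ false → memb x (a ∷ L) ≡ false
  memb-f x a L xa h rewrite ≡ᵇ-f xa = h

  L4 : List ℕ
  L4 = p ∷ q ∷ α 0 ∷ β 0 ∷ []

  α0≢β0 : α 0 ≢ β 0
  α0≢β0 = ρ<⇒≢ (αβ< 0 d>0)

  sizeT'-quadrilateral : d ≡ 1 → sizeT' ≡ 4
  sizeT'-quadrilateral d1 = trans (cb-ext n inV' (λ x → memb x L4) (λ x _ → bool-ext (to {x}) (fro {x}))) (cb-list n L4 all4 dist4)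
    where
      k0 : ∀ {k} → k < d → k ≡ 0
      k0 {zero} _ = refl
      k0 {suc k} kd = ⊥-elim (<⇒≱ kd (subst (_≤ suc k) (sym d1) (s≤s z≤n)))
      to : ∀ {x} → inV' x ≡ true → memb x L4 ≡ true
      to {x} h with inV'⇒ {x} h
      ... | inj₁ e = memb-here {x} (q ∷ α 0 ∷ β 0 ∷ []) e
      ... | inj₂ (inj₁ e) = memb-there x p (q ∷ α 0 ∷ β 0 ∷ []) (memb-here {x} (α 0 ∷ β 0 ∷ []) e)
      ... | inj₂ (inj₂ (k , kd , inj₁ e)) rewrite k0 kd = memb-there x p (q ∷ α 0 ∷ β 0 ∷ []) (memb-there x q (α 0 ∷ β 0 ∷ []) (memb-here {x} (β 0 ∷ []) e))
      ... | inj₂ (inj₂ (k , kd , inj₂ e)) rewrite k0 kd = memb-there x p (q ∷ α 0 ∷ β 0 ∷ []) (memb-there x q (α 0 ∷ β 0 ∷ []) (memb-there x (α 0) (β 0 ∷ []) (memb-here {x} [] e)))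
      fro : ∀ {x} → memb x L4 ≡ true → inV' x ≡ true
      fro {x} h with memb-inv x p (q ∷ α 0 ∷ β 0 ∷ []) h
      ... | inj₁ e = ⇒inV' (inj₁ e)
      ... | inj₂ h2 with memb-inv x q (α 0 ∷ β 0 ∷ []) h2
      ... | inj₁ e = ⇒inV' (inj₂ (inj₁ e))
      ... | inj₂ h3 with memb-inv x (α 0) (β 0 ∷ []) h3
      ... | inj₁ e = ⇒inV' (InVeq e (InVα 0 d>0))
        where InVeq : ∀ {x y} → x ≡ y → VertexT' y → VertexT' x
              InVeq refl i = i
      ... | inj₂ h4 with memb-inv x (β 0) [] h4
      ... | inj₁ e = ⇒inV' (InVeq e (InVβ 0 d>0))
        where InVeq : ∀ {x y} → x ≡ y → VertexT' y → VertexT' x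
              InVeq refl i = i
      ... | inj₂ ()
      all4 : AllLt n L4
      all4 = p<n , q<n , αn 0 d>0 , βn 0 d>0 , tt
      dist4 : Distinct L4
      dist4 = memb-f p q (α 0 ∷ β 0 ∷ []) p≢q (memb-f p (α 0) (β 0 ∷ []) (λ e → αp 0 d>0 (sym e)) (memb-f p (β 0) [] (λ e → βp 0 d>0 (sym e)) refl))
            , memb-f q (α 0) (β 0 ∷ []) (λ e → αq 0 d>0 (sym e)) (memb-f q (β 0) [] (λ e → βq 0 d>0 (sym e)) refl)
            , memb-f (α 0) (β 0) [] α0≢β0 refl
            , refl , tt

  sizeT'-larger : 1 < d → sizeT' ≢ 4
  sizeT'-larger 1d e = <⇒≱ (s≤s (s≤s (s≤s (s≤s ≤-refl)))) (subst (5 ≤_) e five)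
    where
      W = w' 0
      Ap = farApex 0 d>0
      L5 : List ℕ
      L5 = p ∷ q ∷ α 0 ∷ β 0 ∷ W ∷ []
      InVeq : ∀ {x y} → x ≡ y → VertexT' y → VertexT' x
      InVeq refl i = i
      inW : VertexT' W
      inW with consecutive-step 0 1d
      ... | inj₁ (_ , a , _) = InVeq (sym a) (InVα 1 1d)
      ... | inj₂ (_ , _ , b , _) = InVeq (sym b) (InVβ 1 1d)
      fro : ∀ x → x < n → memb x L5 ≡ true → inV' x ≡ true
      fro x _ h with memb-inv x p (q ∷ α 0 ∷ β 0 ∷ W ∷ []) h
      ... | inj₁ e = ⇒inV' (inj₁ e)
      ... | inj₂ h2 with memb-inv x q (α 0 ∷ β 0 ∷ W ∷ []) h2
      ... | inj₁ e = ⇒inV' (inj₂ (inj₁ e))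
      ... | inj₂ h3 with memb-inv x (α 0) (β 0 ∷ W ∷ []) h3
      ... | inj₁ e = ⇒inV' (InVeq e (InVα 0 d>0))
      ... | inj₂ h4 with memb-inv x (β 0) (W ∷ []) h4
      ... | inj₁ e = ⇒inV' (InVeq e (InVβ 0 d>0))
      ... | inj₂ h5 with memb-inv x W [] h5
      ... | inj₁ e = ⇒inV' (InVeq e inW)
      ... | inj₂ ()
      all5 : AllLt n L5
      all5 = p<n , q<n , αn 0 d>0 , βn 0 d>0 , ApexData.cn Ap , tt
      dist5 : Distinct L5
      dist5 = memb-f p q (α 0 ∷ β 0 ∷ W ∷ []) p≢q (memb-f p (α 0) (β 0 ∷ W ∷ []) (λ e → αp 0 d>0 (sym e)) (memb-f p (β 0) (W ∷ []) (λ e → βp 0 d>0 (sym e)) (memb-f p W [] (λ e → w'p 0 d>0 (sym e)) refl)))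
            , memb-f q (α 0) (β 0 ∷ W ∷ []) (λ e → αq 0 d>0 (sym e)) (memb-f q (β 0) (W ∷ []) (λ e → βq 0 d>0 (sym e)) (memb-f q W [] (λ e → w'≢q 0 1d (sym e)) refl))
            , memb-f (α 0) (β 0) (W ∷ []) α0≢β0 (memb-f (α 0) W [] (λ e → ApexData.cα Ap (sym e)) refl)
            , memb-f (β 0) W [] (λ e → ApexData.cβ Ap (sym e)) refl
            , refl , tt
      five : 5 ≤ sizeT'
      five = subst (_≤ sizeT') (cb-list n L5 all5 dist5) (cb-mono n (λ x → memb x L5) inV' fro)

ifF : ∀ {X : Bool} {b a : ℕ} → X ≡ false → (if X then b else a) ≡ a
ifF refl = refl
ifT : ∀ {X : Bool} {b a : ℕ} → X ≡ true → (if X then b else a) ≡ b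
ifT refl = refl

module TileGeometry {n : ℕ} {T : List Seg} {p q d : ℕ} {τ : ℕ → Seg} {w w' : ℕ → ℕ}
  (S : CrossingSetup n T p q d τ w w') where

  open SubpolygonBoundary S public

  gluedNorth : ℕ → Bool
  gluedNorth k = if isEven k then not (onαSide k) else onαSide k

  α≢β : ∀ k → k < d → α k ≢ β k
  α≢β k kd = ρ<⇒≢ (αβ< k kd)

  tEq : ∀ k → suc k < d → (if isEnd (τ (suc k)) (proj₁ (τ k)) then proj₂ (τ k) else proj₁ (τ k)) ≡ gamEnd k
  tEq k skd with ends (τ k) (vs k (suc<⇒< skd)) | consecutive-step k skd
  ... | inj₁ (e1 , e2) | inj₁ (eL , a , b , c) = trans (ifF X) (trans (sym e1) (sym (gamEnd-α {k} eL)))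
    where X : isEnd (τ (suc k)) (proj₁ (τ k)) ≡ false
          X = subst (λ z → isEnd (τ (suc k)) z ≡ false) e1 (notEndF (suc k) skd (λ e → ApexData.cα (farApex k (suc<⇒< skd)) (sym (trans e a))) (λ e → α≢β k (suc<⇒< skd) (trans e b)))
  ... | inj₁ (e1 , e2) | inj₂ (eR , a , b , c) = trans (ifT X) (trans (sym e2) (sym (gamEnd-β {k} eR)))
    where X : isEnd (τ (suc k)) (proj₁ (τ k)) ≡ true
          X = subst (λ z → isEnd (τ (suc k)) z ≡ true) (trans a e1) (endτα (suc k) skd)
  ... | inj₂ (e1 , e2) | inj₁ (eL , a , b , c) = trans (ifT X) (trans (sym e1) (sym (gamEnd-α {k} eL)))
    where X : isEnd (τ (suc k)) (proj₁ (τ k)) ≡ true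
          X = subst (λ z → isEnd (τ (suc k)) z ≡ true) (trans b e2) (endτβ (suc k) skd)
  ... | inj₂ (e1 , e2) | inj₂ (eR , a , b , c) = trans (ifF X) (trans (sym e2) (sym (gamEnd-β {k} eR)))
    where X : isEnd (τ (suc k)) (proj₁ (τ k)) ≡ false
          X = subst (λ z → isEnd (τ (suc k)) z ≡ false) e2 (notEndF (suc k) skd (λ e → α≢β k (suc<⇒< skd) (sym (trans e a))) (λ e → ApexData.cβ (farApex k (suc<⇒< skd)) (sym (trans e b))))

  gamEq : ∀ k → suc k < d → gam k ≡ seg (gamEnd k) (w' k)
  gamEq k skd = cong (λ z → seg z (w' k)) (tEq k skd)

  glueNorth≡gluedNorth : ∀ k → suc k < d → glueNorth k ≡ gluedNorth k
  glueNorth≡gluedNorth k skd = trans (cong₂ segEqᵇ (labelRole k kd North) (gamEq k skd)) core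
    where
      kd = suc<⇒< skd
      core : segEqᵇ (roleSeg k (sideRole k North)) (seg (gamEnd k) (w' k)) ≡ gluedNorth k
      core with isEven k | consecutive-step k skd
      ... | true | inj₁ (eL , _) = trans (segEqᵇ-f (λ e → α≢β k kd (sym (trans (seg-injR e) (gamEnd-α {k} eL))))) (sym (cong not eL))
      ... | true | inj₂ (eR , _) = trans (segEqᵇ-t (cong (λ z → seg z (w' k)) (sym (gamEnd-β {k} eR)))) (sym (cong not eR))
      ... | false | inj₁ (eL , _) = trans (segEqᵇ-t (cong (λ z → seg z (w' k)) (sym (gamEnd-α {k} eL)))) (sym eL)
      ... | false | inj₂ (eR , _) = trans (segEqᵇ-f (λ e → α≢β k kd (trans (seg-injR e) (gamEnd-β {k} eR)))) (sym eR)

  X Y : ℕ → ℕ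
  X k = proj₁ (pos k)
  Y k = proj₂ (pos k)

  posN : ∀ k → suc k < d → gluedNorth k ≡ true → pos (suc k) ≡ (X k , suc (Y k))
  posN k skd g = cong (λ b → if b then (X k , suc (Y k)) else (suc (X k) , Y k)) (trans (glueNorth≡gluedNorth k skd) g)
  posE : ∀ k → suc k < d → gluedNorth k ≡ false → pos (suc k) ≡ (suc (X k) , Y k)
  posE k skd g = cong (λ b → if b then (X k , suc (Y k)) else (suc (X k) , Y k)) (trans (glueNorth≡gluedNorth k skd) g)

  pos-level : ∀ k → X k + Y k ≡ k
  pos-level zero = refl
  pos-level (suc k) with glueNorth k
  ... | true = trans (+-suc (X k) (Y k)) (cong suc (pos-level k))
  ... | false = cong suc (pos-level k)

  pos-injective : ∀ k l → pos k ≡ pos l → k ≡ l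
  pos-injective k l e = trans (sym (pos-level k)) (trans (cong (λ z → proj₁ z + proj₂ z) e) (pos-level l))

  srB : Bool → Side → Role
  srB b South = if b then RWa else RWb
  srB b West = if b then RWb else RWa
  srB b East = if b then RAw else RBw
  srB b North = if b then RBw else RAw

  sideRole≡ : ∀ k s → sideRole k s ≡ srB (isEven k) s
  sideRole≡ k South = refl
  sideRole≡ k West = refl
  sideRole≡ k East = refl
  sideRole≡ k North = refl

  srB-inj : ∀ b s s' → srB b s ≡ srB b s' → s ≡ s'
  srB-inj true South South _ = refl
  srB-inj true South West ()
  srB-inj true South East ()
  srB-inj true South North ()
  srB-inj true West South ()
  srB-inj true West West _ = refl
  srB-inj true West East ()
  srB-inj true West North ()
  srB-inj true East South ()
  srB-inj true East West ()
  srB-inj true East East _ = refl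
  srB-inj true East North ()
  srB-inj true North South ()
  srB-inj true North West ()
  srB-inj true North East ()
  srB-inj true North North _ = refl
  srB-inj false South South _ = refl
  srB-inj false South West ()
  srB-inj false South East ()
  srB-inj false South North ()
  srB-inj false West South ()
  srB-inj false West West _ = refl
  srB-inj false West East ()
  srB-inj false West North ()
  srB-inj false East South ()
  srB-inj false East West ()
  srB-inj false East East _ = refl
  srB-inj false East North ()
  srB-inj false North South ()
  srB-inj false North West ()
  srB-inj false North East ()
  srB-inj false North North _ = refl

  sideRole-inj : ∀ k s s' → sideRole k s ≡ sideRole k s' → s ≡ s'
  sideRole-inj k s s' e = srB-inj (isEven k) s s' (trans (sym (sideRole≡ k s)) (trans e (sideRole≡ k s')))

  labelOf : ∀ k → k < d → ∀ s → label k s ≡ descSeg (roleDesc k (sideRole k s))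
  labelOf k kd s = trans (labelRole k kd s) (proj₁ (roleDesc-correct k kd (sideRole k s)))
  validOf : ∀ k → k < d → ∀ s → ValidDesc (roleDesc k (sideRole k s))
  validOf k kd s = proj₂ (roleDesc-correct k kd (sideRole k s))

  TauUp TauDn GUp GDn : ℕ → Side
  TauUp k = if gluedNorth k then East else North
  TauDn j = if gluedNorth j then West else South
  GUp j = if gluedNorth j then North else East
  GDn j = if gluedNorth j then South else West

  up : Side → Bool
  up North = true
  up East = true
  up South = false
  up West = false

  invPA : ∀ k r → roleDesc k r ≡ PA → k ≡ 0 × r ≡ RWa
  invPA k RAw e with suc k ≡ᵇ d | onαSide k
  invPA k RAw () | true | _
  invPA k RAw () | false | true
  invPA k RAw () | false | false
  invPA k RBw e with suc k ≡ᵇ d | onαSide k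
  invPA k RBw () | true | _
  invPA k RBw () | false | true
  invPA k RBw () | false | false
  invPA zero RWa e = refl , refl
  invPA (suc i) RWa e with onαSide i
  invPA (suc i) RWa () | true
  invPA (suc i) RWa () | false
  invPA zero RWb ()
  invPA (suc i) RWb e with onαSide i
  invPA (suc i) RWb () | true
  invPA (suc i) RWb () | false

  invPB : ∀ k r → roleDesc k r ≡ PB → k ≡ 0 × r ≡ RWb
  invPB k RAw e with suc k ≡ᵇ d | onαSide k
  invPB k RAw () | true | _
  invPB k RAw () | false | true
  invPB k RAw () | false | false
  invPB k RBw e with suc k ≡ᵇ d | onαSide k
  invPB k RBw () | true | _
  invPB k RBw () | false | true
  invPB k RBw () | false | false
  invPB zero RWa ()
  invPB (suc i) RWa e with onαSide i
  invPB (suc i) RWa () | true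
  invPB (suc i) RWa () | false
  invPB zero RWb e = refl , refl
  invPB (suc i) RWb e with onαSide i
  invPB (suc i) RWb () | true
  invPB (suc i) RWb () | false

  invQA : ∀ k r → roleDesc k r ≡ QA → suc k ≡ d × r ≡ RAw
  invQA k RAw e with suc k ≡ᵇ d in el | onαSide k
  ... | true | _ = ≡ᵇ-t⇒ el , refl
  invQA k RAw () | false | true
  invQA k RAw () | false | false
  invQA k RBw e with suc k ≡ᵇ d | onαSide k
  invQA k RBw () | true | _
  invQA k RBw () | false | true
  invQA k RBw () | false | false
  invQA zero RWa ()
  invQA (suc i) RWa e with onαSide i
  invQA (suc i) RWa () | true
  invQA (suc i) RWa () | false
  invQA zero RWb ()
  invQA (suc i) RWb e with onαSide i
  invQA (suc i) RWb () | true
  invQA (suc i) RWb () | false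

  invQB : ∀ k r → roleDesc k r ≡ QB → suc k ≡ d × r ≡ RBw
  invQB k RBw e with suc k ≡ᵇ d in el | onαSide k
  ... | true | _ = ≡ᵇ-t⇒ el , refl
  invQB k RBw () | false | true
  invQB k RBw () | false | false
  invQB k RAw e with suc k ≡ᵇ d | onαSide k
  invQB k RAw () | true | _
  invQB k RAw () | false | true
  invQB k RAw () | false | false
  invQB zero RWa ()
  invQB (suc i) RWa e with onαSide i
  invQB (suc i) RWa () | true
  invQB (suc i) RWa () | false
  invQB zero RWb ()
  invQB (suc i) RWb e with onαSide i
  invQB (suc i) RWb () | true
  invQB (suc i) RWb () | false

  cgB : ∀ {b : Bool} {r1 r2 : Role} → b ≡ true → r1 ≡ (if b then r1 else r2)
  cgB refl = refl
  cgF : ∀ {b : Bool} {r1 r2 : Role} → b ≡ false → r2 ≡ (if b then r1 else r2)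
  cgF refl = refl

  invTau : ∀ k r j → roleDesc k r ≡ Tau j → (suc k ≡ j × r ≡ (if onαSide k then RBw else RAw)) ⊎ (k ≡ suc j × r ≡ (if onαSide j then RWb else RWa))
  invTau k RAw j e with suc k ≡ᵇ d | onαSide k in eb
  invTau k RAw j () | true | _
  invTau k RAw j () | false | true
  invTau k RAw j refl | false | false = inj₁ (refl , refl)
  invTau k RBw j e with suc k ≡ᵇ d | onαSide k in eb
  invTau k RBw j () | true | _
  invTau k RBw j refl | false | true = inj₁ (refl , refl)
  invTau k RBw j () | false | false
  invTau zero RWa j ()
  invTau (suc i) RWa j e with onαSide i in eb
  invTau (suc i) RWa j () | true
  invTau (suc i) RWa j refl | false = inj₂ (refl , cgF eb)
  invTau zero RWb j ()
  invTau (suc i) RWb j e with onαSide i in eb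
  invTau (suc i) RWb j refl | true = inj₂ (refl , cgB eb)
  invTau (suc i) RWb j () | false

  invG : ∀ k r j → roleDesc k r ≡ G j → (k ≡ j × r ≡ (if onαSide j then RAw else RBw)) ⊎ (k ≡ suc j × r ≡ (if onαSide j then RWa else RWb))
  invG k RAw j e with suc k ≡ᵇ d | onαSide k in eb
  invG k RAw j () | true | _
  invG k RAw j refl | false | true = inj₁ (refl , cgB eb)
  invG k RAw j () | false | false
  invG k RBw j e with suc k ≡ᵇ d | onαSide k in eb
  invG k RBw j () | true | _
  invG k RBw j () | false | true
  invG k RBw j refl | false | false = inj₁ (refl , cgF eb)
  invG zero RWa j ()
  invG (suc i) RWa j e with onαSide i in eb
  invG (suc i) RWa j refl | true = inj₂ (refl , cgB eb)
  invG (suc i) RWa j () | false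
  invG zero RWb j ()
  invG (suc i) RWb j e with onαSide i in eb
  invG (suc i) RWb j () | true
  invG (suc i) RWb j refl | false = inj₂ (refl , cgF eb)

  QAs QBs : ℕ → Side
  QAs k = if isEven k then East else North
  QBs k = if isEven k then North else East

  srQA : ∀ k → sideRole k (QAs k) ≡ RAw
  srQA k = trans (sideRole≡ k (QAs k)) (h (isEven k))
    where h : ∀ b → srB b (if b then East else North) ≡ RAw
          h true = refl
          h false = refl
  srQB : ∀ k → sideRole k (QBs k) ≡ RBw
  srQB k = trans (sideRole≡ k (QBs k)) (h (isEven k))
    where h : ∀ b → srB b (if b then North else East) ≡ RBw
          h true = refl
          h false = refl
  srUpTau : ∀ k → sideRole k (TauUp k) ≡ (if onαSide k then RBw else RAw)
  srUpTau k = trans (sideRole≡ k (TauUp k)) (h (isEven k) (onαSide k))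
    where h : ∀ b l → srB b (if (if b then not l else l) then East else North) ≡ (if l then RBw else RAw)
          h true true = refl
          h true false = refl
          h false true = refl
          h false false = refl
  srDnTau : ∀ j → sideRole (suc j) (TauDn j) ≡ (if onαSide j then RWb else RWa)
  srDnTau j = trans (sideRole≡ (suc j) (TauDn j)) (h (isEven j) (onαSide j))
    where h : ∀ b l → srB (not b) (if (if b then not l else l) then West else South) ≡ (if l then RWb else RWa)
          h true true = refl
          h true false = refl
          h false true = refl
          h false false = refl
  srUpG : ∀ j → sideRole j (GUp j) ≡ (if onαSide j then RAw else RBw)
  srUpG j = trans (sideRole≡ j (GUp j)) (h (isEven j) (onαSide j))
    where h : ∀ b l → srB b (if (if b then not l else l) then North else East) ≡ (if l then RAw else RBw)
          h true true = refl
          h true false = refl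
          h false true = refl
          h false false = refl
  srDnG : ∀ j → sideRole (suc j) (GDn j) ≡ (if onαSide j then RWa else RWb)
  srDnG j = trans (sideRole≡ (suc j) (GDn j)) (h (isEven j) (onαSide j))
    where h : ∀ b l → srB (not b) (if (if b then not l else l) then South else West) ≡ (if l then RWa else RWb)
          h true true = refl
          h true false = refl
          h false true = refl
          h false false = refl

  drOf : ∀ k s e → k < d → ValidDesc e → label k s ≡ descSeg e → roleDesc k (sideRole k s) ≡ e
  drOf k s e kd ve h = descSeg-injective (roleDesc k (sideRole k s)) e (validOf k kd s) ve (trans (sym (labelOf k kd s)) h)

  occPA : ∀ k s → k < d → label k s ≡ descSeg PA → k ≡ 0 × s ≡ South
  occPA k s kd h with invPA k (sideRole k s) (drOf k s PA kd tt h)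
  ... | refl , r = refl , sideRole-inj 0 s South r
  occPB : ∀ k s → k < d → label k s ≡ descSeg PB → k ≡ 0 × s ≡ West
  occPB k s kd h with invPB k (sideRole k s) (drOf k s PB kd tt h)
  ... | refl , r = refl , sideRole-inj 0 s West r
  occQA : ∀ k s → k < d → label k s ≡ descSeg QA → suc k ≡ d × s ≡ QAs k
  occQA k s kd h with invQA k (sideRole k s) (drOf k s QA kd tt h)
  ... | e , r = e , sideRole-inj k s (QAs k) (trans r (sym (srQA k)))
  occQB : ∀ k s → k < d → label k s ≡ descSeg QB → suc k ≡ d × s ≡ QBs k
  occQB k s kd h with invQB k (sideRole k s) (drOf k s QB kd tt h)
  ... | e , r = e , sideRole-inj k s (QBs k) (trans r (sym (srQB k)))
  occTau : ∀ k s j → k < d → j < d → label k s ≡ descSeg (Tau j) → (suc k ≡ j × s ≡ TauUp k) ⊎ (k ≡ suc j × s ≡ TauDn j)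
  occTau k s j kd jd h with invTau k (sideRole k s) j (drOf k s (Tau j) kd jd h)
  ... | inj₁ (e , r) = inj₁ (e , sideRole-inj k s (TauUp k) (trans r (sym (srUpTau k))))
  ... | inj₂ (refl , r) = inj₂ (refl , sideRole-inj (suc j) s (TauDn j) (trans r (sym (srDnTau j))))
  occG : ∀ k s j → k < d → suc j < d → label k s ≡ descSeg (G j) → (k ≡ j × s ≡ GUp j) ⊎ (k ≡ suc j × s ≡ GDn j)
  occG k s j kd jd h with invG k (sideRole k s) j (drOf k s (G j) kd jd h)
  ... | inj₁ (refl , r) = inj₁ (refl , sideRole-inj j s (GUp j) (trans r (sym (srUpG j))))
  ... | inj₂ (refl , r) = inj₂ (refl , sideRole-inj (suc j) s (GDn j) (trans r (sym (srDnG j))))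

  notLastF : ∀ {k} → suc k < d → (suc k ≡ᵇ d) ≡ false
  notLastF skd = ≡ᵇ-f (<⇒≢ skd)

  labUpTau : ∀ k → suc k < d → label k (TauUp k) ≡ descSeg (Tau (suc k))
  labUpTau k skd = trans (labelOf k (suc<⇒< skd) (TauUp k)) (cong descSeg (trans (cong (roleDesc k) (srUpTau k)) core))
    where
      core : roleDesc k (if onαSide k then RBw else RAw) ≡ Tau (suc k)
      core = h (onαSide k) refl
        where h : ∀ b → onαSide k ≡ b → roleDesc k (if b then RBw else RAw) ≡ Tau (suc k)
              h true e rewrite notLastF skd | e = refl
              h false e rewrite notLastF skd | e = refl
  labDnTau : ∀ j → suc j < d → label (suc j) (TauDn j) ≡ descSeg (Tau j)
  labDnTau j sjd = trans (labelOf (suc j) sjd (TauDn j)) (cong descSeg (trans (cong (roleDesc (suc j)) (srDnTau j)) core))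
    where
      core : roleDesc (suc j) (if onαSide j then RWb else RWa) ≡ Tau j
      core = h (onαSide j) refl
        where h : ∀ b → onαSide j ≡ b → roleDesc (suc j) (if b then RWb else RWa) ≡ Tau j
              h true e rewrite e = refl
              h false e rewrite e = refl
  labUpG : ∀ j → suc j < d → label j (GUp j) ≡ descSeg (G j)
  labUpG j sjd = trans (labelOf j (suc<⇒< sjd) (GUp j)) (cong descSeg (trans (cong (roleDesc j) (srUpG j)) core))
    where
      core : roleDesc j (if onαSide j then RAw else RBw) ≡ G j
      core = h (onαSide j) refl
        where h : ∀ b → onαSide j ≡ b → roleDesc j (if b then RAw else RBw) ≡ G j
              h true e rewrite notLastF sjd | e = refl
              h false e rewrite notLastF sjd | e = refl
  labPA : label 0 South ≡ descSeg PA
  labPA = labelOf 0 d>0 South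
  labPB : label 0 West ≡ descSeg PB
  labPB = labelOf 0 d>0 West

  tsAt : Side → Pt → USeg
  tsAt South (x , y) = H , x , y
  tsAt North (x , y) = H , x , suc y
  tsAt West (x , y) = V , x , y
  tsAt East (x , y) = V , suc x , y

  glue : ∀ k → suc k < d → tileSide (suc k) (GDn k) ≡ tileSide k (GUp k)
  glue k skd with gluedNorth k in g
  ... | true = cong (tsAt South) (posN k skd g)
  ... | false = cong (tsAt West) (posE k skd g)

  lvlU : USeg → ℕ
  lvlU (_ , a , b) = a + b

  lvlTS : ∀ k s → lvlU (tileSide k s) ≡ (if up s then suc k else k)
  lvlTS k South = pos-level k
  lvlTS k West = pos-level k
  lvlTS k North = trans (+-suc (X k) (Y k)) (cong suc (pos-level k))
  lvlTS k East = cong suc (pos-level k)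

  sideLvl : ∀ l s' e → tileSide l s' ≡ e → lvlU e ≡ (if up s' then suc l else l)
  sideLvl l s' e eq = trans (cong lvlU (sym eq)) (lvlTS l s')

  upTauUp : ∀ k → up (TauUp k) ≡ true
  upTauUp k with gluedNorth k
  ... | true = refl
  ... | false = refl
  upTauDn : ∀ j → up (TauDn j) ≡ false
  upTauDn j with gluedNorth j
  ... | true = refl
  ... | false = refl

  lvlUp : ∀ k → lvlU (tileSide k (TauUp k)) ≡ suc k
  lvlUp k = trans (lvlTS k (TauUp k)) (cong (λ b → if b then suc k else k) (upTauUp k))
  lvlDn : ∀ j → lvlU (tileSide (suc j) (TauDn j)) ≡ suc j
  lvlDn j = trans (lvlTS (suc j) (TauDn j)) (cong (λ b → if b then suc (suc j) else suc j) (upTauDn j))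

  n≢sn : ∀ {a} → a ≢ suc a
  n≢sn ()

  xyInj : ∀ {D D' : Dir} {a b a' b' : ℕ} → (D , a , b) ≡ (D' , a' , b') → D ≡ D' × a ≡ a' × b ≡ b'
  xyInj refl = refl , refl , refl

  noUpS : ∀ k → suc k < d → tileSide (suc k) South ≢ tileSide k (TauUp k)
  noUpS k skd e with gluedNorth k in g
  ... | true with proj₁ (xyInj e)
  ... | ()
  noUpS k skd e | false = n≢sn (sym (proj₁ (proj₂ (xyInj (trans (sym (cong (tsAt South) (posE k skd g))) e)))))
  noUpW : ∀ k → suc k < d → tileSide (suc k) West ≢ tileSide k (TauUp k)
  noUpW k skd e with gluedNorth k in g
  ... | true = n≢sn (proj₁ (proj₂ (xyInj (trans (sym (cong (tsAt West) (posN k skd g))) e))))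
  ... | false with proj₁ (xyInj e)
  ... | ()

  noDnN : ∀ j → suc j < d → tileSide j North ≢ tileSide (suc j) (TauDn j)
  noDnN j sjd e with gluedNorth j in g
  ... | true with proj₁ (xyInj e)
  ... | ()
  noDnN j sjd e | false = n≢sn (proj₁ (proj₂ (xyInj (trans e (cong (tsAt South) (posE j sjd g))))))
  noDnE : ∀ j → suc j < d → tileSide j East ≢ tileSide (suc j) (TauDn j)
  noDnE j sjd e with gluedNorth j in g
  ... | true = n≢sn (sym (proj₁ (proj₂ (xyInj (trans e (cong (tsAt West) (posN j sjd g)))))))
  ... | false with proj₁ (xyInj e)
  ... | ()

  extUp : ∀ k → suc k < d → ∀ l → SideOf l (tileSide k (TauUp k)) → l ≡ k
  extUp k skd l (ld , North , eq) = suc-injective (trans (sym (sideLvl l North _ eq)) (lvlUp k))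
  extUp k skd l (ld , East , eq) = suc-injective (trans (sym (sideLvl l East _ eq)) (lvlUp k))
  extUp k skd l (ld , South , eq) with trans (sym (sideLvl l South _ eq)) (lvlUp k)
  ... | refl = ⊥-elim (noUpS k skd eq)
  extUp k skd l (ld , West , eq) with trans (sym (sideLvl l West _ eq)) (lvlUp k)
  ... | refl = ⊥-elim (noUpW k skd eq)

  extDn : ∀ j → suc j < d → ∀ l → SideOf l (tileSide (suc j) (TauDn j)) → l ≡ suc j
  extDn j sjd l (ld , South , eq) = trans (sym (sideLvl l South _ eq)) (lvlDn j)
  extDn j sjd l (ld , West , eq) = trans (sym (sideLvl l West _ eq)) (lvlDn j)
  extDn j sjd l (ld , North , eq) with suc-injective (trans (sym (sideLvl l North _ eq)) (lvlDn j))
  ... | refl = ⊥-elim (noDnN j sjd eq)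
  extDn j sjd l (ld , East , eq) with suc-injective (trans (sym (sideLvl l East _ eq)) (lvlDn j))
  ... | refl = ⊥-elim (noDnE j sjd eq)

  exterior-up : ∀ k → suc k < d → Exterior (tileSide k (TauUp k))
  exterior-up k skd = (k , suc<⇒< skd , TauUp k , refl) , λ { (a , b , ab , sa , sb) → ab (trans (extUp k skd a sa) (sym (extUp k skd b sb))) }
  exterior-down : ∀ j → suc j < d → Exterior (tileSide (suc j) (TauDn j))
  exterior-down j sjd = (suc j , sjd , TauDn j , refl) , λ { (a , b , ab , sa , sb) → ab (trans (extDn j sjd a sa) (sym (extDn j sjd b sb))) }

  interior-gam : ∀ j → suc j < d → Interior (tileSide j (GUp j))
  interior-gam j sjd = j , suc j , n≢sn , (suc<⇒< sjd , GUp j , refl) , (sjd , GDn j , glue j sjd)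

  Cor : Pt → Set
  Cor P = (Σ ℕ λ l → l < d × HorizAdj P (pos l)) × (Σ ℕ λ m → m < d × VertAdj P (pos m))

  straight-north : ∀ k → suc (suc k) < d → gluedNorth k ≡ true → gluedNorth (suc k) ≡ true →
                   Parallel (tileSide k East) (tileSide (suc (suc k)) West) ×
                   KnightNWSE (tileSide k East) (tileSide (suc (suc k)) West) × ¬ Corner (suc k)
  straight-north k ssd g0 g1 = proj₁ pk , proj₂ pk , subst (λ P → ¬ Cor P) (sym P1) nc
    where
      x = X k
      y = Y k
      sd = suc<⇒< ssd
      P1 : pos (suc k) ≡ (x , suc y)
      P1 = posN k sd g0
      P2 : pos (suc (suc k)) ≡ (x , suc (suc y))
      P2 = trans (posN (suc k) ssd g1) (cong (λ P → (proj₁ P , suc (proj₂ P))) P1)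
      pk : Parallel (V , suc x , y) (tsAt West (pos (suc (suc k)))) × KnightNWSE (V , suc x , y) (tsAt West (pos (suc (suc k))))
      pk = subst (λ P → Parallel (V , suc x , y) (tsAt West P) × KnightNWSE (V , suc x , y) (tsAt West P)) (sym P2)
             (refl , refl , inj₁ (+-comm x 1 , sym (+-comm y 2)))
      nc : ¬ Cor (x , suc y)
      nc ((l , ld , yeq , inj₁ xeq) , _) = n≢sn (trans yeq (cong proj₂ (trans (cong pos ll) P2)))
        where ll : l ≡ suc (suc k)
              ll = trans (sym (pos-level l)) (trans (cong₂ _+_ (sym xeq) (sym yeq)) (trans (cong suc (+-suc x y)) (cong (λ z → suc (suc z)) (pos-level k))))
      nc ((l , ld , yeq , inj₂ xeq) , _) = n≢sn (sym (trans yeq (cong proj₂ (cong pos ll))))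
        where ll : l ≡ k
              ll = suc-injective (trans (cong suc (sym (pos-level l))) (trans (cong₂ _+_ xeq (sym yeq)) (trans (+-suc x y) (cong suc (pos-level k)))))

  straight-east : ∀ k → suc (suc k) < d → gluedNorth k ≡ false → gluedNorth (suc k) ≡ false →
                  Parallel (tileSide k North) (tileSide (suc (suc k)) South) ×
                  KnightNWSE (tileSide k North) (tileSide (suc (suc k)) South) × ¬ Corner (suc k)
  straight-east k ssd g0 g1 = proj₁ pk , proj₂ pk , subst (λ P → ¬ Cor P) (sym P1) nc
    where
      x = X k
      y = Y k
      sd = suc<⇒< ssd
      P1 : pos (suc k) ≡ (suc x , y)
      P1 = posE k sd g0
      P2 : pos (suc (suc k)) ≡ (suc (suc x) , y)
      P2 = trans (posE (suc k) ssd g1) (cong (λ P → (suc (proj₁ P) , proj₂ P)) P1)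
      pk : Parallel (H , x , suc y) (tsAt South (pos (suc (suc k)))) × KnightNWSE (H , x , suc y) (tsAt South (pos (suc (suc k))))
      pk = subst (λ P → Parallel (H , x , suc y) (tsAt South P) × KnightNWSE (H , x , suc y) (tsAt South P)) (sym P2)
             (refl , refl , inj₂ (inj₂ (inj₂ (sym (+-comm x 2) , +-comm y 1))))
      nc : ¬ Cor (suc x , y)
      nc (_ , (m , md , xeq , inj₁ yeq)) = n≢sn (trans xeq (cong proj₁ (trans (cong pos ll) P2)))
        where ll : m ≡ suc (suc k)
              ll = trans (sym (pos-level m)) (trans (cong₂ _+_ (sym xeq) (sym yeq)) (trans (cong suc (+-suc x y)) (cong (λ z → suc (suc z)) (pos-level k))))
      nc (_ , (m , md , xeq , inj₂ yeq)) = n≢sn (sym (trans xeq (cong proj₁ (cong pos ll))))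
        where ll : m ≡ k
              ll = suc-injective (trans (cong suc (sym (pos-level m))) (trans (sym (+-suc (X m) (Y m))) (trans (cong₂ _+_ (sym xeq) yeq) (cong suc (pos-level k)))))

  turn-north-east : ∀ k → suc (suc k) < d → gluedNorth k ≡ true → gluedNorth (suc k) ≡ false →
                    Perpendicular (tileSide k East) (tileSide (suc (suc k)) South) ×
                    ShareVertex (tileSide k East) (tileSide (suc (suc k)) South) × Corner (suc k)
  turn-north-east k ssd g0 g1 = proj₁ pk , proj₂ pk , subst Cor (sym P1) cr
    where
      x = X k
      y = Y k
      sd = suc<⇒< ssd
      P1 : pos (suc k) ≡ (x , suc y)
      P1 = posN k sd g0
      P2 : pos (suc (suc k)) ≡ (suc x , suc y)
      P2 = trans (posE (suc k) ssd g1) (cong (λ P → (suc (proj₁ P) , proj₂ P)) P1)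
      pk : Perpendicular (V , suc x , y) (tsAt South (pos (suc (suc k)))) × ShareVertex (V , suc x , y) (tsAt South (pos (suc (suc k))))
      pk = subst (λ P → Perpendicular (V , suc x , y) (tsAt South P) × ShareVertex (V , suc x , y) (tsAt South P)) (sym P2)
             ((λ ()) , ((suc x , suc y) , inj₂ refl , inj₁ refl))
      cr : Cor (x , suc y)
      cr = (suc (suc k) , ssd , sym (cong proj₂ P2) , inj₁ (sym (cong proj₁ P2))) , (k , <-trans (n<1+n k) sd , refl , inj₂ refl)

  turn-east-north : ∀ k → suc (suc k) < d → gluedNorth k ≡ false → gluedNorth (suc k) ≡ true →
                    Perpendicular (tileSide k North) (tileSide (suc (suc k)) West) ×
                    ShareVertex (tileSide k North) (tileSide (suc (suc k)) West) × Corner (suc k)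
  turn-east-north k ssd g0 g1 = proj₁ pk , proj₂ pk , subst Cor (sym P1) cr
    where
      x = X k
      y = Y k
      sd = suc<⇒< ssd
      P1 : pos (suc k) ≡ (suc x , y)
      P1 = posE k sd g0
      P2 : pos (suc (suc k)) ≡ (suc x , suc y)
      P2 = trans (posN (suc k) ssd g1) (cong (λ P → (proj₁ P , suc (proj₂ P))) P1)
      pk : Perpendicular (H , x , suc y) (tsAt West (pos (suc (suc k)))) × ShareVertex (H , x , suc y) (tsAt West (pos (suc (suc k))))
      pk = subst (λ P → Perpendicular (H , x , suc y) (tsAt West P) × ShareVertex (H , x , suc y) (tsAt West P)) (sym P2)
             ((λ ()) , ((suc x , suc y) , inj₂ refl , inj₁ refl))
      cr : Cor (suc x , y)
      cr = (k , <-trans (n<1+n k) sd , refl , inj₂ refl) , (suc (suc k) , ssd , sym (cong proj₁ P2) , inj₁ (sym (cong proj₂ P2)))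

  balanced-geometry : ∀ k → suc (suc k) < d → gluedNorth k ≡ gluedNorth (suc k) →
            Parallel (tileSide k (TauUp k)) (tileSide (suc (suc k)) (TauDn (suc k))) ×
            KnightNWSE (tileSide k (TauUp k)) (tileSide (suc (suc k)) (TauDn (suc k))) ×
            ¬ Corner (suc k)
  balanced-geometry k ssd e with gluedNorth k in g0 | gluedNorth (suc k) in g1
  ... | true | true = straight-north k ssd g0 g1
  ... | false | false = straight-east k ssd g0 g1
  balanced-geometry k ssd () | true | false
  balanced-geometry k ssd () | false | true

  imbalanced-geometry : ∀ k → suc (suc k) < d → gluedNorth k ≢ gluedNorth (suc k) →
            Perpendicular (tileSide k (TauUp k)) (tileSide (suc (suc k)) (TauDn (suc k))) ×
            ShareVertex (tileSide k (TauUp k)) (tileSide (suc (suc k)) (TauDn (suc k))) ×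
            Corner (suc k)
  imbalanced-geometry k ssd ne with gluedNorth k in g0 | gluedNorth (suc k) in g1
  ... | true | false = turn-north-east k ssd g0 g1
  ... | false | true = turn-east-north k ssd g0 g1
  ... | true | true = ⊥-elim (ne refl)
  ... | false | false = ⊥-elim (ne refl)

gnEq : ∀ e a b → (if e then not a else a) ≡ (if not e then not b else b) → a ≢ b
gnEq true true true () refl
gnEq true false false () refl
gnEq false true true () refl
gnEq false false false () refl
gnEq true true false _ ()
gnEq true false true _ ()
gnEq false true false _ ()
gnEq false false true _ ()

gnNe : ∀ e a b → a ≢ b → (if e then not a else a) ≡ (if not e then not b else b)
gnNe true true true h = ⊥-elim (h refl)
gnNe true true false h = refl
gnNe true false true h = refl
gnNe true false false h = ⊥-elim (h refl)
gnNe false true true h = ⊥-elim (h refl)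
gnNe false true false h = refl
gnNe false false true h = refl
gnNe false false false h = ⊥-elim (h refl)

boolNe : ∀ {a b : Bool} → a ≢ b → (a ≡ true × b ≡ false) ⊎ (a ≡ false × b ≡ true)
boolNe {true} {true} h = ⊥-elim (h refl)
boolNe {true} {false} h = inj₁ (refl , refl)
boolNe {false} {true} h = inj₂ (refl , refl)
boolNe {false} {false} h = ⊥-elim (h refl)

module SnakeGraph {n : ℕ} {T : List Seg} {p q d : ℕ} {τ : ℕ → Seg} {w w' : ℕ → ℕ}
  (S : CrossingSetup n T p q d τ w w') where

  open TileGeometry S public

  ntW : ∀ b i → NotTau (drW b i) → b ≡ true
  ntW true _ _ = refl
  ntW false _ ()
  ntW' : ∀ b i → b ≡ true → NotTau (drW b i)
  ntW' true _ _ = tt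
  ntWb : ∀ b i → NotTau (drW' b i) → b ≡ false
  ntWb true _ ()
  ntWb false _ _ = refl
  ntWb' : ∀ b i → b ≡ false → NotTau (drW' b i)
  ntWb' false _ _ = tt
  ntA : ∀ b k → NotTau (drA false b k) → b ≡ true
  ntA true _ _ = refl
  ntA false _ ()
  ntA' : ∀ b k → b ≡ true → NotTau (drA false b k)
  ntA' true _ _ = tt
  ntB : ∀ b k → NotTau (drB false b k) → b ≡ false
  ntB true _ ()
  ntB false _ _ = refl
  ntB' : ∀ b k → b ≡ false → NotTau (drB false b k)
  ntB' false _ _ = tt

  ntOf : ∀ e → ValidDesc e → BdT' (descSeg e) → NotTau e
  ntOf PA _ _ = tt
  ntOf PB _ _ = tt
  ntOf QA _ _ = tt
  ntOf QB _ _ = tt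
  ntOf (Tau t) vt b = crossed-not-boundary t vt b
  ntOf (G t) _ _ = tt

  bdR→ : ∀ k r → k < d → BdT' (roleSeg k r) → NotTau (roleDesc k r)
  bdR→ k r kd b = ntOf (roleDesc k r) (proj₂ (roleDesc-correct k kd r)) (subst BdT' (proj₁ (roleDesc-correct k kd r)) b)
  →bdR : ∀ k r → k < d → NotTau (roleDesc k r) → BdT' (roleSeg k r)
  →bdR k r kd nt = subst BdT' (sym (proj₁ (roleDesc-correct k kd r))) (descriptor-boundary (roleDesc k r) (proj₂ (roleDesc-correct k kd r)) nt)

  module CrossedDiagonalEdges (i : ℕ) (ssd : suc (suc i) < d) where
    j = suc i
    jd = suc<⇒< ssd
    ntRWa : BdT' (roleSeg j RWa) → onαSide i ≡ true
    ntRWa b = ntW (onαSide i) i (bdR→ j RWa jd b)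
    ntRWb : BdT' (roleSeg j RWb) → onαSide i ≡ false
    ntRWb b = ntWb (onαSide i) i (bdR→ j RWb jd b)
    ntRAw : BdT' (roleSeg j RAw) → onαSide j ≡ true
    ntRAw b = ntA (onαSide j) j (subst (λ z → NotTau (drA z (onαSide j) j)) (notLastF ssd) (bdR→ j RAw jd b))
    ntRBw : BdT' (roleSeg j RBw) → onαSide j ≡ false
    ntRBw b = ntB (onαSide j) j (subst (λ z → NotTau (drB z (onαSide j) j)) (notLastF ssd) (bdR→ j RBw jd b))
    bRWa : onαSide i ≡ true → BdT' (roleSeg j RWa)
    bRWa e = →bdR j RWa jd (ntW' (onαSide i) i e)
    bRWb : onαSide i ≡ false → BdT' (roleSeg j RWb)
    bRWb e = →bdR j RWb jd (ntWb' (onαSide i) i e)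
    bRAw : onαSide j ≡ true → BdT' (roleSeg j RAw)
    bRAw e = →bdR j RAw jd (subst (λ z → NotTau (drA z (onαSide j) j)) (sym (notLastF ssd)) (ntA' (onαSide j) j e))
    bRBw : onαSide j ≡ false → BdT' (roleSeg j RBw)
    bRBw e = →bdR j RBw jd (subst (λ z → NotTau (drB z (onαSide j) j)) (sym (notLastF ssd)) (ntB' (onαSide j) j e))

    a = proj₁ (τ j)
    b = proj₂ (τ j)

    balanced⇒onαSide-differs : Balanced j → onαSide i ≢ onαSide j
    balanced⇒onαSide-differs B with ends (τ j) (vs j jd)
    balanced⇒onαSide-differs (inj₁ (x , y)) | inj₁ (e1 , e2) = neq (ntRWa (subst BdT' (trans (cong (λ z → seg z (w j)) (sym e1)) (seg-sym (α j) (w j))) x)) (ntRBw (subst BdT' (cong (λ z → seg z (w' j)) (sym e2)) y))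
      where neq : onαSide i ≡ true → onαSide j ≡ false → onαSide i ≢ onαSide j
            neq u v z = t≢f (trans (sym u) (trans z v))
    balanced⇒onαSide-differs (inj₂ (x , y)) | inj₁ (e1 , e2) = neq (ntRWb (subst BdT' (cong (seg (w j)) (sym e2)) x)) (ntRAw (subst BdT' (trans (cong (seg (w' j)) (sym e1)) (seg-sym (w' j) (α j))) y))
      where neq : onαSide i ≡ false → onαSide j ≡ true → onαSide i ≢ onαSide j
            neq u v z = t≢f (trans (sym v) (trans (sym z) u))
    balanced⇒onαSide-differs (inj₁ (x , y)) | inj₂ (e1 , e2) = neq (ntRWb (subst BdT' (trans (cong (λ z → seg z (w j)) (sym e2)) (seg-sym (β j) (w j))) x)) (ntRAw (subst BdT' (cong (λ z → seg z (w' j)) (sym e1)) y))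
      where neq : onαSide i ≡ false → onαSide j ≡ true → onαSide i ≢ onαSide j
            neq u v z = t≢f (trans (sym v) (trans (sym z) u))
    balanced⇒onαSide-differs (inj₂ (x , y)) | inj₂ (e1 , e2) = neq (ntRWa (subst BdT' (cong (seg (w j)) (sym e1)) x)) (ntRBw (subst BdT' (trans (cong (seg (w' j)) (sym e2)) (seg-sym (w' j) (β j))) y))
      where neq : onαSide i ≡ true → onαSide j ≡ false → onαSide i ≢ onαSide j
            neq u v z = t≢f (trans (sym u) (trans z v))

    onαSide-differs⇒balanced : onαSide i ≢ onαSide j → Balanced j
    onαSide-differs⇒balanced ne with ends (τ j) (vs j jd) | boolNe ne
    ... | inj₁ (e1 , e2) | inj₁ (u , v) = inj₁ (subst BdT' (sym (trans (cong (λ z → seg z (w j)) (sym e1)) (seg-sym (α j) (w j)))) (bRWa u) , subst BdT' (sym (cong (λ z → seg z (w' j)) (sym e2))) (bRBw v))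
    ... | inj₁ (e1 , e2) | inj₂ (u , v) = inj₂ (subst BdT' (sym (cong (seg (w j)) (sym e2))) (bRWb u) , subst BdT' (sym (trans (cong (seg (w' j)) (sym e1)) (seg-sym (w' j) (α j)))) (bRAw v))
    ... | inj₂ (e1 , e2) | inj₁ (u , v) = inj₂ (subst BdT' (sym (cong (seg (w j)) (sym e1))) (bRWa u) , subst BdT' (sym (trans (cong (seg (w' j)) (sym e2)) (seg-sym (w' j) (β j)))) (bRBw v))
    ... | inj₂ (e1 , e2) | inj₂ (u , v) = inj₁ (subst BdT' (sym (trans (cong (λ z → seg z (w j)) (sym e2)) (seg-sym (β j) (w j)))) (bRWb u) , subst BdT' (sym (cong (λ z → seg z (w' j)) (sym e1))) (bRAw v))

    balanced⇒glue-same : Balanced j → gluedNorth i ≡ gluedNorth j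
    balanced⇒glue-same B = gnNe (isEven i) (onαSide i) (onαSide j) (balanced⇒onαSide-differs B)
    imbalanced⇒glue-differs : ¬ Balanced j → gluedNorth i ≢ gluedNorth j
    imbalanced⇒glue-differs nb e = nb (onαSide-differs⇒balanced (gnEq (isEven i) (onαSide i) (onαSide j) e))

    e₁ = tileSide i (TauUp i)
    e₂ = tileSide (suc j) (TauDn j)
    e₁≢e₂ : e₁ ≢ e₂
    e₁≢e₂ e = n≢sn (trans (sym (lvlUp i)) (trans (cong lvlU e) (lvlDn j)))
    τjD : τ j ≡ descSeg (Tau j)
    τjD = τseg j jd
    lo₂ : LabelOnlyOn₂ (τ j) e₁ e₂
    lo₂ = e₁≢e₂ , λ g → to g , fro g
      where
        to : ∀ g → HasLabel g (τ j) → g ≡ e₁ ⊎ g ≡ e₂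
        to g (k , kd , s , ts , lab) with occTau k s j kd jd (trans lab τjD)
        ... | inj₁ (refl , refl) = inj₁ (sym ts)
        ... | inj₂ (refl , refl) = inj₂ (sym ts)
        fro : ∀ g → g ≡ e₁ ⊎ g ≡ e₂ → HasLabel g (τ j)
        fro g (inj₁ refl) = i , <-trans (n<1+n i) jd , TauUp i , refl , trans (labUpTau i jd) (sym τjD)
        fro g (inj₂ refl) = suc j , ssd , TauDn j , refl , trans (labDnTau j ssd) (sym τjD)
    s₁ : SideOf i e₁
    s₁ = <-trans (n<1+n i) jd , TauUp i , refl
    s₂ : SideOf (i + 2) e₂
    s₂ = subst (λ z → SideOf z e₂) (sym (+-comm i 2)) (ssd , TauDn j , refl)

  balanced-diagonal-edges : ∀ j → 0 < j → suc j < d → Balanced j →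
       Σ USeg λ e₁ → Σ USeg λ e₂ → Σ ℕ λ k →
         LabelOnlyOn₂ (τ j) e₁ e₂ × Exterior e₁ × Exterior e₂ ×
         Parallel e₁ e₂ × KnightNWSE e₁ e₂ ×
         SideOf k e₁ × SideOf (k + 2) e₂ × ¬ Corner (suc k)
  balanced-diagonal-edges (suc i) _ ssd B = CrossedDiagonalEdges.e₁ i ssd , CrossedDiagonalEdges.e₂ i ssd , i , CrossedDiagonalEdges.lo₂ i ssd , exterior-up i (suc<⇒< ssd) , exterior-down (suc i) ssd ,
      proj₁ Gm , proj₁ (proj₂ Gm) , CrossedDiagonalEdges.s₁ i ssd , CrossedDiagonalEdges.s₂ i ssd , proj₂ (proj₂ Gm)
    where Gm = balanced-geometry i ssd (CrossedDiagonalEdges.balanced⇒glue-same i ssd B)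

  imbalanced-diagonal-edges : ∀ j → 0 < j → suc j < d → ¬ Balanced j →
       Σ USeg λ e₁ → Σ USeg λ e₂ → Σ ℕ λ k →
         LabelOnlyOn₂ (τ j) e₁ e₂ × Exterior e₁ × Exterior e₂ ×
         Perpendicular e₁ e₂ × ShareVertex e₁ e₂ ×
         SideOf k e₁ × SideOf (k + 2) e₂ × Corner (suc k)
  imbalanced-diagonal-edges (suc i) _ ssd NB = CrossedDiagonalEdges.e₁ i ssd , CrossedDiagonalEdges.e₂ i ssd , i , CrossedDiagonalEdges.lo₂ i ssd , exterior-up i (suc<⇒< ssd) , exterior-down (suc i) ssd ,
      proj₁ Gm , proj₁ (proj₂ Gm) , CrossedDiagonalEdges.s₁ i ssd , CrossedDiagonalEdges.s₂ i ssd , proj₂ (proj₂ Gm)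
    where Gm = imbalanced-geometry i ssd (CrossedDiagonalEdges.imbalanced⇒glue-differs i ssd NB)

  ttCases : ∀ j → gamEnd j ≡ α j ⊎ gamEnd j ≡ β j
  ttCases j with onαSide j
  ... | true = inj₁ refl
  ... | false = inj₂ refl

  incP : ∀ e → ValidDesc e → NotTau e → isEnd (descSeg e) p ≡ true → e ≡ PA ⊎ e ≡ PB
  incP PA _ _ _ = inj₁ refl
  incP PB _ _ _ = inj₂ refl
  incP QA _ _ h with isEnd-seg {α l1} {q} h
  ... | inj₁ x = ⊥-elim (αp l1 l1d (sym x))
  ... | inj₂ x = ⊥-elim (p≢q x)
  incP QB _ _ h with isEnd-seg {β l1} {q} h
  ... | inj₁ x = ⊥-elim (βp l1 l1d (sym x))
  ... | inj₂ x = ⊥-elim (p≢q x)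
  incP (G j) sjd _ h with isEnd-seg {gamEnd j} {w' j} h | ttCases j
  ... | inj₂ x | _ = ⊥-elim (w'p j (suc<⇒< sjd) (sym x))
  ... | inj₁ x | inj₁ t = ⊥-elim (αp j (suc<⇒< sjd) (sym (trans x t)))
  ... | inj₁ x | inj₂ t = ⊥-elim (βp j (suc<⇒< sjd) (sym (trans x t)))

  incQ : ∀ e → ValidDesc e → NotTau e → isEnd (descSeg e) q ≡ true → e ≡ QA ⊎ e ≡ QB
  incQ QA _ _ _ = inj₁ refl
  incQ QB _ _ _ = inj₂ refl
  incQ PA _ _ h with isEnd-seg {p} {α 0} h
  ... | inj₁ x = ⊥-elim (p≢q (sym x))
  ... | inj₂ x = ⊥-elim (αq 0 d>0 (sym x))
  incQ PB _ _ h with isEnd-seg {p} {β 0} h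
  ... | inj₁ x = ⊥-elim (p≢q (sym x))
  ... | inj₂ x = ⊥-elim (βq 0 d>0 (sym x))
  incQ (G j) sjd _ h with isEnd-seg {gamEnd j} {w' j} h | ttCases j
  ... | inj₂ x | _ = ⊥-elim (w'≢q j sjd (sym x))
  ... | inj₁ x | inj₁ t = ⊥-elim (αq j (suc<⇒< sjd) (sym (trans x t)))
  ... | inj₁ x | inj₂ t = ⊥-elim (βq j (suc<⇒< sjd) (sym (trans x t)))

  boundary-segment-interior-edge : ∀ s → BdT' s → ¬ (isEnd s p ≡ true) → ¬ (isEnd s q ≡ true) → Σ USeg λ e → LabelOnlyOn s e × Interior e
  boundary-segment-interior-edge s b np' nq' with boundary-descriptor s b
  ... | PA , _ , _ , refl = ⊥-elim (np' (isEnd-sL {p} {α 0}))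
  ... | PB , _ , _ , refl = ⊥-elim (np' (isEnd-sL {p} {β 0}))
  ... | QA , _ , _ , refl = ⊥-elim (nq' (isEnd-sR {α l1} {q}))
  ... | QB , _ , _ , refl = ⊥-elim (nq' (isEnd-sR {β l1} {q}))
  ... | Tau _ , _ , () , _
  ... | G j , sjd , _ , refl = tileSide j (GUp j) , (λ f → to f , fro f) , interior-gam j sjd
    where
      to : ∀ f → HasLabel f (descSeg (G j)) → f ≡ tileSide j (GUp j)
      to f (k , kd , s' , ts , lab) with occG k s' j kd sjd lab
      ... | inj₁ (refl , refl) = sym ts
      ... | inj₂ (refl , refl) = trans (sym ts) (glue j sjd)
      fro : ∀ f → f ≡ tileSide j (GUp j) → HasLabel f (descSeg (G j))
      fro f refl = j , suc<⇒< sjd , GUp j , refl , labUpG j sjd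

  labelOnlyOn-single : ∀ K S0 → K < d → (∀ k s → k < d → label k s ≡ label K S0 → k ≡ K × s ≡ S0) → LabelOnlyOn (label K S0) (tileSide K S0)
  labelOnlyOn-single K S0 Kd occ f = to , fro
    where
      to : HasLabel f (label K S0) → f ≡ tileSide K S0
      to (k , kd , s , ts , lab) with occ k s kd lab
      ... | refl , refl = sym ts
      fro : f ≡ tileSide K S0 → HasLabel f (label K S0)
      fro refl = K , Kd , S0 , refl , refl

  uniqQA : ∀ K S0 → K < d → label K S0 ≡ descSeg QA → ∀ k s → k < d → label k s ≡ label K S0 → k ≡ K × s ≡ S0
  uniqQA K S0 Kd h k s kd lab with occQA k s kd (trans lab h) | occQA K S0 Kd h
  ... | e1 , s1 | e2 , s2 = kk , trans s1 (trans (cong QAs kk) (sym s2))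
    where kk = suc-injective (trans e1 (sym e2))
  uniqQB : ∀ K S0 → K < d → label K S0 ≡ descSeg QB → ∀ k s → k < d → label k s ≡ label K S0 → k ≡ K × s ≡ S0
  uniqQB K S0 Kd h k s kd lab with occQB k s kd (trans lab h) | occQB K S0 Kd h
  ... | e1 , s1 | e2 , s2 = kk , trans s1 (trans (cong QBs kk) (sym s2))
    where kk = suc-injective (trans e1 (sym e2))

  sl1 : suc l1 ≡ d
  sl1 = pr d>0
    where pr : ∀ {x} → 0 < x → suc (x ∸ 1) ≡ x
          pr {suc x} _ = refl

  lastA : roleDesc l1 RAw ≡ QA
  lastA rewrite ≡ᵇ-t sl1 = refl
  lastB : roleDesc l1 RBw ≡ QB
  lastB rewrite ≡ᵇ-t sl1 = refl

  labNE : (label l1 North ≡ descSeg QB × label l1 East ≡ descSeg QA) ⊎ (label l1 North ≡ descSeg QA × label l1 East ≡ descSeg QB)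
  labNE = h (isEven l1) refl
    where
      h : ∀ b → isEven l1 ≡ b → (label l1 North ≡ descSeg QB × label l1 East ≡ descSeg QA) ⊎ (label l1 North ≡ descSeg QA × label l1 East ≡ descSeg QB)
      h true e = inj₁ (trans (labelOf l1 l1d North) (trans (cong (λ z → descSeg (roleDesc l1 (if z then RBw else RAw))) e) (cong descSeg lastB)) ,
                       trans (labelOf l1 l1d East) (trans (cong (λ z → descSeg (roleDesc l1 (if z then RAw else RBw))) e) (cong descSeg lastA)))
      h false e = inj₂ (trans (labelOf l1 l1d North) (trans (cong (λ z → descSeg (roleDesc l1 (if z then RBw else RAw))) e) (cong descSeg lastA)) ,
                        trans (labelOf l1 l1d East) (trans (cong (λ z → descSeg (roleDesc l1 (if z then RAw else RBw))) e) (cong descSeg lastB)))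

  loQ : ∀ S0 → label l1 S0 ≡ descSeg QA ⊎ label l1 S0 ≡ descSeg QB → LabelOnlyOn (label l1 S0) (tileSide l1 S0)
  loQ S0 (inj₁ h) = labelOnlyOn-single l1 S0 l1d (uniqQA l1 S0 l1d h)
  loQ S0 (inj₂ h) = labelOnlyOn-single l1 S0 l1d (uniqQB l1 S0 l1d h)

  p-boundary-segments : ∀ s → (BdT' s × isEnd s p ≡ true → s ≡ label 0 South ⊎ s ≡ label 0 West)
                            × (s ≡ label 0 South ⊎ s ≡ label 0 West → BdT' s × isEnd s p ≡ true)
  p-boundary-segments s = to , fro
    where
      to : BdT' s × isEnd s p ≡ true → s ≡ label 0 South ⊎ s ≡ label 0 West
      to (b , ip) with boundary-descriptor s b
      ... | e , ve , nt , refl with incP e ve nt ip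
      ... | inj₁ refl = inj₁ (sym labPA)
      ... | inj₂ refl = inj₂ (sym labPB)
      fro : s ≡ label 0 South ⊎ s ≡ label 0 West → BdT' s × isEnd s p ≡ true
      fro (inj₁ refl) = subst (λ z → BdT' z × isEnd z p ≡ true) (sym labPA) (descriptor-boundary PA tt tt , isEnd-sL {p} {α 0})
      fro (inj₂ refl) = subst (λ z → BdT' z × isEnd z p ≡ true) (sym labPB) (descriptor-boundary PB tt tt , isEnd-sL {p} {β 0})

  last-north-at-q : label l1 North ≡ descSeg QA ⊎ label l1 North ≡ descSeg QB
  last-north-at-q with labNE
  ... | inj₁ (x , _) = inj₂ x
  ... | inj₂ (x , _) = inj₁ x

  last-east-at-q : label l1 East ≡ descSeg QA ⊎ label l1 East ≡ descSeg QB
  last-east-at-q with labNE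
  ... | inj₁ (_ , y) = inj₁ y
  ... | inj₂ (_ , y) = inj₂ y

  q-boundary-segments : ∀ s → (BdT' s × isEnd s q ≡ true → s ≡ label l1 North ⊎ s ≡ label l1 East)
                            × (s ≡ label l1 North ⊎ s ≡ label l1 East → BdT' s × isEnd s q ≡ true)
  q-boundary-segments s = to , fro
    where
      to : BdT' s × isEnd s q ≡ true → s ≡ label l1 North ⊎ s ≡ label l1 East
      to (b , iq) with boundary-descriptor s b
      ... | e , ve , nt , refl with incQ e ve nt iq | labNE
      ... | inj₁ refl | inj₁ (_ , y) = inj₂ (sym y)
      ... | inj₁ refl | inj₂ (x , _) = inj₁ (sym x)
      ... | inj₂ refl | inj₁ (x , _) = inj₁ (sym x)
      ... | inj₂ refl | inj₂ (_ , y) = inj₂ (sym y)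
      at-q : s ≡ descSeg QA ⊎ s ≡ descSeg QB → BdT' s × isEnd s q ≡ true
      at-q (inj₁ refl) = descriptor-boundary QA tt tt , isEnd-sR {α l1} {q}
      at-q (inj₂ refl) = descriptor-boundary QB tt tt , isEnd-sR {β l1} {q}
      fro : s ≡ label l1 North ⊎ s ≡ label l1 East → BdT' s × isEnd s q ≡ true
      fro (inj₁ e) with last-north-at-q
      ... | inj₁ x = at-q (inj₁ (trans e x))
      ... | inj₂ x = at-q (inj₂ (trans e x))
      fro (inj₂ e) with last-east-at-q
      ... | inj₁ x = at-q (inj₁ (trans e x))
      ... | inj₂ x = at-q (inj₂ (trans e x))

  end-segments-first-last-tile : ((∀ s → (BdT' s × isEnd s p ≡ true → s ≡ label 0 South ⊎ s ≡ label 0 West)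
            × (s ≡ label 0 South ⊎ s ≡ label 0 West → BdT' s × isEnd s p ≡ true))
     × LabelOnlyOn (label 0 South) (tileSide 0 South)
     × LabelOnlyOn (label 0 West) (tileSide 0 West)
     × (∀ s → (BdT' s × isEnd s q ≡ true → s ≡ label (d ∸ 1) North ⊎ s ≡ label (d ∸ 1) East)
            × (s ≡ label (d ∸ 1) North ⊎ s ≡ label (d ∸ 1) East → BdT' s × isEnd s q ≡ true))
     × LabelOnlyOn (label (d ∸ 1) North) (tileSide (d ∸ 1) North)
     × LabelOnlyOn (label (d ∸ 1) East) (tileSide (d ∸ 1) East))
  end-segments-first-last-tile =
    p-boundary-segments ,
    labelOnlyOn-single 0 South d>0 (λ k s kd lab → occPA k s kd (trans lab labPA)) ,
    labelOnlyOn-single 0 West d>0 (λ k s kd lab → occPB k s kd (trans lab labPB)) ,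
    q-boundary-segments ,
    loQ North last-north-at-q ,
    loQ East last-east-at-q

  d≡1⊎1<d : d ≡ 1 ⊎ 1 < d
  d≡1⊎1<d with <-cmp 1 d
  ... | tri< x _ _ = inj₂ x
  ... | tri≈ _ x _ = inj₁ (sym x)
  ... | tri> _ _ x = ⊥-elim (<⇒≱ d>0 (≤-pred x))

  quadrilateral-diagonal-unlabelled : sizeT' ≡ 4 → ∀ e → ¬ HasLabel e (τ 0)
  quadrilateral-diagonal-unlabelled s4 e (k , kd , s , ts , lab) with d≡1⊎1<d
  ... | inj₂ x = sizeT'-larger x s4
  ... | inj₁ d1 with occTau k s 0 kd d>0 (trans lab (τseg 0 d>0))
  ... | inj₁ (() , _)
  ... | inj₂ (refl , _) = n≮n _ (subst (1 <_) d1 kd)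

  first-diagonal-label : 1 < d → Σ USeg λ e → LabelOnlyOn (τ 0) e × Exterior e × (e ≡ tileSide 1 South ⊎ e ≡ tileSide 1 West)
  first-diagonal-label 1d = tileSide 1 (TauDn 0) , (λ f → to f , fro f) , exterior-down 0 1d , side
    where
      τ0D : τ 0 ≡ descSeg (Tau 0)
      τ0D = τseg 0 d>0
      to : ∀ f → HasLabel f (τ 0) → f ≡ tileSide 1 (TauDn 0)
      to f (k , kd , s , ts , lab) with occTau k s 0 kd d>0 (trans lab τ0D)
      ... | inj₁ (() , _)
      ... | inj₂ (refl , refl) = sym ts
      fro : ∀ f → f ≡ tileSide 1 (TauDn 0) → HasLabel f (τ 0)
      fro f refl = 1 , 1d , TauDn 0 , refl , trans (labDnTau 0 1d) (sym τ0D)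
      side : tileSide 1 (TauDn 0) ≡ tileSide 1 South ⊎ tileSide 1 (TauDn 0) ≡ tileSide 1 West
      side with gluedNorth 0
      ... | true = inj₂ refl
      ... | false = inj₁ refl

  last-diagonal-label : ∀ t → suc (suc t) ≡ d → Σ USeg λ e → LabelOnlyOn (τ (suc t)) e × Exterior e × (e ≡ tileSide t North ⊎ e ≡ tileSide t East)
  last-diagonal-label t et = tileSide t (TauUp t) , (λ f → to f , fro f) , exterior-up t std , side
    where
      std : suc t < d
      std = subst (suc t <_) et (n<1+n (suc t))
      tD : τ (suc t) ≡ descSeg (Tau (suc t))
      tD = τseg (suc t) std
      to : ∀ f → HasLabel f (τ (suc t)) → f ≡ tileSide t (TauUp t)
      to f (k , kd , s , ts , lab) with occTau k s (suc t) kd std (trans lab tD)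
      ... | inj₁ (refl , refl) = sym ts
      ... | inj₂ (refl , _) = ⊥-elim (n≮n _ (subst (_< d) et kd))
      fro : ∀ f → f ≡ tileSide t (TauUp t) → HasLabel f (τ (suc t))
      fro f refl = t , suc<⇒< std , TauUp t , refl , trans (labUpTau t std) (sym tD)
      side : tileSide t (TauUp t) ≡ tileSide t North ⊎ tileSide t (TauUp t) ≡ tileSide t East
      side with gluedNorth t
      ... | true = inj₂ refl
      ... | false = inj₁ refl

  end-diagonals-labels : ((sizeT' ≢ 4 →
        (Σ USeg λ e → LabelOnlyOn (τ 0) e × Exterior e ×
                      (e ≡ tileSide 1 South ⊎ e ≡ tileSide 1 West))
      × (Σ USeg λ e → LabelOnlyOn (τ (d ∸ 1)) e × Exterior e ×
                      (e ≡ tileSide (d ∸ 2) North ⊎ e ≡ tileSide (d ∸ 2) East)))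
     × (sizeT' ≡ 4 → ∀ e → ¬ HasLabel e (τ 0)))
  end-diagonals-labels = not-quadrilateral , quadrilateral-diagonal-unlabelled
    where
      last : ∀ {x} → 1 < x → x ≡ d → Σ USeg λ e → LabelOnlyOn (τ (x ∸ 1)) e × Exterior e × (e ≡ tileSide (x ∸ 2) North ⊎ e ≡ tileSide (x ∸ 2) East)
      last {suc (suc t)} _ e = last-diagonal-label t e
      last {suc zero} (s≤s ()) _
      not-quadrilateral : sizeT' ≢ 4 →
          (Σ USeg λ e → LabelOnlyOn (τ 0) e × Exterior e × (e ≡ tileSide 1 South ⊎ e ≡ tileSide 1 West))
        × (Σ USeg λ e → LabelOnlyOn (τ (d ∸ 1)) e × Exterior e × (e ≡ tileSide (d ∸ 2) North ⊎ e ≡ tileSide (d ∸ 2) East))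
      not-quadrilateral ns with d≡1⊎1<d
      ... | inj₁ d1 = ⊥-elim (ns (sizeT'-quadrilateral d1))
      ... | inj₂ 1d = first-diagonal-label 1d , last 1d refl

  tiles-distinct : ∀ k l → k < d → l < d → pos k ≡ pos l → k ≡ l
  tiles-distinct k l _ _ e = pos-injective k l e

lemma4p1 :
  ∀ (n : ℕ) (T : List Seg) (p q : ℕ) (d : ℕ) (τ : ℕ → Seg) (w w' : ℕ → ℕ) →
  3 ≤ n →
  Triangulation n T →
  Diagonal n (seg p q) →
  seg p q ∉ T →
  (∀ σ → σ ∈ T → Cross σ (seg p q) → Σ ℕ λ k → k < d × τ k ≡ σ) →
  (∀ k → k < d → τ k ∈ T × Cross (τ k) (seg p q)) →
  (∀ k l → l < d → k < l → Before p (τ k) (τ l)) →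
  (∀ k → k < d → Apex n T (τ k) (w k) × SameSide (τ k) (w k) p) →
  (∀ k → k < d → Apex n T (τ k) (w' k) × SameSide (τ k) (w' k) q) →
  let open Snake n T p q d τ w w' in
  -- (1) balanced interior diagonals
  (∀ j → 0 < j → suc j < d → Balanced j →
     Σ USeg λ e₁ → Σ USeg λ e₂ → Σ ℕ λ k →
       LabelOnlyOn₂ (τ j) e₁ e₂ × Exterior e₁ × Exterior e₂ ×
       Parallel e₁ e₂ × KnightNWSE e₁ e₂ ×
       SideOf k e₁ × SideOf (k + 2) e₂ × ¬ Corner (suc k))
  ×
  -- (2) imbalanced interior diagonals
  (∀ j → 0 < j → suc j < d → ¬ Balanced j →
     Σ USeg λ e₁ → Σ USeg λ e₂ → Σ ℕ λ k →
       LabelOnlyOn₂ (τ j) e₁ e₂ × Exterior e₁ × Exterior e₂ ×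
       Perpendicular e₁ e₂ × ShareVertex e₁ e₂ ×
       SideOf k e₁ × SideOf (k + 2) e₂ × Corner (suc k))
  ×
  -- (3) boundary segments of T' not incident to γ
  (∀ s → BdT' s → ¬ Incident s p → ¬ Incident s q →
     Σ USeg λ e → LabelOnlyOn s e × Interior e)
  ×
  -- (4) boundary segments of T' incident to p₀ and to p_{d+1}
  ((∀ s → (BdT' s × Incident s p → s ≡ label 0 South ⊎ s ≡ label 0 West)
        × (s ≡ label 0 South ⊎ s ≡ label 0 West → BdT' s × Incident s p))
   × LabelOnlyOn (label 0 South) (tileSide 0 South)
   × LabelOnlyOn (label 0 West) (tileSide 0 West)
   × (∀ s → (BdT' s × Incident s q → s ≡ label (d ∸ 1) North ⊎ s ≡ label (d ∸ 1) East)
          × (s ≡ label (d ∸ 1) North ⊎ s ≡ label (d ∸ 1) East → BdT' s × Incident s q))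
   × LabelOnlyOn (label (d ∸ 1) North) (tileSide (d ∸ 1) North)
   × LabelOnlyOn (label (d ∸ 1) East) (tileSide (d ∸ 1) East))
  ×
  -- (5) the first and last crossed diagonals
  ((sizeT' ≢ 4 →
      (Σ USeg λ e → LabelOnlyOn (τ 0) e × Exterior e ×
                    (e ≡ tileSide 1 South ⊎ e ≡ tileSide 1 West))
    × (Σ USeg λ e → LabelOnlyOn (τ (d ∸ 1)) e × Exterior e ×
                    (e ≡ tileSide (d ∸ 2) North ⊎ e ≡ tileSide (d ∸ 2) East)))
   × (sizeT' ≡ 4 → ∀ e → ¬ HasLabel e (τ 0)))
  ×
  -- (6) exactly d tiles (tiles 0,…,d-1 occupy pairwise distinct boxes)
  (∀ k l → k < d → l < d → pos k ≡ pos l → k ≡ l)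
lemma4p1 n T p q d τ w w' _ hT hγ hγT hcov hcr hbef hw hw' =
  balanced-diagonal-edges , imbalanced-diagonal-edges , boundary-segment-interior-edge ,
  end-segments-first-last-tile , end-diagonals-labels , tiles-distinct
  where
    setup : CrossingSetup n T p q d τ w w'
    setup = record
      { triangulation = hT ; γ-diagonal = hγ ; γ∉T = hγT ; crossed-complete = hcov
      ; crossed-in-T = hcr ; crossed-ordered = hbef ; p-apex = hw ; q-apex = hw' }
    open SnakeGraph setup
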